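{- Let $\Gamma$ be a $U$-context and $A$ a $U$-type in $\Gamma$ (with the types in $\Gamma$, $A$, and $M$ in the image of the reflection map). If $\Gamma \vdash_{\lambda{*}U} M : T A$, then $\Gamma^* \vdash_{\lambda{*}U{\approx}} M^* : \mathrm{Rel}\,A^*\,M\,M'$.
   Context: $\lambda{*}$ is the type-in-type pure type system with $\Sigma$-types: terms $* \mid x \mid \Pi x{:}A.B \mid \Sigma x{:}A.B \mid \lambda x{:}A.t \mid s\,t \mid (s,t) \mid \pi_1 t\mid\pi_2 t$, axiom $*:*$, the standard rules (variable, weakening, $\Pi$/$\Sigma$-formation, abstraction, application, pairing, projections, conversion), with conversion the untyped congruence generated by $(\lambda x{:}A.s)t=s[t/x]$ and $\pi_i(t_1,t_2)=t_i$. $\lambda{*}U$ extends it with an inductive–recursive universe: $U:*$ with constructors $\hat\Pi,\hat\Sigma : \Pi A{:}U.(TA\to U)\to U$, $\hat * : U$, and $T:U\to *$ with $T(\hat\Pi A B)=\Pi a{:}TA.T(Ba)$, $T(\hat\Sigma AB)=\Sigma a{:}TA.T(Ba)$, $T(\hat *)=U$. The reflection map sends $\lambda{*}$-terms to $\lambda{*}U$-terms by $\overline{*}=\hat *$, $\overline{x}=x$, $\overline{\Pi x{:}A.B}=\hat\Pi\,\overline{A}\,(\lambda x{:}T\overline{A}.\overline{B})$, similarly for $\Sigma$ with $\hat\Sigma$, and commuting with $\lambda$, application, pairing, projections. $\lambda{*}U{\approx}$ extends $\lambda{*}U$ by an indexed inductive–recursive definition of $\mathrm{Eq} : U\to U\to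 *$ together with $\mathrm{Rel} : \Pi\{A\,B : U\}.\ \mathrm{Eq}\,A\,B \to TA\to TB\to *$. Constructors: $\mathrm{refl}_{\hat *} : \mathrm{Eq}\,\hat *\,\hat *$; $\hat\Pi^* \{A\,A'{:}U\}\{B : TA\to U\}\{B':TA'\to U\}\,(A^* : \mathrm{Eq}\,A\,A')\,(B^* : \Pi a{:}TA\,\Pi a'{:}TA'\,\Pi a^*{:}\mathrm{Rel}\,A^*\,a\,a'.\ \mathrm{Eq}\,(Ba)\,(B'a')) : \mathrm{Eq}\,(\hat\Pi A B)\,(\hat\Pi A' B')$; and $\hat\Sigma^*$ with the same arguments into $\mathrm{Eq}\,(\hat\Sigma AB)\,(\hat\Sigma A'B')$. Equations: $\mathrm{Rel}\,\mathrm{refl}_{\hat *}\,A\,B = \mathrm{Eq}\,A\,B$; $\mathrm{Rel}\,(\hat\Pi^* A^* B^*)\,f\,f' = \Pi x{:}TA\,\Pi x'{:}TA'\,\Pi x^*{:}\mathrm{Rel}\,A^*\,x\,x'.\ \mathrm{Rel}\,(B^*\,x\,x'\,x^*)\,(f x)\,(f' x')$; $\mathrm{Rel}\,(\hat\Sigma^* A^* B^*)\,p\,p' = \Sigma x^*{:}\mathrm{Rel}\,A^*(\pi_1 p)(\pi_1 p').\ \mathrm{Rel}\,(B^*(\pi_1p)(\pi_1p')x^*)\,(\pi_2p)\,(\pi_2p')$. Priming $(\cdot)'$ replaces every variable $x$ (free or bound) by a fresh variable $x'$; for each $x$ there is also a fresh variable $x^*$, unprimed/primed/starred variables being pairwise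 disjoint. The operation $(\cdot)^*$ on terms in the image of reflection: $(x)^* = x^*$; $\hat *^* = \mathrm{refl}_{\hat *}$; $(\hat\Pi A(\lambda x{:}TA.B))^* = \hat\Pi^* A^*\,(\lambda x{:}TA\,\lambda x'{:}TA'\,\lambda x^*{:}\mathrm{Rel}\,A^*\,x\,x'.\ B^*)$; analogously for $\hat\Sigma$ with $\hat\Sigma^*$; $(\lambda x{:}TA.b)^* = \lambda x{:}TA\,\lambda x'{:}TA'\,\lambda x^*{:}\mathrm{Rel}\,A^*\,x\,x'.\ b^*$; $(f\,a)^* = f^*\,a\,a'\,a^*$; $(a,b)^* = (a^*,b^*)$; $(\pi_i p)^* = \pi_i p^*$. A $\lambda{*}U$-context $\Gamma$ is a $U$-context if it has the form $x_1 : TA_1,\dots,x_n : TA_n(x_1,\dots,x_{n-1})$ with $x_1{:}TA_1,\dots,x_i{:}TA_i \vdash A_{i+1} : U$ for $0\le i<n$; $A$ is a $U$-type in $\Gamma$ if $\Gamma$ is a $U$-context and $\Gamma\vdash A : U$. For such $\Gamma$, $\Gamma^*$ is the context $x_1{:}TA_1,\dots,x_n{:}TA_n,\ x_1'{:}TA_1',\dots,x_n'{:}TA_n',\ x_1^*{:}\mathrm{Rel}\,A_1^*\,x_1\,x_1',\dots,x_n^*{:}\mathrm{Rel}\,A_n^*\,x_n\,x_n'$. -}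

module Defs where

open import Data.Nat using (ℕ; zero; suc; _+_; _*_; _∸_)
open import Data.Product using (_×_; _,_; proj₁; proj₂)
open import Data.List using (List; []; _∷_; map; _++_; length)
open import Relation.Binary.Construct.Closure.Equivalence using (EqClosure)

-- The constants of λ*U and λ*U≈ are primitive constants whose
-- "implicit" arguments are made explicit (ordinary Π-arguments).

data Const : Set where
  cU cPî cSĝ c⋆̂ cT : Const
  cEq cRel crefl cPî* cSĝ* : Const

data Tm : Set where
  var  : ℕ → Tm
  ⋆    : Tm
  Pi   : Tm → Tm → Tm
  Sg   : Tm → Tm → Tm
  lam  : Tm → Tm → Tm
  app  : Tm → Tm → Tm
  pair : Tm → Tm → Tm
  fst  : Tm → Tm
  snd  : Tm → Tm
  con  : Const → Tm

extR : (ℕ → ℕ) → ℕ → ℕ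
extR f zero    = zero
extR f (suc k) = suc (f k)

rename : (ℕ → ℕ) → Tm → Tm
rename f (var k)    = var (f k)
rename f ⋆          = ⋆
rename f (Pi A B)   = Pi (rename f A) (rename (extR f) B)
rename f (Sg A B)   = Sg (rename f A) (rename (extR f) B)
rename f (lam A b)  = lam (rename f A) (rename (extR f) b)
rename f (app s t)  = app (rename f s) (rename f t)
rename f (pair s t) = pair (rename f s) (rename f t)
rename f (fst t)    = fst (rename f t)
rename f (snd t)    = snd (rename f t)
rename f (con c)    = con c

shift : ℕ → Tm → Tm
shift n = rename (n +_)

extS : (ℕ → Tm) → ℕ → Tm
extS σ zero    = var zero
extS σ (suc k) = shift 1 (σ k)

subst : (ℕ → Tm) → Tm → Tm
subst σ (var k)    = σ k
subst σ ⋆          = ⋆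
subst σ (Pi A B)   = Pi (subst σ A) (subst (extS σ) B)
subst σ (Sg A B)   = Sg (subst σ A) (subst (extS σ) B)
subst σ (lam A b)  = lam (subst σ A) (subst (extS σ) b)
subst σ (app s t)  = app (subst σ s) (subst σ t)
subst σ (pair s t) = pair (subst σ s) (subst σ t)
subst σ (fst t)    = fst (subst σ t)
subst σ (snd t)    = snd (subst σ t)
subst σ (con c)    = con c

single : Tm → ℕ → Tm
single a zero    = a
single a (suc k) = var k

_[_] : Tm → Tm → Tm
B [ a ] = subst (single a) B

U· ⋆̂· : Tm
U·  = con cU
⋆̂·  = con c⋆̂

T· : Tm → Tm
T· A = app (con cT) A

Pî· Sĝ· Eq· : Tm → Tm → Tm
Pî· A B = app (app (con cPî) A) B
Sĝ· A B = app (app (con cSĝ) A) B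
Eq· A B = app (app (con cEq) A) B

Rel· : Tm → Tm → Tm → Tm → Tm → Tm
Rel· A A' e x y = app (app (app (app (app (con cRel) A) A') e) x) y

Pî*· Sĝ*· : Tm → Tm → Tm → Tm → Tm → Tm → Tm
Pî*· A A' B B' As Bs = app (app (app (app (app (app (con cPî*) A) A') B) B') As) Bs
Sĝ*· A A' B B' As Bs = app (app (app (app (app (app (con cSĝ*) A) A') B) B') As) Bs

v : ℕ → Tm
v = var

-- Type of Π̂*/Σ̂* (implicit arguments A A' B B' made explicit):
-- Π A A':U. Π B:TA→U. Π B':TA'→U. Π A*:Eq A A'.
--   Π B*:(Π a:TA. Π a':TA'. Π a*:Rel A* a a'. Eq (B a) (B' a')).
--   Eq (Π̂ A B) (Π̂ A' B')
hatStarType : (Tm → Tm → Tm) → Tm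
hatStarType hat =
  Pi U· (Pi U·
  (Pi (Pi (T· (v 1)) U·)
  (Pi (Pi (T· (v 1)) U·)
  (Pi (Eq· (v 3) (v 2))
  (Pi (Pi (T· (v 4)) (Pi (T· (v 4)) (Pi (Rel· (v 6) (v 5) (v 2) (v 1) (v 0))
        (Eq· (app (v 5) (v 2)) (app (v 4) (v 1))))))
  (Eq· (hat (v 5) (v 3)) (hat (v 4) (v 2))))))))

ctype : Const → Tm
ctype cU    = ⋆
ctype cPî   = Pi U· (Pi (Pi (T· (v 0)) U·) U·)
ctype cSĝ   = Pi U· (Pi (Pi (T· (v 0)) U·) U·)
ctype c⋆̂    = U·
ctype cT    = Pi U· ⋆
ctype cEq   = Pi U· (Pi U· ⋆)
ctype cRel  = Pi U· (Pi U· (Pi (Eq· (v 1) (v 0)) (Pi (T· (v 2)) (Pi (T· (v 2)) ⋆))))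
ctype crefl = Eq· ⋆̂· ⋆̂·
ctype cPî*  = hatStarType Pî·
ctype cSĝ*  = hatStarType Sĝ·

data Sys : Set where
  λ*U λ*U≈ : Sys

data Allowed : Sys → Const → Set where
  U-U : Allowed λ*U cU
  U-Pî : Allowed λ*U cPî
  U-Sĝ : Allowed λ*U cSĝ
  U-⋆̂ : Allowed λ*U c⋆̂
  U-T : Allowed λ*U cT
  E-all : ∀ c → Allowed λ*U≈ c

data Contr : Sys → Tm → Tm → Set where
  β     : ∀ {s A b a} → Contr s (app (lam A b) a) (b [ a ])
  π₁β   : ∀ {s a b} → Contr s (fst (pair a b)) a
  π₂β   : ∀ {s a b} → Contr s (snd (pair a b)) b
  T-Pî  : ∀ {s A B} → Contr s (T· (Pî· A B)) (Pi (T· A) (T· (app (shift 1 B) (v 0))))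
  T-Sĝ  : ∀ {s A B} → Contr s (T· (Sĝ· A B)) (Sg (T· A) (T· (app (shift 1 B) (v 0))))
  T-⋆̂   : ∀ {s} → Contr s (T· ⋆̂·) U·
  Rel-refl : ∀ {X Y A B} → Contr λ*U≈ (Rel· X Y (con crefl) A B) (Eq· A B)
  Rel-Pî* : ∀ {X Y A A' B B' As Bs f f'} →
    Contr λ*U≈ (Rel· X Y (Pî*· A A' B B' As Bs) f f')
      (Pi (T· A) (Pi (T· (shift 1 A')) (Pi (Rel· (shift 2 A) (shift 2 A') (shift 2 As) (v 1) (v 0))
        (Rel· (app (shift 3 B) (v 2)) (app (shift 3 B') (v 1))
              (app (app (app (shift 3 Bs) (v 2)) (v 1)) (v 0))
              (app (shift 3 f) (v 2)) (app (shift 3 f') (v 1))))))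
  Rel-Sĝ* : ∀ {X Y A A' B B' As Bs p p'} →
    Contr λ*U≈ (Rel· X Y (Sĝ*· A A' B B' As Bs) p p')
      (Sg (Rel· A A' As (fst p) (fst p'))
        (Rel· (app (shift 1 B) (fst (shift 1 p))) (app (shift 1 B') (fst (shift 1 p')))
              (app (app (app (shift 1 Bs) (fst (shift 1 p))) (fst (shift 1 p'))) (v 0))
              (snd (shift 1 p)) (snd (shift 1 p'))))

data Step (s : Sys) : Tm → Tm → Set where
  here : ∀ {t u} → Contr s t u → Step s t u
  Pi₁  : ∀ {A A' B} → Step s A A' → Step s (Pi A B) (Pi A' B)
  Pi₂  : ∀ {A B B'} → Step s B B' → Step s (Pi A B) (Pi A B')
  Sg₁  : ∀ {A A' B} → Step s A A' → Step s (Sg A B) (Sg A' B)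
  Sg₂  : ∀ {A B B'} → Step s B B' → Step s (Sg A B) (Sg A B')
  lam₁ : ∀ {A A' b} → Step s A A' → Step s (lam A b) (lam A' b)
  lam₂ : ∀ {A b b'} → Step s b b' → Step s (lam A b) (lam A b')
  app₁ : ∀ {f f' a} → Step s f f' → Step s (app f a) (app f' a)
  app₂ : ∀ {f a a'} → Step s a a' → Step s (app f a) (app f a')
  pair₁ : ∀ {a a' b} → Step s a a' → Step s (pair a b) (pair a' b)
  pair₂ : ∀ {a b b'} → Step s b b' → Step s (pair a b) (pair a b')
  fst₁ : ∀ {p p'} → Step s p p' → Step s (fst p) (fst p')
  snd₁ : ∀ {p p'} → Step s p p' → Step s (snd p) (snd p')

Conv : Sys → Tm → Tm → Set
Conv s = EqClosure (Step s)

-- Contexts: head of the list = most recently bound variable (index 0)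
Ctx : Set
Ctx = List Tm

data _⊢[_]_∶_ : Ctx → Sys → Tm → Tm → Set where
  ax    : ∀ {s} → [] ⊢[ s ] ⋆ ∶ ⋆
  const : ∀ {s} c → Allowed s c → [] ⊢[ s ] con c ∶ ctype c
  var0  : ∀ {s Γ A} → Γ ⊢[ s ] A ∶ ⋆ → (A ∷ Γ) ⊢[ s ] var 0 ∶ shift 1 A
  weak  : ∀ {s Γ A t B} → Γ ⊢[ s ] t ∶ B → Γ ⊢[ s ] A ∶ ⋆ →
          (A ∷ Γ) ⊢[ s ] shift 1 t ∶ shift 1 B
  piF   : ∀ {s Γ A B} → Γ ⊢[ s ] A ∶ ⋆ → (A ∷ Γ) ⊢[ s ] B ∶ ⋆ → Γ ⊢[ s ] Pi A B ∶ ⋆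
  sgF   : ∀ {s Γ A B} → Γ ⊢[ s ] A ∶ ⋆ → (A ∷ Γ) ⊢[ s ] B ∶ ⋆ → Γ ⊢[ s ] Sg A B ∶ ⋆
  abs   : ∀ {s Γ A b B} → (A ∷ Γ) ⊢[ s ] b ∶ B → Γ ⊢[ s ] Pi A B ∶ ⋆ →
          Γ ⊢[ s ] lam A b ∶ Pi A B
  appl  : ∀ {s Γ f a A B} → Γ ⊢[ s ] f ∶ Pi A B → Γ ⊢[ s ] a ∶ A →
          Γ ⊢[ s ] app f a ∶ (B [ a ])
  pairI : ∀ {s Γ a b A B} → Γ ⊢[ s ] a ∶ A → Γ ⊢[ s ] b ∶ (B [ a ]) →
          Γ ⊢[ s ] Sg A B ∶ ⋆ → Γ ⊢[ s ] pair a b ∶ Sg A B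
  proj₁I : ∀ {s Γ p A B} → Γ ⊢[ s ] p ∶ Sg A B → Γ ⊢[ s ] fst p ∶ A
  proj₂I : ∀ {s Γ p A B} → Γ ⊢[ s ] p ∶ Sg A B → Γ ⊢[ s ] snd p ∶ (B [ fst p ])
  conv  : ∀ {s Γ t A B} → Γ ⊢[ s ] t ∶ A → Conv s A B → Γ ⊢[ s ] B ∶ ⋆ →
          Γ ⊢[ s ] t ∶ B

data Src : Set where
  var  : ℕ → Src
  ⋆    : Src
  Pi   : Src → Src → Src
  Sg   : Src → Src → Src
  lam  : Src → Src → Src
  app  : Src → Src → Src
  pair : Src → Src → Src
  fst  : Src → Src
  snd  : Src → Src

reflect : Src → Tm
reflect (var k)    = var k
reflect ⋆          = ⋆̂·
reflect (Pi A B)   = Pî· (reflect A) (lam (T· (reflect A)) (reflect B))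
reflect (Sg A B)   = Sĝ· (reflect A) (lam (T· (reflect A)) (reflect B))
reflect (lam A b)  = lam (T· (reflect A)) (reflect b)
reflect (app s t)  = app (reflect s) (reflect t)
reflect (pair s t) = pair (reflect s) (reflect t)
reflect (fst t)    = fst (reflect t)
reflect (snd t)    = snd (reflect t)

-- Priming and starring, de Bruijn style.
-- An environment sends a source variable to the target indices of its
-- three copies (x , x' , x*).

Env : Set
Env = ℕ → ℕ × ℕ × ℕ

c₀ c₁ : Env → Tm → Tm
c₀ ρ t = rename (λ k → proj₁ (ρ k)) t
c₁ ρ t = rename (λ k → proj₁ (proj₂ (ρ k))) t

-- going under the three binders λx λx' λx*
extE : Env → Env
extE ρ zero    = (2 , 1 , 0)
extE ρ (suc k) = (3 + proj₁ (ρ k) , 3 + proj₁ (proj₂ (ρ k)) , 3 + proj₂ (proj₂ (ρ k)))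

triLam : Env → Tm → Tm → Tm → Tm
triLam ρ Â Astar body =
  lam (T· (c₀ ρ Â)) (lam (T· (shift 1 (c₁ ρ Â)))
    (lam (Rel· (shift 2 (c₀ ρ Â)) (shift 2 (c₁ ρ Â)) (shift 2 Astar) (v 1) (v 0)) body))

-- (reflect N)* computed on the λ*-preimage N
star : Env → Src → Tm
star ρ (var k)    = var (proj₂ (proj₂ (ρ k)))
star ρ ⋆          = con crefl
star ρ (Pi A B)   = Pî*· (c₀ ρ (reflect A)) (c₁ ρ (reflect A))
                         (c₀ ρ (lam (T· (reflect A)) (reflect B)))
                         (c₁ ρ (lam (T· (reflect A)) (reflect B)))
                         (star ρ A) (triLam ρ (reflect A) (star ρ A) (star (extE ρ) B))
star ρ (Sg A B)   = Sĝ*· (c₀ ρ (reflect A)) (c₁ ρ (reflect A))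
                         (c₀ ρ (lam (T· (reflect A)) (reflect B)))
                         (c₁ ρ (lam (T· (reflect A)) (reflect B)))
                         (star ρ A) (triLam ρ (reflect A) (star ρ A) (star (extE ρ) B))
star ρ (lam A b)  = triLam ρ (reflect A) (star ρ A) (star (extE ρ) b)
star ρ (app f a)  = app (app (app (star ρ f) (c₀ ρ (reflect a))) (c₁ ρ (reflect a))) (star ρ a)
star ρ (pair a b) = pair (star ρ a) (star ρ b)
star ρ (fst p)    = fst (star ρ p)
star ρ (snd p)    = snd (star ρ p)

-- U-contexts. A context is given by the λ*-preimages [Aₙ, …, A₁]
-- (head = last); the λ*U context is x₁ : T Ā₁, …, xₙ : T Āₙ.

ctx : List Src → Ctx
ctx = map (λ A → T· (reflect A))

data UCtx : List Src → Set where
  []  : UCtx []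
  _∷_ : ∀ {Γ A} → ctx Γ ⊢[ λ*U ] reflect A ∶ U· → UCtx Γ → UCtx (A ∷ Γ)

-- Γ* = x₁..xₙ, x₁'..xₙ', x₁*..xₙ*.  In the final context (length 3n),
-- source variable k (i.e. x_{n-k}) has copies at 2n+k, n+k, k.
envΓ : ℕ → Env
envΓ n k = (2 * n + k , n + k , k)

-- Inside the primed block, the entry for xᵢ' sees x'_{i-1},..,x'_1 on
-- top of x₁..xₙ, so source index k goes to primed index k (unprimed n+k).
primeEnv : ℕ → Env
primeEnv n k = (n + k , k , k)

starCtx : List Src → Ctx
starCtx Γ =
  map (λ A → Rel· (c₀ (envΓ n) (reflect A)) (c₁ (envΓ n) (reflect A)) (star (envΓ n) A)
                  (var (2 * n ∸ 1)) (var (n ∸ 1))) Γ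
  ++ map (λ A → T· (c₁ (primeEnv n) (reflect A))) Γ
  ++ ctx Γ
  where n = length Γ

module Submission where

-- Since (·)* is only defined on reflected terms, we extend it to a
-- parametricity translation str of all λ*U terms (including the sort and
-- the constants U, T, Π̂, Σ̂, *̂), with a relation R C x y for every type C
-- (Part 5), and prove the abstraction theorem: every λ*U derivation
-- Γ ⊢ t : C and typed environment from Γ into Δ give Δ ⊢ t* : R C t₀ t₁
-- (Part 9).  On reflected terms str agrees
-- with (·)*, and Γ* carries a typed environment (11); the theorem follows.

open import Defs
open import Data.Nat using (ℕ; zero; suc; _+_; _*_; _∸_)
open import Data.Nat.Properties using (+-suc; +-comm; +-assoc)
open import Data.Nat.Solver using (module +-*-Solver)
open import Data.List using (List; []; _∷_; length; map; _++_)
open import Data.List.Properties using (length-map; length-++; ++-assoc)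
open import Data.Maybe using (Maybe; just; nothing; _<∣>_)
import Data.Maybe as Maybe
open import Data.Product using (_×_; _,_; proj₁; proj₂; Σ)
import Data.Product as Prod
open import Function using (_∘_)
open import Relation.Binary.PropositionalEquality using (_≡_; _≗_; refl; sym; trans; cong; cong₂) renaming (subst to ≡subst)
open import Relation.Binary.Construct.Closure.Equivalence using (gmap)
import Relation.Binary.Construct.Closure.Equivalence as EQ
open import Relation.Binary.Construct.Closure.ReflexiveTransitive using (Star; ε; _◅_; _◅◅_)
import Relation.Binary.Construct.Closure.ReflexiveTransitive as S
open import Relation.Binary.Construct.Closure.Symmetric using (fwd; bwd)

extR-id : extR (λ k → k) ≗ (λ k → k)
extR-id zero = refl
extR-id (suc k) = refl

extR-cong : ∀ {f g} → f ≗ g → extR f ≗ extR g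
extR-cong e zero = refl
extR-cong e (suc k) = cong suc (e k)

rename-cong : ∀ {f g} → f ≗ g → ∀ t → rename f t ≡ rename g t
rename-cong e (var k) = cong var (e k)
rename-cong e ⋆ = refl
rename-cong e (Pi A B) = cong₂ Pi (rename-cong e A) (rename-cong (extR-cong e) B)
rename-cong e (Sg A B) = cong₂ Sg (rename-cong e A) (rename-cong (extR-cong e) B)
rename-cong e (lam A B) = cong₂ lam (rename-cong e A) (rename-cong (extR-cong e) B)
rename-cong e (app s t) = cong₂ app (rename-cong e s) (rename-cong e t)
rename-cong e (pair s t) = cong₂ pair (rename-cong e s) (rename-cong e t)
rename-cong e (fst t) = cong fst (rename-cong e t)
rename-cong e (snd t) = cong snd (rename-cong e t)
rename-cong e (con c) = refl

extS-cong : ∀ {σ τ} → σ ≗ τ → extS σ ≗ extS τ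
extS-cong e zero = refl
extS-cong e (suc k) = cong (shift 1) (e k)

subst-cong : ∀ {σ τ} → σ ≗ τ → ∀ t → subst σ t ≡ subst τ t
subst-cong e (var k) = e k
subst-cong e ⋆ = refl
subst-cong e (Pi A B) = cong₂ Pi (subst-cong e A) (subst-cong (extS-cong e) B)
subst-cong e (Sg A B) = cong₂ Sg (subst-cong e A) (subst-cong (extS-cong e) B)
subst-cong e (lam A B) = cong₂ lam (subst-cong e A) (subst-cong (extS-cong e) B)
subst-cong e (app s t) = cong₂ app (subst-cong e s) (subst-cong e t)
subst-cong e (pair s t) = cong₂ pair (subst-cong e s) (subst-cong e t)
subst-cong e (fst t) = cong fst (subst-cong e t)
subst-cong e (snd t) = cong snd (subst-cong e t)
subst-cong e (con c) = refl

rename-rename : ∀ f g t → rename f (rename g t) ≡ rename (f ∘ g) t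
rename-rename f g (var k) = refl
rename-rename f g ⋆ = refl
rename-rename f g (Pi A B) = cong₂ Pi (rename-rename f g A)
  (trans (rename-rename (extR f) (extR g) B) (rename-cong (λ { zero → refl ; (suc k) → refl }) B))
rename-rename f g (Sg A B) = cong₂ Sg (rename-rename f g A)
  (trans (rename-rename (extR f) (extR g) B) (rename-cong (λ { zero → refl ; (suc k) → refl }) B))
rename-rename f g (lam A B) = cong₂ lam (rename-rename f g A)
  (trans (rename-rename (extR f) (extR g) B) (rename-cong (λ { zero → refl ; (suc k) → refl }) B))
rename-rename f g (app s t) = cong₂ app (rename-rename f g s) (rename-rename f g t)
rename-rename f g (pair s t) = cong₂ pair (rename-rename f g s) (rename-rename f g t)
rename-rename f g (fst t) = cong fst (rename-rename f g t)
rename-rename f g (snd t) = cong snd (rename-rename f g t)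
rename-rename f g (con c) = refl

subst-rename : ∀ σ f t → subst σ (rename f t) ≡ subst (σ ∘ f) t
subst-rename σ f (var k) = refl
subst-rename σ f ⋆ = refl
subst-rename σ f (Pi A B) = cong₂ Pi (subst-rename σ f A)
  (trans (subst-rename (extS σ) (extR f) B) (subst-cong (λ { zero → refl ; (suc k) → refl }) B))
subst-rename σ f (Sg A B) = cong₂ Sg (subst-rename σ f A)
  (trans (subst-rename (extS σ) (extR f) B) (subst-cong (λ { zero → refl ; (suc k) → refl }) B))
subst-rename σ f (lam A B) = cong₂ lam (subst-rename σ f A)
  (trans (subst-rename (extS σ) (extR f) B) (subst-cong (λ { zero → refl ; (suc k) → refl }) B))
subst-rename σ f (app s t) = cong₂ app (subst-rename σ f s) (subst-rename σ f t)
subst-rename σ f (pair s t) = cong₂ pair (subst-rename σ f s) (subst-rename σ f t)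
subst-rename σ f (fst t) = cong fst (subst-rename σ f t)
subst-rename σ f (snd t) = cong snd (subst-rename σ f t)
subst-rename σ f (con c) = refl

extS-ren : ∀ f σ → (rename (extR f) ∘ extS σ) ≗ extS (rename f ∘ σ)
extS-ren f σ zero = refl
extS-ren f σ (suc k) = trans (rename-rename (extR f) suc (σ k))
  (sym (rename-rename suc f (σ k)))

rename-subst : ∀ f σ t → rename f (subst σ t) ≡ subst (rename f ∘ σ) t
rename-subst f σ (var k) = refl
rename-subst f σ ⋆ = refl
rename-subst f σ (Pi A B) = cong₂ Pi (rename-subst f σ A)
  (trans (rename-subst (extR f) (extS σ) B) (subst-cong (extS-ren f σ) B))
rename-subst f σ (Sg A B) = cong₂ Sg (rename-subst f σ A)
  (trans (rename-subst (extR f) (extS σ) B) (subst-cong (extS-ren f σ) B))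
rename-subst f σ (lam A B) = cong₂ lam (rename-subst f σ A)
  (trans (rename-subst (extR f) (extS σ) B) (subst-cong (extS-ren f σ) B))
rename-subst f σ (app s t) = cong₂ app (rename-subst f σ s) (rename-subst f σ t)
rename-subst f σ (pair s t) = cong₂ pair (rename-subst f σ s) (rename-subst f σ t)
rename-subst f σ (fst t) = cong fst (rename-subst f σ t)
rename-subst f σ (snd t) = cong snd (rename-subst f σ t)
rename-subst f σ (con c) = refl

extS-sub : ∀ σ τ → (subst (extS σ) ∘ extS τ) ≗ extS (subst σ ∘ τ)
extS-sub σ τ zero = refl
extS-sub σ τ (suc k) = trans (subst-rename (extS σ) suc (τ k))
  (sym (rename-subst suc σ (τ k)))

subst-subst : ∀ σ τ t → subst σ (subst τ t) ≡ subst (subst σ ∘ τ) t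
subst-subst σ τ (var k) = refl
subst-subst σ τ ⋆ = refl
subst-subst σ τ (Pi A B) = cong₂ Pi (subst-subst σ τ A)
  (trans (subst-subst (extS σ) (extS τ) B) (subst-cong (extS-sub σ τ) B))
subst-subst σ τ (Sg A B) = cong₂ Sg (subst-subst σ τ A)
  (trans (subst-subst (extS σ) (extS τ) B) (subst-cong (extS-sub σ τ) B))
subst-subst σ τ (lam A B) = cong₂ lam (subst-subst σ τ A)
  (trans (subst-subst (extS σ) (extS τ) B) (subst-cong (extS-sub σ τ) B))
subst-subst σ τ (app s t) = cong₂ app (subst-subst σ τ s) (subst-subst σ τ t)
subst-subst σ τ (pair s t) = cong₂ pair (subst-subst σ τ s) (subst-subst σ τ t)
subst-subst σ τ (fst t) = cong fst (subst-subst σ τ t)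
subst-subst σ τ (snd t) = cong snd (subst-subst σ τ t)
subst-subst σ τ (con c) = refl

ren-as-sub : ∀ f t → rename f t ≡ subst (var ∘ f) t
ren-as-sub f (var k) = refl
ren-as-sub f ⋆ = refl
ren-as-sub f (Pi A B) = cong₂ Pi (ren-as-sub f A)
  (trans (ren-as-sub (extR f) B) (subst-cong (λ { zero → refl ; (suc k) → refl }) B))
ren-as-sub f (Sg A B) = cong₂ Sg (ren-as-sub f A)
  (trans (ren-as-sub (extR f) B) (subst-cong (λ { zero → refl ; (suc k) → refl }) B))
ren-as-sub f (lam A B) = cong₂ lam (ren-as-sub f A)
  (trans (ren-as-sub (extR f) B) (subst-cong (λ { zero → refl ; (suc k) → refl }) B))
ren-as-sub f (app s t) = cong₂ app (ren-as-sub f s) (ren-as-sub f t)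
ren-as-sub f (pair s t) = cong₂ pair (ren-as-sub f s) (ren-as-sub f t)
ren-as-sub f (fst t) = cong fst (ren-as-sub f t)
ren-as-sub f (snd t) = cong snd (ren-as-sub f t)
ren-as-sub f (con c) = refl

rename-id : ∀ t → rename (λ k → k) t ≡ t
rename-id (var k) = refl
rename-id ⋆ = refl
rename-id (Pi A B) = cong₂ Pi (rename-id A) (trans (rename-cong extR-id B) (rename-id B))
rename-id (Sg A B) = cong₂ Sg (rename-id A) (trans (rename-cong extR-id B) (rename-id B))
rename-id (lam A B) = cong₂ lam (rename-id A) (trans (rename-cong extR-id B) (rename-id B))
rename-id (app s t) = cong₂ app (rename-id s) (rename-id t)
rename-id (pair s t) = cong₂ pair (rename-id s) (rename-id t)
rename-id (fst t) = cong fst (rename-id t)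
rename-id (snd t) = cong snd (rename-id t)
rename-id (con c) = refl

subst-id : ∀ t → subst var t ≡ t
subst-id t = trans (sym (ren-as-sub (λ k → k) t)) (rename-id t)

shift-zero : ∀ t → shift 0 t ≡ t
shift-zero = rename-id

shift-shift : ∀ m n t → shift m (shift n t) ≡ shift (m + n) t
shift-shift m n t = trans (rename-rename (m +_) (n +_) t) (rename-cong (λ k → sym (+-assoc m n k)) t)

sub-single-shift : ∀ a t → (shift 1 t) [ a ] ≡ t
sub-single-shift a t = trans (subst-rename (single a) suc t) (subst-id t)

extS-shift : ∀ σ t → subst (extS σ) (shift 1 t) ≡ shift 1 (subst σ t)
extS-shift σ t = trans (subst-rename (extS σ) suc t) (sym (rename-subst suc σ t))

subst-single : ∀ σ b a → subst σ (b [ a ]) ≡ (subst (extS σ) b) [ subst σ a ]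
subst-single σ b a = trans (subst-subst σ (single a) b)
  (trans (subst-cong (λ { zero → refl ; (suc k) → sym (sub-single-shift (subst σ a) (σ k)) }) b)
         (sym (subst-subst (single (subst σ a)) (extS σ) b)))

rename-single : ∀ f b a → rename f (b [ a ]) ≡ (rename (extR f) b) [ rename f a ]
rename-single f b a = trans (ren-as-sub f (b [ a ]))
  (trans (subst-single (var ∘ f) b a)
  (cong₂ _[_] (trans (subst-cong (λ { zero → refl ; (suc k) → refl }) b) (sym (ren-as-sub (extR f) b)))
              (sym (ren-as-sub f a))))

-- Extending a substitution by a term for index 0; consAll pushes a
-- list of terms, the last one landing on index 0.
consS : Tm → (ℕ → Tm) → ℕ → Tm
consS x σ zero = x
consS x σ (suc k) = σ k

consAll : List Tm → (ℕ → Tm) → ℕ → Tm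
consAll [] σ = σ
consAll (x ∷ xs) σ = consAll xs (consS x σ)

sub-ext-single : ∀ (σ : ℕ → Tm) B z → (subst (extS σ) B) [ z ] ≡ subst (consS z σ) B
sub-ext-single σ B z = trans (subst-subst _ (extS σ) B) (subst-cong (λ { zero → refl ; (suc k) → sub-single-shift z (σ k) }) B)

extSn : ℕ → (ℕ → Tm) → ℕ → Tm
extSn zero σ = σ
extSn (suc n) σ = extS (extSn n σ)

extSn-+ : ∀ n σ k → extSn n σ (n + k) ≡ shift n (σ k)
extSn-+ zero σ k = sym (shift-zero (σ k))
extSn-+ (suc n) σ k = trans (cong (shift 1) (extSn-+ n σ k)) (shift-shift 1 n (σ k))

extSn-shift : ∀ n σ t → subst (extSn n σ) (shift n t) ≡ shift n (subst σ t)
extSn-shift n σ t = trans (subst-rename (extSn n σ) (n +_) t)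
  (trans (subst-cong (extSn-+ n σ) t) (sym (rename-subst (n +_) σ t)))

Contr-subst : ∀ {s t u} σ → Contr s t u → Contr s (subst σ t) (subst σ u)
Contr-subst {s} σ (β {A = A} {b} {a}) = ≡subst (Contr s (subst σ (app (lam A b) a))) (sym (subst-single σ b a)) β
Contr-subst σ π₁β = π₁β
Contr-subst σ π₂β = π₂β
Contr-subst {s} σ (T-Pî {A = A} {B}) =
  ≡subst (λ z → Contr s (T· (Pî· (subst σ A) (subst σ B))) (Pi (T· (subst σ A)) (T· (app z (v 0))))) (sym (extS-shift σ B)) (T-Pî {A = subst σ A} {subst σ B})
Contr-subst {s} σ (T-Sĝ {A = A} {B}) =
  ≡subst (λ z → Contr s (T· (Sĝ· (subst σ A) (subst σ B))) (Sg (T· (subst σ A)) (T· (app z (v 0))))) (sym (extS-shift σ B)) (T-Sĝ {A = subst σ A} {subst σ B})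
Contr-subst σ T-⋆̂ = T-⋆̂
Contr-subst σ Rel-refl = Rel-refl
Contr-subst σ (Rel-Pî* {X} {Y} {A} {A'} {B} {B'} {As} {Bs} {f} {f'}) =
  ≡subst (λ z → Contr λ*U≈ (subst σ (Rel· X Y (Pî*· A A' B B' As Bs) f f')) z) (sym eq) (Rel-Pî* {subst σ X} {subst σ Y} {subst σ A} {subst σ A'} {subst σ B} {subst σ B'} {subst σ As} {subst σ Bs} {subst σ f} {subst σ f'})
  where
  e1 = extS-shift σ
  e2 = extSn-shift 2 σ
  e3 = extSn-shift 3 σ
  eq : subst σ (Pi (T· A) (Pi (T· (shift 1 A')) (Pi (Rel· (shift 2 A) (shift 2 A') (shift 2 As) (v 1) (v 0))
        (Rel· (app (shift 3 B) (v 2)) (app (shift 3 B') (v 1))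
              (app (app (app (shift 3 Bs) (v 2)) (v 1)) (v 0))
              (app (shift 3 f) (v 2)) (app (shift 3 f') (v 1))))))
     ≡ Pi (T· (subst σ A)) (Pi (T· (shift 1 (subst σ A'))) (Pi (Rel· (shift 2 (subst σ A)) (shift 2 (subst σ A')) (shift 2 (subst σ As)) (v 1) (v 0))
        (Rel· (app (shift 3 (subst σ B)) (v 2)) (app (shift 3 (subst σ B')) (v 1))
              (app (app (app (shift 3 (subst σ Bs)) (v 2)) (v 1)) (v 0))
              (app (shift 3 (subst σ f)) (v 2)) (app (shift 3 (subst σ f')) (v 1)))))
  eq rewrite e1 A' | e2 A | e2 A' | e2 As | e3 B | e3 B' | e3 Bs | e3 f | e3 f' = refl
Contr-subst σ (Rel-Sĝ* {X} {Y} {A} {A'} {B} {B'} {As} {Bs} {p} {p'}) =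
  ≡subst (λ z → Contr λ*U≈ (subst σ (Rel· X Y (Sĝ*· A A' B B' As Bs) p p')) z) (sym eq) (Rel-Sĝ* {subst σ X} {subst σ Y} {subst σ A} {subst σ A'} {subst σ B} {subst σ B'} {subst σ As} {subst σ Bs} {subst σ p} {subst σ p'})
  where
  e1 = extS-shift σ
  eq : subst σ (Sg (Rel· A A' As (fst p) (fst p'))
        (Rel· (app (shift 1 B) (fst (shift 1 p))) (app (shift 1 B') (fst (shift 1 p')))
              (app (app (app (shift 1 Bs) (fst (shift 1 p))) (fst (shift 1 p'))) (v 0))
              (snd (shift 1 p)) (snd (shift 1 p'))))
     ≡ Sg (Rel· (subst σ A) (subst σ A') (subst σ As) (fst (subst σ p)) (fst (subst σ p')))
        (Rel· (app (shift 1 (subst σ B)) (fst (shift 1 (subst σ p)))) (app (shift 1 (subst σ B')) (fst (shift 1 (subst σ p'))))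
              (app (app (app (shift 1 (subst σ Bs)) (fst (shift 1 (subst σ p)))) (fst (shift 1 (subst σ p')))) (v 0))
              (snd (shift 1 (subst σ p))) (snd (shift 1 (subst σ p'))))
  eq rewrite e1 B | e1 B' | e1 Bs | e1 p | e1 p' = refl

Step-subst : ∀ {s t u} σ → Step s t u → Step s (subst σ t) (subst σ u)
Step-subst σ (here c) = here (Contr-subst σ c)
Step-subst σ (Pi₁ r) = Pi₁ (Step-subst σ r)
Step-subst σ (Pi₂ r) = Pi₂ (Step-subst (extS σ) r)
Step-subst σ (Sg₁ r) = Sg₁ (Step-subst σ r)
Step-subst σ (Sg₂ r) = Sg₂ (Step-subst (extS σ) r)
Step-subst σ (lam₁ r) = lam₁ (Step-subst σ r)
Step-subst σ (lam₂ r) = lam₂ (Step-subst (extS σ) r)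
Step-subst σ (app₁ r) = app₁ (Step-subst σ r)
Step-subst σ (app₂ r) = app₂ (Step-subst σ r)
Step-subst σ (pair₁ r) = pair₁ (Step-subst σ r)
Step-subst σ (pair₂ r) = pair₂ (Step-subst σ r)
Step-subst σ (fst₁ r) = fst₁ (Step-subst σ r)
Step-subst σ (snd₁ r) = snd₁ (Step-subst σ r)

Conv-subst : ∀ {s t u} σ → Conv s t u → Conv s (subst σ t) (subst σ u)
Conv-subst σ = gmap (subst σ) (Step-subst σ)

Step-rename : ∀ {s t u} f → Step s t u → Step s (rename f t) (rename f u)
Step-rename {s} {t} {u} f r rewrite ren-as-sub f t | ren-as-sub f u = Step-subst (var ∘ f) r

Conv-rename : ∀ {s t u} f → Conv s t u → Conv s (rename f t) (rename f u)
Conv-rename f = gmap (rename f) (Step-rename f)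

infixr 5 _∙_
_∙_ : ∀ {s t u w} → Conv s t u → Conv s u w → Conv s t w
_∙_ = _◅◅_

⁻ : ∀ {s t u} → Conv s t u → Conv s u t
⁻ {s} = EQ.symmetric (Step s)

Step⇒Conv : ∀ {s t u} → Step s t u → Conv s t u
Step⇒Conv = EQ.return

Contr⇒Conv : ∀ {s t u} → Contr s t u → Conv s t u
Contr⇒Conv c = Step⇒Conv (here c)

Steps⇒Conv : ∀ {s t u} → Star (Step s) t u → Conv s t u
Steps⇒Conv = S.map fwd

≡⇒Conv : ∀ {s t u} → t ≡ u → Conv s t u
≡⇒Conv refl = ε

cPi : ∀ {s A A' B B'} → Conv s A A' → Conv s B B' → Conv s (Pi A B) (Pi A' B')
cPi {A' = A'} {B = B} p q = gmap (λ x → Pi x B) Pi₁ p ∙ gmap (Pi A') Pi₂ q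
cSg : ∀ {s A A' B B'} → Conv s A A' → Conv s B B' → Conv s (Sg A B) (Sg A' B')
cSg {A' = A'} {B = B} p q = gmap (λ x → Sg x B) Sg₁ p ∙ gmap (Sg A') Sg₂ q
cLam : ∀ {s A A' b b'} → Conv s A A' → Conv s b b' → Conv s (lam A b) (lam A' b')
cLam {A' = A'} {b = b} p q = gmap (λ x → lam x b) lam₁ p ∙ gmap (lam A') lam₂ q
cApp : ∀ {s f f' a a'} → Conv s f f' → Conv s a a' → Conv s (app f a) (app f' a')
cApp {f' = f'} {a = a} p q = gmap (λ x → app x a) app₁ p ∙ gmap (app f') app₂ q
cPair : ∀ {s a a' b b'} → Conv s a a' → Conv s b b' → Conv s (pair a b) (pair a' b')
cPair {a' = a'} {b = b} p q = gmap (λ x → pair x b) pair₁ p ∙ gmap (pair a') pair₂ q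
cFst : ∀ {s p p'} → Conv s p p' → Conv s (fst p) (fst p')
cFst = gmap fst fst₁
cSnd : ∀ {s p p'} → Conv s p p' → Conv s (snd p) (snd p')
cSnd = gmap snd snd₁

extS-conv : ∀ {s σ σ'} → (∀ k → Conv s (σ k) (σ' k)) → ∀ k → Conv s (extS σ k) (extS σ' k)
extS-conv h zero = ε
extS-conv h (suc k) = Conv-rename suc (h k)

subst-conv : ∀ {s σ σ'} → (∀ k → Conv s (σ k) (σ' k)) → ∀ t → Conv s (subst σ t) (subst σ' t)
subst-conv h (var k) = h k
subst-conv h ⋆ = ε
subst-conv h (Pi A B) = cPi (subst-conv h A) (subst-conv (extS-conv h) B)
subst-conv h (Sg A B) = cSg (subst-conv h A) (subst-conv (extS-conv h) B)
subst-conv h (lam A b) = cLam (subst-conv h A) (subst-conv (extS-conv h) b)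
subst-conv h (app f a) = cApp (subst-conv h f) (subst-conv h a)
subst-conv h (pair a b) = cPair (subst-conv h a) (subst-conv h b)
subst-conv h (fst p) = cFst (subst-conv h p)
subst-conv h (snd p) = cSnd (subst-conv h p)
subst-conv h (con c) = ε

Contr-emb : ∀ {t u} → Contr λ*U t u → Contr λ*U≈ t u
Contr-emb β = β
Contr-emb π₁β = π₁β
Contr-emb π₂β = π₂β
Contr-emb T-Pî = T-Pî
Contr-emb T-Sĝ = T-Sĝ
Contr-emb T-⋆̂ = T-⋆̂

Step-emb : ∀ {t u} → Step λ*U t u → Step λ*U≈ t u
Step-emb (here c) = here (Contr-emb c)
Step-emb (Pi₁ r) = Pi₁ (Step-emb r)
Step-emb (Pi₂ r) = Pi₂ (Step-emb r)
Step-emb (Sg₁ r) = Sg₁ (Step-emb r)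
Step-emb (Sg₂ r) = Sg₂ (Step-emb r)
Step-emb (lam₁ r) = lam₁ (Step-emb r)
Step-emb (lam₂ r) = lam₂ (Step-emb r)
Step-emb (app₁ r) = app₁ (Step-emb r)
Step-emb (app₂ r) = app₂ (Step-emb r)
Step-emb (pair₁ r) = pair₁ (Step-emb r)
Step-emb (pair₂ r) = pair₂ (Step-emb r)
Step-emb (fst₁ r) = fst₁ (Step-emb r)
Step-emb (snd₁ r) = snd₁ (Step-emb r)

Conv-emb : ∀ {t u} → Conv λ*U t u → Conv λ*U≈ t u
Conv-emb = EQ.map Step-emb

-- Part 3: confluence of λ*U, used only for the injectivity of Π-types.
-- Parallel reduction (Tait–Martin-Löf); its complete development
-- (Takahashi) gives the diamond property, hence Church–Rosser.
infix 4 _⇛_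
data _⇛_ : Tm → Tm → Set where
  pvar : ∀ {k} → var k ⇛ var k
  p⋆ : ⋆ ⇛ ⋆
  pcon : ∀ {c} → con c ⇛ con c
  pPi : ∀ {A A' B B'} → A ⇛ A' → B ⇛ B' → Pi A B ⇛ Pi A' B'
  pSg : ∀ {A A' B B'} → A ⇛ A' → B ⇛ B' → Sg A B ⇛ Sg A' B'
  plam : ∀ {A A' B B'} → A ⇛ A' → B ⇛ B' → lam A B ⇛ lam A' B'
  papp : ∀ {A A' B B'} → A ⇛ A' → B ⇛ B' → app A B ⇛ app A' B'
  ppair : ∀ {A A' B B'} → A ⇛ A' → B ⇛ B' → pair A B ⇛ pair A' B'
  pfst : ∀ {A A'} → A ⇛ A' → fst A ⇛ fst A'
  psnd : ∀ {A A'} → A ⇛ A' → snd A ⇛ snd A'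
  pβ : ∀ {A b b' a a'} → b ⇛ b' → a ⇛ a' → app (lam A b) a ⇛ b' [ a' ]
  pπ₁ : ∀ {a a' b} → a ⇛ a' → fst (pair a b) ⇛ a'
  pπ₂ : ∀ {a b b'} → b ⇛ b' → snd (pair a b) ⇛ b'
  pTPi : ∀ {A A' B B'} → A ⇛ A' → B ⇛ B' → T· (Pî· A B) ⇛ Pi (T· A') (T· (app (shift 1 B') (v 0)))
  pTSg : ∀ {A A' B B'} → A ⇛ A' → B ⇛ B' → T· (Sĝ· A B) ⇛ Sg (T· A') (T· (app (shift 1 B') (v 0)))
  pT⋆ : T· ⋆̂· ⇛ U·

par-refl : ∀ t → t ⇛ t
par-refl (var k) = pvar
par-refl ⋆ = p⋆
par-refl (Pi A B) = pPi (par-refl A) (par-refl B)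
par-refl (Sg A B) = pSg (par-refl A) (par-refl B)
par-refl (lam A B) = plam (par-refl A) (par-refl B)
par-refl (app A B) = papp (par-refl A) (par-refl B)
par-refl (pair A B) = ppair (par-refl A) (par-refl B)
par-refl (fst A) = pfst (par-refl A)
par-refl (snd A) = psnd (par-refl A)
par-refl (con c) = pcon

ParSubst : (ℕ → Tm) → (ℕ → Tm) → Set
ParSubst σ τ = ∀ k → σ k ⇛ τ k

par-rename : ∀ {t u} f → t ⇛ u → rename f t ⇛ rename f u
par-rename f pvar = pvar
par-rename f p⋆ = p⋆
par-rename f pcon = pcon
par-rename f (pPi p q) = pPi (par-rename f p) (par-rename (extR f) q)
par-rename f (pSg p q) = pSg (par-rename f p) (par-rename (extR f) q)
par-rename f (plam p q) = plam (par-rename f p) (par-rename (extR f) q)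
par-rename f (papp p q) = papp (par-rename f p) (par-rename f q)
par-rename f (ppair p q) = ppair (par-rename f p) (par-rename f q)
par-rename f (pfst p) = pfst (par-rename f p)
par-rename f (psnd p) = psnd (par-rename f p)
par-rename f (pβ {b' = b'} {a' = a'} p q) = ≡subst (_ ⇛_) (sym (rename-single f b' a')) (pβ (par-rename (extR f) p) (par-rename f q))
par-rename f (pπ₁ p) = pπ₁ (par-rename f p)
par-rename f (pπ₂ p) = pπ₂ (par-rename f p)
par-rename f (pTPi {B' = B'} p q) =
  ≡subst (λ z → T· (Pî· _ _) ⇛ Pi _ (T· (app z (v 0)))) (sym (trans (rename-rename (extR f) suc B') (sym (rename-rename suc f B'))))
    (pTPi (par-rename f p) (par-rename f q))
par-rename f (pTSg {B' = B'} p q) =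
  ≡subst (λ z → T· (Sĝ· _ _) ⇛ Sg _ (T· (app z (v 0)))) (sym (trans (rename-rename (extR f) suc B') (sym (rename-rename suc f B'))))
    (pTSg (par-rename f p) (par-rename f q))
par-rename f pT⋆ = pT⋆

ParSubst-ext : ∀ {σ τ} → ParSubst σ τ → ParSubst (extS σ) (extS τ)
ParSubst-ext h zero = pvar
ParSubst-ext h (suc k) = par-rename suc (h k)

par-subst : ∀ {t u σ τ} → ParSubst σ τ → t ⇛ u → subst σ t ⇛ subst τ u
par-subst h (pvar {k}) = h k
par-subst h p⋆ = p⋆
par-subst h pcon = pcon
par-subst h (pPi p q) = pPi (par-subst h p) (par-subst (ParSubst-ext h) q)
par-subst h (pSg p q) = pSg (par-subst h p) (par-subst (ParSubst-ext h) q)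
par-subst h (plam p q) = plam (par-subst h p) (par-subst (ParSubst-ext h) q)
par-subst h (papp p q) = papp (par-subst h p) (par-subst h q)
par-subst h (ppair p q) = ppair (par-subst h p) (par-subst h q)
par-subst h (pfst p) = pfst (par-subst h p)
par-subst h (psnd p) = psnd (par-subst h p)
par-subst {τ = τ} h (pβ {b' = b'} {a' = a'} p q) = ≡subst (_ ⇛_) (sym (subst-single τ b' a')) (pβ (par-subst (ParSubst-ext h) p) (par-subst h q))
par-subst {τ = τ} h (pπ₁ p) = pπ₁ (par-subst h p)
par-subst {τ = τ} h (pπ₂ p) = pπ₂ (par-subst h p)
par-subst {τ = τ} h (pTPi {B' = B'} p q) =
  ≡subst (λ z → T· (Pî· _ _) ⇛ Pi _ (T· (app z (v 0)))) (sym (extS-shift τ B'))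
    (pTPi (par-subst h p) (par-subst h q))
par-subst {τ = τ} h (pTSg {B' = B'} p q) =
  ≡subst (λ z → T· (Sĝ· _ _) ⇛ Sg _ (T· (app z (v 0)))) (sym (extS-shift τ B'))
    (pTSg (par-subst h p) (par-subst h q))
par-subst h pT⋆ = pT⋆

par-single : ∀ {b b' a a'} → b ⇛ b' → a ⇛ a' → b [ a ] ⇛ b' [ a' ]
par-single p q = par-subst (λ { zero → q ; (suc k) → pvar }) p

data AppView : Tm → Tm → Set where
  vβ : ∀ {A b a} → AppView (lam A b) a
  vTPi : ∀ {A B} → AppView (con cT) (Pî· A B)
  vTSg : ∀ {A B} → AppView (con cT) (Sĝ· A B)
  vT⋆ : AppView (con cT) ⋆̂·
  vgen : ∀ {f a} → AppView f a

appView : ∀ f a → AppView f a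
appView (lam A b) a = vβ
appView (con cT) (app (app (con cPî) A) B) = vTPi
appView (con cT) (app (app (con cSĝ) A) B) = vTSg
appView (con cT) (con c⋆̂) = vT⋆
appView f a = vgen

data ProjView : Tm → Set where
  vpair : ∀ {a b} → ProjView (pair a b)
  vpgen : ∀ {p} → ProjView p

projView : ∀ p → ProjView p
projView (pair a b) = vpair
projView p = vpgen

develop : Tm → Tm
develop (var k) = var k
develop ⋆ = ⋆
develop (Pi A B) = Pi (develop A) (develop B)
develop (Sg A B) = Sg (develop A) (develop B)
develop (lam A b) = lam (develop A) (develop b)
develop (app f a) with appView f a
... | vβ {A} {b} = develop b [ develop a ]
... | vTPi {A} {B} = Pi (T· (develop A)) (T· (app (shift 1 (develop B)) (v 0)))
... | vTSg {A} {B} = Sg (T· (develop A)) (T· (app (shift 1 (develop B)) (v 0)))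
... | vT⋆ = U·
... | vgen = app (develop f) (develop a)
develop (pair a b) = pair (develop a) (develop b)
develop (fst p) with projView p
... | vpair {a} {b} = develop a
... | vpgen = fst (develop p)
develop (snd p) with projView p
... | vpair {a} {b} = develop b
... | vpgen = snd (develop p)
develop (con c) = con c

par-develop : ∀ {t u} → t ⇛ u → u ⇛ develop t
par-develop pvar = pvar
par-develop p⋆ = p⋆
par-develop pcon = pcon
par-develop (pPi p q) = pPi (par-develop p) (par-develop q)
par-develop (pSg p q) = pSg (par-develop p) (par-develop q)
par-develop (plam p q) = plam (par-develop p) (par-develop q)
par-develop (papp {f} {f'} {a} {a'} p q) with appView f a
par-develop (papp (plam p₁ p₂) q) | vβ with par-develop (plam p₁ p₂)
... | plam _ ib = pβ ib (par-develop q)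
par-develop (papp pcon (papp (papp pcon qA) qB)) | vTPi = pTPi (par-develop qA) (par-develop qB)
par-develop (papp pcon (papp (papp pcon qA) qB)) | vTSg = pTSg (par-develop qA) (par-develop qB)
par-develop (papp pcon pcon) | vT⋆ = pT⋆
par-develop (papp p q) | vgen = papp (par-develop p) (par-develop q)
par-develop (ppair p q) = ppair (par-develop p) (par-develop q)
par-develop (pfst {p} p₀) with projView p
par-develop (pfst (ppair p q)) | vpair with par-develop (ppair p q)
... | ppair ia _ = pπ₁ ia
par-develop (pfst p₀) | vpgen = pfst (par-develop p₀)
par-develop (psnd {p} p₀) with projView p
par-develop (psnd (ppair p q)) | vpair with par-develop (ppair p q)
... | ppair _ ib = pπ₂ ib
par-develop (psnd p₀) | vpgen = psnd (par-develop p₀)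
par-develop (pβ p q) = par-single (par-develop p) (par-develop q)
par-develop (pπ₁ p) = par-develop p
par-develop (pπ₂ p) = par-develop p
par-develop (pTPi p q) = pPi (papp pcon (par-develop p)) (papp pcon (papp (par-rename suc (par-develop q)) pvar))
par-develop (pTSg p q) = pSg (papp pcon (par-develop p)) (papp pcon (papp (par-rename suc (par-develop q)) pvar))
par-develop pT⋆ = pcon

Contr⇛ : ∀ {t u} → Contr λ*U t u → t ⇛ u
Contr⇛ β = pβ (par-refl _) (par-refl _)
Contr⇛ π₁β = pπ₁ (par-refl _)
Contr⇛ π₂β = pπ₂ (par-refl _)
Contr⇛ T-Pî = pTPi (par-refl _) (par-refl _)
Contr⇛ T-Sĝ = pTSg (par-refl _) (par-refl _)
Contr⇛ T-⋆̂ = pT⋆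

Step⇛ : ∀ {t u} → Step λ*U t u → t ⇛ u
Step⇛ (here c) = Contr⇛ c
Step⇛ (Pi₁ r) = pPi (Step⇛ r) (par-refl _)
Step⇛ (Pi₂ r) = pPi (par-refl _) (Step⇛ r)
Step⇛ (Sg₁ r) = pSg (Step⇛ r) (par-refl _)
Step⇛ (Sg₂ r) = pSg (par-refl _) (Step⇛ r)
Step⇛ (lam₁ r) = plam (Step⇛ r) (par-refl _)
Step⇛ (lam₂ r) = plam (par-refl _) (Step⇛ r)
Step⇛ (app₁ r) = papp (Step⇛ r) (par-refl _)
Step⇛ (app₂ r) = papp (par-refl _) (Step⇛ r)
Step⇛ (pair₁ r) = ppair (Step⇛ r) (par-refl _)
Step⇛ (pair₂ r) = ppair (par-refl _) (Step⇛ r)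
Step⇛ (fst₁ r) = pfst (Step⇛ r)
Step⇛ (snd₁ r) = psnd (Step⇛ r)

⇛⇒Conv : ∀ {t u} → t ⇛ u → Conv λ*U t u
⇛⇒Conv pvar = ε
⇛⇒Conv p⋆ = ε
⇛⇒Conv pcon = ε
⇛⇒Conv (pPi p q) = cPi (⇛⇒Conv p) (⇛⇒Conv q)
⇛⇒Conv (pSg p q) = cSg (⇛⇒Conv p) (⇛⇒Conv q)
⇛⇒Conv (plam p q) = cLam (⇛⇒Conv p) (⇛⇒Conv q)
⇛⇒Conv (papp p q) = cApp (⇛⇒Conv p) (⇛⇒Conv q)
⇛⇒Conv (ppair p q) = cPair (⇛⇒Conv p) (⇛⇒Conv q)
⇛⇒Conv (pfst p) = cFst (⇛⇒Conv p)
⇛⇒Conv (psnd p) = cSnd (⇛⇒Conv p)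
⇛⇒Conv (pβ p q) = cApp (cLam ε (⇛⇒Conv p)) (⇛⇒Conv q) ∙ Contr⇒Conv β
⇛⇒Conv (pπ₁ p) = Contr⇒Conv π₁β ∙ ⇛⇒Conv p
⇛⇒Conv (pπ₂ p) = Contr⇒Conv π₂β ∙ ⇛⇒Conv p
⇛⇒Conv (pTPi p q) = Contr⇒Conv T-Pî ∙ cPi (cApp ε (⇛⇒Conv p)) (cApp ε (cApp (Conv-rename suc (⇛⇒Conv q)) ε))
⇛⇒Conv (pTSg p q) = Contr⇒Conv T-Sĝ ∙ cSg (cApp ε (⇛⇒Conv p)) (cApp ε (cApp (Conv-rename suc (⇛⇒Conv q)) ε))
⇛⇒Conv pT⋆ = Contr⇒Conv T-⋆̂

ParSteps : Tm → Tm → Set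
ParSteps = Star _⇛_

ParSteps⇒Conv : ∀ {t u} → ParSteps t u → Conv λ*U t u
ParSteps⇒Conv ε = ε
ParSteps⇒Conv (p ◅ ps) = ⇛⇒Conv p ∙ ParSteps⇒Conv ps

strip : ∀ {t u₁ u₂} → t ⇛ u₁ → ParSteps t u₂ → Σ Tm (λ w → ParSteps u₁ w × u₂ ⇛ w)
strip {u₁ = u₁} p ε = u₁ , ε , p
strip {t} p (q ◅ qs) with strip (par-develop q) qs
... | w , a , b = w , (par-develop p ◅ a) , b

church-rosser : ∀ {t u} → Conv λ*U t u → Σ Tm (λ w → ParSteps t w × ParSteps u w)
church-rosser {t} ε = t , ε , ε
church-rosser (fwd r ◅ rs) with church-rosser rs
... | w , a , b = w , (Step⇛ r ◅ a) , b
church-rosser (bwd r ◅ rs) with church-rosser rs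
... | w , a , b with strip (Step⇛ r) a
... | w' , c , d = w' , c , (b ◅◅ (d ◅ ε))

Pi-ParSteps : ∀ {A B w} → ParSteps (Pi A B) w → Σ Tm (λ A' → Σ Tm (λ B' → w ≡ Pi A' B' × ParSteps A A' × ParSteps B B'))
Pi-ParSteps ε = _ , _ , refl , ε , ε
Pi-ParSteps (pPi p q ◅ ps) with Pi-ParSteps ps
... | A' , B' , refl , a , b = A' , B' , refl , (p ◅ a) , (q ◅ b)

Pi-inj : ∀ {A B A' B'} → Conv λ*U (Pi A B) (Pi A' B') → Conv λ*U A A' × Conv λ*U B B'
Pi-inj c with church-rosser c
... | w , a , b with Pi-ParSteps a | Pi-ParSteps b
... | X , Y , refl , a1 , a2 | .X , .Y , refl , b1 , b2 =
  (ParSteps⇒Conv a1 ∙ ⁻ (ParSteps⇒Conv b1)) , (ParSteps⇒Conv a2 ∙ ⁻ (ParSteps⇒Conv b2))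

data WF (s : Sys) : Ctx → Set where
  [] : WF s []
  _∷_ : ∀ {Γ A} → Γ ⊢[ s ] A ∶ ⋆ → WF s Γ → WF s (A ∷ Γ)

infix 3 _∋_∶_
data _∋_∶_ : Ctx → ℕ → Tm → Set where
  here : ∀ {Γ A} → (A ∷ Γ) ∋ 0 ∶ shift 1 A
  there : ∀ {Γ A k B} → Γ ∋ k ∶ B → (A ∷ Γ) ∋ suc k ∶ shift 1 B

retype : ∀ {s Γ t C C'} → C ≡ C' → Γ ⊢[ s ] t ∶ C → Γ ⊢[ s ] t ∶ C'
retype refl D = D

reterm : ∀ {s Γ t t' C} → t ≡ t' → Γ ⊢[ s ] t ∶ C → Γ ⊢[ s ] t' ∶ C
reterm refl D = D

Closed : Tm → Set
Closed t = ∀ f → rename f t ≡ t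

closed-typed : ∀ {s Γ t C} → Closed t → Closed C → [] ⊢[ s ] t ∶ C → WF s Γ → Γ ⊢[ s ] t ∶ C
closed-typed cl-t cl-C D [] = D
closed-typed cl-t cl-C D (E ∷ w) = reterm (cl-t suc) (retype (cl-C suc) (weak (closed-typed cl-t cl-C D w) E))

var-typed : ∀ {s Γ k B} → WF s Γ → Γ ∋ k ∶ B → Γ ⊢[ s ] var k ∶ B
var-typed (E ∷ w) here = var0 E
var-typed (E ∷ w) (there x) = weak (var-typed w x) E

ctype-sub : ∀ c σ → subst σ (ctype c) ≡ ctype c
ctype-sub cU σ = refl
ctype-sub cPî σ = refl
ctype-sub cSĝ σ = refl
ctype-sub c⋆̂ σ = refl
ctype-sub cT σ = refl
ctype-sub cEq σ = refl
ctype-sub cRel σ = refl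
ctype-sub crefl σ = refl
ctype-sub cPî* σ = refl
ctype-sub cSĝ* σ = refl

ctype-closed : ∀ c → Closed (ctype c)
ctype-closed c f = trans (ren-as-sub f (ctype c)) (ctype-sub c (var ∘ f))

TypedSubst : Ctx → (ℕ → Tm) → Ctx → Set
TypedSubst Δ σ Γ = WF λ*U≈ Δ × (∀ {k B} → Γ ∋ k ∶ B → Δ ⊢[ λ*U≈ ] σ k ∶ subst σ B)

TypedSubst-ext : ∀ {Δ σ Γ A} → TypedSubst Δ σ Γ → Δ ⊢[ λ*U≈ ] subst σ A ∶ ⋆ → TypedSubst (subst σ A ∷ Δ) (extS σ) (A ∷ Γ)
TypedSubst-ext {σ = σ} {A = A} (w , h) E = (E ∷ w) , λ
  { here → retype (sym (extS-shift σ A)) (var0 E)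
  ; (there {B = B} x) → retype (sym (extS-shift σ B)) (weak (h x) E) }

TypedSubst-down : ∀ {Δ σ Γ A} → TypedSubst Δ σ (A ∷ Γ) → TypedSubst Δ (σ ∘ suc) Γ
TypedSubst-down {σ = σ} (w , h) = w , λ { {B = B} x → retype (subst-rename σ suc B) (h (there x)) }

⋆-typed : ∀ {s Γ} → WF s Γ → Γ ⊢[ s ] ⋆ ∶ ⋆
⋆-typed w = closed-typed (λ _ → refl) (λ _ → refl) ax w

-- The annotated judgement ⊢v: the rules of λ*U, restricted to the
-- constants allowed by Al, whose binding and eliminating rules also record
-- the typing of the domain and codomain involved.  These extra premises
-- are what the abstraction theorem needs as induction hypotheses.
module Annotated (Al : Const → Set) where

  infix 3 _⊢v_∶_
  data _⊢v_∶_ : Ctx → Tm → Tm → Set where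
    ax    : [] ⊢v ⋆ ∶ ⋆
    const : ∀ c → Al c → [] ⊢v con c ∶ ctype c
    var0  : ∀ {Γ A} → Γ ⊢v A ∶ ⋆ → (A ∷ Γ) ⊢v var 0 ∶ shift 1 A
    weak  : ∀ {Γ A t B} → Γ ⊢v t ∶ B → Γ ⊢v A ∶ ⋆ → (A ∷ Γ) ⊢v shift 1 t ∶ shift 1 B
    piF   : ∀ {Γ A B} → Γ ⊢v A ∶ ⋆ → (A ∷ Γ) ⊢v B ∶ ⋆ → Γ ⊢v Pi A B ∶ ⋆
    sgF   : ∀ {Γ A B} → Γ ⊢v A ∶ ⋆ → (A ∷ Γ) ⊢v B ∶ ⋆ → Γ ⊢v Sg A B ∶ ⋆
    abs   : ∀ {Γ A b B} → (A ∷ Γ) ⊢v b ∶ B → Γ ⊢v A ∶ ⋆ → (A ∷ Γ) ⊢v B ∶ ⋆ → Γ ⊢v lam A b ∶ Pi A B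
    appl  : ∀ {Γ f a A B} → Γ ⊢v f ∶ Pi A B → Γ ⊢v a ∶ A → Γ ⊢v A ∶ ⋆ → (A ∷ Γ) ⊢v B ∶ ⋆ →
            Γ ⊢v (B [ a ]) ∶ ⋆ → Γ ⊢v app f a ∶ (B [ a ])
    pairI : ∀ {Γ a b A B} → Γ ⊢v a ∶ A → Γ ⊢v b ∶ (B [ a ]) → Γ ⊢v A ∶ ⋆ → (A ∷ Γ) ⊢v B ∶ ⋆ →
            Γ ⊢v pair a b ∶ Sg A B
    proj₁I : ∀ {Γ p A B} → Γ ⊢v p ∶ Sg A B → Γ ⊢v A ∶ ⋆ → (A ∷ Γ) ⊢v B ∶ ⋆ → Γ ⊢v fst p ∶ A
    proj₂I : ∀ {Γ p A B} → Γ ⊢v p ∶ Sg A B → Γ ⊢v A ∶ ⋆ → (A ∷ Γ) ⊢v B ∶ ⋆ →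
             Γ ⊢v (B [ fst p ]) ∶ ⋆ → Γ ⊢v snd p ∶ (B [ fst p ])
    conv  : ∀ {Γ t A B} → Γ ⊢v t ∶ A → Conv λ*U A B → Γ ⊢v B ∶ ⋆ → Γ ⊢v t ∶ B

  data WFv : Ctx → Set where
    [] : WFv []
    _∷_ : ∀ {Γ A} → Γ ⊢v A ∶ ⋆ → WFv Γ → WFv (A ∷ Γ)

  retypeᵛ : ∀ {Γ t C C'} → C ≡ C' → Γ ⊢v t ∶ C → Γ ⊢v t ∶ C'
  retypeᵛ refl D = D

  retermᵛ : ∀ {Γ t t' C} → t ≡ t' → Γ ⊢v t ∶ C → Γ ⊢v t' ∶ C
  retermᵛ refl D = D

  closed-typedᵛ : ∀ {Γ t C} → Closed t → Closed C → [] ⊢v t ∶ C → WFv Γ → Γ ⊢v t ∶ C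
  closed-typedᵛ cl-t cl-C D [] = D
  closed-typedᵛ cl-t cl-C D (E ∷ w) = retermᵛ (cl-t suc) (retypeᵛ (cl-C suc) (weak (closed-typedᵛ cl-t cl-C D w) E))

  var-typedᵛ : ∀ {Γ k B} → WFv Γ → Γ ∋ k ∶ B → Γ ⊢v var k ∶ B
  var-typedᵛ (E ∷ w) here = var0 E
  var-typedᵛ (E ∷ w) (there x) = weak (var-typedᵛ w x) E

  ctx-wfᵛ : ∀ {Γ t C} → Γ ⊢v t ∶ C → WFv Γ
  ctx-wfᵛ ax = []
  ctx-wfᵛ (const c x) = []
  ctx-wfᵛ (var0 D) = D ∷ ctx-wfᵛ D
  ctx-wfᵛ (weak D E) = E ∷ ctx-wfᵛ D
  ctx-wfᵛ (piF D E) = ctx-wfᵛ D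
  ctx-wfᵛ (sgF D E) = ctx-wfᵛ D
  ctx-wfᵛ (abs D E F) = ctx-wfᵛ E
  ctx-wfᵛ (appl D E _ _ _) = ctx-wfᵛ E
  ctx-wfᵛ (pairI D E _ _) = ctx-wfᵛ D
  ctx-wfᵛ (proj₁I D _ _) = ctx-wfᵛ D
  ctx-wfᵛ (proj₂I D _ _ _) = ctx-wfᵛ D
  ctx-wfᵛ (conv D _ _) = ctx-wfᵛ D

  ⋆-typedᵛ : ∀ {Γ} → WFv Γ → Γ ⊢v ⋆ ∶ ⋆
  ⋆-typedᵛ w = closed-typedᵛ (λ _ → refl) (λ _ → refl) ax w

  TypedSubstᵛ : Ctx → (ℕ → Tm) → Ctx → Set
  TypedSubstᵛ Δ σ Γ = WFv Δ × (∀ {k B} → Γ ∋ k ∶ B → Δ ⊢v σ k ∶ subst σ B)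

  TypedSubstᵛ-ext : ∀ {Δ σ Γ A} → TypedSubstᵛ Δ σ Γ → Δ ⊢v subst σ A ∶ ⋆ → TypedSubstᵛ (subst σ A ∷ Δ) (extS σ) (A ∷ Γ)
  TypedSubstᵛ-ext {σ = σ} {A = A} (w , h) E = (E ∷ w) , λ
    { here → retypeᵛ (sym (extS-shift σ A)) (var0 E)
    ; (there {B = B} x) → retypeᵛ (sym (extS-shift σ B)) (weak (h x) E) }

  TypedSubstᵛ-down : ∀ {Δ σ Γ A} → TypedSubstᵛ Δ σ (A ∷ Γ) → TypedSubstᵛ Δ (σ ∘ suc) Γ
  TypedSubstᵛ-down {σ = σ} (w , h) = w , λ { {B = B} x → retypeᵛ (subst-rename σ suc B) (h (there x)) }

  substᵛ : ∀ {Γ t C Δ σ} → Γ ⊢v t ∶ C → TypedSubstᵛ Δ σ Γ → Δ ⊢v subst σ t ∶ subst σ C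
  substᵛ ax (w , h) = ⋆-typedᵛ w
  substᵛ {σ = σ} (const c a) (w , h) = retypeᵛ (sym (ctype-sub c σ)) (closed-typedᵛ (λ _ → refl) (ctype-closed c) (const c a) w)
  substᵛ (var0 D) (w , h) = h here
  substᵛ {σ = σ} (weak {t = t} {B} D E) ok =
    retermᵛ (sym (subst-rename σ suc t)) (retypeᵛ (sym (subst-rename σ suc B)) (substᵛ D (TypedSubstᵛ-down ok)))
  substᵛ (piF D E) ok = piF (substᵛ D ok) (substᵛ E (TypedSubstᵛ-ext ok (substᵛ D ok)))
  substᵛ (sgF D E) ok = sgF (substᵛ D ok) (substᵛ E (TypedSubstᵛ-ext ok (substᵛ D ok)))
  substᵛ (abs D E F) ok = abs (substᵛ D (TypedSubstᵛ-ext ok (substᵛ E ok))) (substᵛ E ok) (substᵛ F (TypedSubstᵛ-ext ok (substᵛ E ok)))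
  substᵛ {σ = σ} (appl {a = a} {B = B} D E F G H) ok =
    retypeᵛ (sym (subst-single σ B a))
      (appl (substᵛ D ok) (substᵛ E ok) (substᵛ F ok) (substᵛ G (TypedSubstᵛ-ext ok (substᵛ F ok)))
        (retermᵛ (subst-single σ B a) (substᵛ H ok)))
  substᵛ {σ = σ} (pairI {a = a} {B = B} D E F G) ok =
    pairI (substᵛ D ok) (retypeᵛ (subst-single σ B a) (substᵛ E ok)) (substᵛ F ok) (substᵛ G (TypedSubstᵛ-ext ok (substᵛ F ok)))
  substᵛ (proj₁I D E F) ok = proj₁I (substᵛ D ok) (substᵛ E ok) (substᵛ F (TypedSubstᵛ-ext ok (substᵛ E ok)))
  substᵛ {σ = σ} (proj₂I {p = p} {B = B} D E F G) ok =
    retypeᵛ (sym (subst-single σ B (fst p)))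
      (proj₂I (substᵛ D ok) (substᵛ E ok) (substᵛ F (TypedSubstᵛ-ext ok (substᵛ E ok)))
        (retermᵛ (subst-single σ B (fst p)) (substᵛ G ok)))
  substᵛ {σ = σ} (conv D c E) ok = conv (substᵛ D ok) (Conv-subst σ c) (substᵛ E ok)

  single-substᵛ : ∀ {Γ A B a t} → (A ∷ Γ) ⊢v t ∶ B → Γ ⊢v a ∶ A → Γ ⊢v t [ a ] ∶ B [ a ]
  single-substᵛ {Γ} {A} {a = a} D E = substᵛ D (ctx-wfᵛ E , λ
    { here → retypeᵛ (sym (sub-single-shift a A)) E
    ; (there {B = B} x) → retypeᵛ (sym (sub-single-shift a B)) (var-typedᵛ (ctx-wfᵛ E) x) })

  TypedSubstᵛ-weaken₁ : ∀ {Γ A X} → Γ ⊢v A ∶ ⋆ → Γ ⊢v X ∶ ⋆ →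
    TypedSubstᵛ (shift 1 A ∷ X ∷ Γ) (var ∘ extR suc) (A ∷ Γ)
  TypedSubstᵛ-weaken₁ {Γ} {A} {X} DA DX = ((weak DA DX) ∷ (DX ∷ ctx-wfᵛ DA)) , λ
    { here → retypeᵛ (e A) (var0 (weak DA DX))
    ; (there {B = B} x) → retypeᵛ (e B) (weak (weak (var-typedᵛ (ctx-wfᵛ DA) x) DX) (weak DA DX)) }
    where
    e : ∀ B → shift 1 (shift 1 B) ≡ subst (var ∘ extR suc) (shift 1 B)
    e B = trans (rename-rename suc suc B) (trans (rename-cong (λ _ → refl) B)
          (trans (sym (rename-rename (extR suc) suc B)) (ren-as-sub (extR suc) (shift 1 B))))

  Pi-generation : ∀ {Γ t S A B} → Γ ⊢v t ∶ S → t ≡ Pi A B → Γ ⊢v A ∶ ⋆ × (A ∷ Γ) ⊢v B ∶ ⋆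
  Pi-generation (weak {t = Pi A' B'} D E) refl with Pi-generation D refl
  ... | DA , DB = weak DA E , retermᵛ (sym (ren-as-sub (extR suc) B')) (retypeᵛ refl (substᵛ DB (TypedSubstᵛ-weaken₁ DA E)))
  Pi-generation (piF D E) refl = D , E
  Pi-generation (conv D x E) eq = Pi-generation D eq

  Sg-generation : ∀ {Γ t S A B} → Γ ⊢v t ∶ S → t ≡ Sg A B → Γ ⊢v A ∶ ⋆ × (A ∷ Γ) ⊢v B ∶ ⋆
  Sg-generation (weak {t = Sg A' B'} D E) refl with Sg-generation D refl
  ... | DA , DB = weak DA E , retermᵛ (sym (ren-as-sub (extR suc) B')) (retypeᵛ refl (substᵛ DB (TypedSubstᵛ-weaken₁ DA E)))
  Sg-generation (sgF D E) refl = D , E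
  Sg-generation (conv D x E) eq = Sg-generation D eq

  subst-typed≈ : ∀ {Γ t C Δ σ} → Γ ⊢v t ∶ C → TypedSubst Δ σ Γ → Δ ⊢[ λ*U≈ ] subst σ t ∶ subst σ C
  subst-typed≈ ax (w , h) = ⋆-typed w
  subst-typed≈ {σ = σ} (const c a) (w , h) = retype (sym (ctype-sub c σ)) (closed-typed (λ _ → refl) (ctype-closed c) (const c (E-all c)) w)
  subst-typed≈ (var0 D) (w , h) = h here
  subst-typed≈ {σ = σ} (weak {t = t} {B} D E) ok =
    reterm (sym (subst-rename σ suc t)) (retype (sym (subst-rename σ suc B)) (subst-typed≈ D (TypedSubst-down ok)))
  subst-typed≈ (piF D E) ok = piF (subst-typed≈ D ok) (subst-typed≈ E (TypedSubst-ext ok (subst-typed≈ D ok)))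
  subst-typed≈ (sgF D E) ok = sgF (subst-typed≈ D ok) (subst-typed≈ E (TypedSubst-ext ok (subst-typed≈ D ok)))
  subst-typed≈ (abs D E F) ok = abs (subst-typed≈ D (TypedSubst-ext ok (subst-typed≈ E ok))) (piF (subst-typed≈ E ok) (subst-typed≈ F (TypedSubst-ext ok (subst-typed≈ E ok))))
  subst-typed≈ {σ = σ} (appl {a = a} {B = B} D E F G H) ok =
    retype (sym (subst-single σ B a)) (appl (subst-typed≈ D ok) (subst-typed≈ E ok))
  subst-typed≈ {σ = σ} (pairI {a = a} {B = B} D E F G) ok =
    pairI (subst-typed≈ D ok) (retype (subst-single σ B a) (subst-typed≈ E ok)) (sgF (subst-typed≈ F ok) (subst-typed≈ G (TypedSubst-ext ok (subst-typed≈ F ok))))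
  subst-typed≈ (proj₁I D E F) ok = proj₁I (subst-typed≈ D ok)
  subst-typed≈ {σ = σ} (proj₂I {p = p} {B = B} D E F G) ok =
    retype (sym (subst-single σ B (fst p))) (proj₂I (subst-typed≈ D ok))
  subst-typed≈ {σ = σ} (conv D c E) ok = conv (subst-typed≈ D ok) (Conv-emb (Conv-subst σ c)) (subst-typed≈ E ok)

module Annotate where
  open Annotated (Allowed λ*U)

  wf-Uᵛ : WFv (U· ∷ [])
  wf-Uᵛ = const cU U-U ∷ []

  U-typedᵛ : ∀ {Γ} → WFv Γ → Γ ⊢v U· ∶ ⋆
  U-typedᵛ w = closed-typedᵛ (λ _ → refl) (λ _ → refl) (const cU U-U) w

  T-constᵛ : ∀ {Γ} → WFv Γ → Γ ⊢v con cT ∶ Pi U· ⋆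
  T-constᵛ w = closed-typedᵛ (λ _ → refl) (λ _ → refl) (const cT U-T) w

  T0-typedᵛ : ∀ {Γ} → WFv (U· ∷ Γ) → (U· ∷ Γ) ⊢v T· (v 0) ∶ ⋆
  T0-typedᵛ {Γ} w@(E ∷ w') = appl (T-constᵛ w) (var0 E) (U-typedᵛ w) (⋆-typedᵛ (U-typedᵛ w ∷ w)) (⋆-typedᵛ w)

  hatType-typedᵛ : [] ⊢v Pi U· (Pi (Pi (T· (v 0)) U·) U·) ∶ ⋆
  hatType-typedᵛ = piF (U-typedᵛ []) (piF (piF (T0-typedᵛ wf-Uᵛ) (U-typedᵛ (T0-typedᵛ wf-Uᵛ ∷ wf-Uᵛ))) (U-typedᵛ (piF (T0-typedᵛ wf-Uᵛ) (U-typedᵛ (T0-typedᵛ wf-Uᵛ ∷ wf-Uᵛ)) ∷ wf-Uᵛ)))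

  ctype-typedᵛ : ∀ c → Allowed λ*U c → [] ⊢v ctype c ∶ ⋆
  ctype-typedᵛ .cU U-U = ax
  ctype-typedᵛ .cPî U-Pî = hatType-typedᵛ
  ctype-typedᵛ .cSĝ U-Sĝ = hatType-typedᵛ
  ctype-typedᵛ .c⋆̂ U-⋆̂ = U-typedᵛ []
  ctype-typedᵛ .cT U-T = piF (U-typedᵛ []) (⋆-typedᵛ wf-Uᵛ)

  validity : ∀ {Γ t C} → Γ ⊢v t ∶ C → Γ ⊢v C ∶ ⋆
  validity ax = ax
  validity (const c a) = ctype-typedᵛ c a
  validity (var0 D) = weak D D
  validity (weak D E) = weak (validity D) E
  validity (piF D E) = ⋆-typedᵛ (ctx-wfᵛ D)
  validity (sgF D E) = ⋆-typedᵛ (ctx-wfᵛ D)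
  validity (abs D E F) = piF E F
  validity (appl D E F G H) = H
  validity (pairI D E F G) = sgF F G
  validity (proj₁I D E F) = E
  validity (proj₂I D E F G) = G
  validity (conv D c E) = E

  annotate : ∀ {Γ t C} → Γ ⊢[ λ*U ] t ∶ C → Γ ⊢v t ∶ C
  annotate ax = ax
  annotate (const c a) = const c a
  annotate (var0 D) = var0 (annotate D)
  annotate (weak D E) = weak (annotate D) (annotate E)
  annotate (piF D E) = piF (annotate D) (annotate E)
  annotate (sgF D E) = sgF (annotate D) (annotate E)
  annotate (abs D E) with Pi-generation (annotate E) refl
  ... | DA , DB = abs (annotate D) DA DB
  annotate (appl D E) with Pi-generation (validity (annotate D)) refl
  ... | DA , DB = appl (annotate D) (annotate E) DA DB (single-substᵛ DB (annotate E))
  annotate (pairI D E F) with Sg-generation (annotate F) refl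
  ... | DA , DB = pairI (annotate D) (annotate E) DA DB
  annotate (proj₁I D) with Sg-generation (validity (annotate D)) refl
  ... | DA , DB = proj₁I (annotate D) DA DB
  annotate (proj₂I D) with Sg-generation (validity (annotate D)) refl
  ... | DA , DB = proj₂I (annotate D) DA DB (single-substᵛ DB (proj₁I (annotate D) DA DB))
  annotate (conv D c E) = conv (annotate D) c (annotate E)

-- An environment assigns to each variable x its
-- three images (x , x' , x*) as target terms; c0 and c1 are the two copies
-- of a term, str ρ t is its translation t*, and R ρ C x y is the relation
-- of the type C at x and y: Rel C* x y when C is T C', and C* x y otherwise.
TmEnv : Set
TmEnv = ℕ → Tm × Tm × Tm

e0 e1 e2 : TmEnv → ℕ → Tm
e0 ρ k = proj₁ (ρ k)
e1 ρ k = proj₁ (proj₂ (ρ k))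
e2 ρ k = proj₂ (proj₂ (ρ k))

c0 c1 : TmEnv → Tm → Tm
c0 ρ = subst (e0 ρ)
c1 ρ = subst (e1 ρ)

map3 : (Tm → Tm) → Tm × Tm × Tm → Tm × Tm × Tm
map3 f (a , b , c) = f a , f b , f c

cons3 : Tm × Tm × Tm → TmEnv → TmEnv
cons3 x ρ zero = x
cons3 x ρ (suc k) = ρ k

sh : ℕ → TmEnv → TmEnv
sh n ρ k = map3 (shift n) (ρ k)

ext3 : TmEnv → TmEnv
ext3 ρ = cons3 (v 2 , v 1 , v 0) (sh 3 ρ)

lams : List Tm → Tm → Tm
lams [] b = b
lams (A ∷ As) b = lam A (lams As b)

apps : Tm → List Tm → Tm
apps f [] = f
apps f (x ∷ xs) = apps (app f x) xs

-- Translations of ⋆ and of the constants: ⋆* relates two types by a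
-- binary predicate, U* x y = Eq x y, T* = Rel, and Π̂*, Σ̂* are the
-- constructors Π̂*, Σ̂* of Eq (with arguments reordered), *̂* = refl.
⋆ʳ Uʳ Tʳ Pîʳ Sĝʳ : Tm
⋆ʳ = lam ⋆ (lam ⋆ (Pi (v 1) (Pi (v 1) ⋆)))
Uʳ = lam U· (lam U· (Eq· (v 1) (v 0)))
Tʳ = lams (U· ∷ U· ∷ Eq· (v 1) (v 0) ∷ T· (v 2) ∷ T· (v 2) ∷ []) (Rel· (v 4) (v 3) (v 2) (v 1) (v 0))
hatStarBinders : List Tm
hatStarBinders = U· ∷ U· ∷ Eq· (v 1) (v 0) ∷ Pi (T· (v 2)) U· ∷ Pi (T· (v 2)) U· ∷
  Pi (T· (v 4)) (Pi (T· (v 4)) (Pi (Rel· (v 6) (v 5) (v 4) (v 1) (v 0)) (Eq· (app (v 4) (v 2)) (app (v 3) (v 1))))) ∷ []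
Pîʳ = lams hatStarBinders (Pî*· (v 5) (v 4) (v 2) (v 1) (v 3) (v 0))
Sĝʳ = lams hatStarBinders (Sĝ*· (v 5) (v 4) (v 2) (v 1) (v 3) (v 0))

constʳ : Const → Tm
constʳ cU = Uʳ
constʳ cPî = Pîʳ
constʳ cSĝ = Sĝʳ
constʳ c⋆̂ = con crefl
constʳ cT = Tʳ
constʳ _ = ⋆

-- Π̂ X a and Σ̂ X a are translated by Π̂*, Σ̂* directly rather than as
-- applications; T X is recognised for the relation R.
data CodeView : Tm → Set where
  isPî : ∀ {X} → CodeView (app (con cPî) X)
  isSĝ : ∀ {X} → CodeView (app (con cSĝ) X)
  notHat : ∀ {f} → CodeView f

codeView : ∀ f → CodeView f
codeView (app (con cPî) X) = isPî
codeView (app (con cSĝ) X) = isSĝ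
codeView f = notHat

data ElView : Tm → Set where
  isT : ∀ {X} → ElView (app (con cT) X)
  notT : ∀ {C} → ElView C

elView : ∀ C → ElView C
elView (app (con cT) X) = isT
elView C = notT

mutual
  str : TmEnv → Tm → Tm
  str ρ (var k) = e2 ρ k
  str ρ ⋆ = ⋆ʳ
  str ρ (Pi A B) = lam (c0 ρ (Pi A B)) (lam (shift 1 (c1 ρ (Pi A B)))
    (Pi (shift 2 (c0 ρ A)) (Pi (shift 3 (c1 ρ A)) (Pi (R (sh 4 ρ) A (v 1) (v 0))
       (R (ext3 (sh 2 ρ)) B (app (v 4) (v 2)) (app (v 3) (v 1)))))))
  str ρ (Sg A B) = lam (c0 ρ (Sg A B)) (lam (shift 1 (c1 ρ (Sg A B)))
    (Sg (R (sh 2 ρ) A (fst (v 1)) (fst (v 0)))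
        (R (cons3 (fst (v 2) , fst (v 1) , v 0) (sh 3 ρ)) B (snd (v 2)) (snd (v 1)))))
  str ρ (lam A b) = lam (c0 ρ A) (lam (shift 1 (c1 ρ A)) (lam (R (sh 2 ρ) A (v 1) (v 0)) (str (ext3 ρ) b)))
  str ρ (app f a) with codeView f
  ... | isPî {X} = Pî*· (c0 ρ X) (c1 ρ X) (c0 ρ a) (c1 ρ a) (str ρ X) (str ρ a)
  ... | isSĝ {X} = Sĝ*· (c0 ρ X) (c1 ρ X) (c0 ρ a) (c1 ρ a) (str ρ X) (str ρ a)
  ... | notHat = app (app (app (str ρ f) (c0 ρ a)) (c1 ρ a)) (str ρ a)
  str ρ (pair a b) = pair (str ρ a) (str ρ b)
  str ρ (fst p) = fst (str ρ p)
  str ρ (snd p) = snd (str ρ p)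
  str ρ (con c) = constʳ c

  R : TmEnv → Tm → Tm → Tm → Tm
  R ρ C x y with elView C
  ... | isT {X} = Rel· (c0 ρ X) (c1 ρ X) (str ρ X) x y
  ... | notT = app (app (str ρ C) x) y

infix 4 _≈E_

_≈E_ : TmEnv → TmEnv → Set
ρ ≈E ρ' = ∀ k → ρ k ≡ ρ' k

cong3 : ∀ {a b c a' b' c' : Tm} → a ≡ a' → b ≡ b' → c ≡ c' → (a , b , c) ≡ (a' , b' , c')
cong3 refl refl refl = refl

c0-cong : ∀ {ρ ρ'} → ρ ≈E ρ' → ∀ t → c0 ρ t ≡ c0 ρ' t
c0-cong e = subst-cong (λ k → cong proj₁ (e k))
c1-cong : ∀ {ρ ρ'} → ρ ≈E ρ' → ∀ t → c1 ρ t ≡ c1 ρ' t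
c1-cong e = subst-cong (λ k → cong (proj₁ ∘ proj₂) (e k))

sh-cong : ∀ {ρ ρ'} n → ρ ≈E ρ' → sh n ρ ≈E sh n ρ'
sh-cong n e k = cong (map3 (shift n)) (e k)

cons3-cong : ∀ {ρ ρ'} x → ρ ≈E ρ' → cons3 x ρ ≈E cons3 x ρ'
cons3-cong x e zero = refl
cons3-cong x e (suc k) = e k

ext3-cong : ∀ {ρ ρ'} → ρ ≈E ρ' → ext3 ρ ≈E ext3 ρ'
ext3-cong e = cons3-cong _ (sh-cong 3 e)

mutual
  str-cong : ∀ {ρ ρ'} → ρ ≈E ρ' → ∀ t → str ρ t ≡ str ρ' t
  str-cong e (var k) = cong (proj₂ ∘ proj₂) (e k)
  str-cong e ⋆ = refl
  str-cong e (Pi A B) = cong₂ lam (c0-cong e (Pi A B)) (cong₂ lam (cong (shift 1) (c1-cong e (Pi A B)))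
    (cong₂ Pi (cong (shift 2) (c0-cong e A)) (cong₂ Pi (cong (shift 3) (c1-cong e A))
      (cong₂ Pi (R-cong (sh-cong 4 e) A (v 1) (v 0)) (R-cong (ext3-cong (sh-cong 2 e)) B (app (v 4) (v 2)) (app (v 3) (v 1)))))))
  str-cong e (Sg A B) = cong₂ lam (c0-cong e (Sg A B)) (cong₂ lam (cong (shift 1) (c1-cong e (Sg A B)))
    (cong₂ Sg (R-cong (sh-cong 2 e) A (fst (v 1)) (fst (v 0)))
              (R-cong (cons3-cong (fst (v 2) , fst (v 1) , v 0) (sh-cong 3 e)) B (snd (v 2)) (snd (v 1)))))
  str-cong e (lam A b) = cong₂ lam (c0-cong e A) (cong₂ lam (cong (shift 1) (c1-cong e A))
    (cong₂ lam (R-cong (sh-cong 2 e) A (v 1) (v 0)) (str-cong (ext3-cong e) b)))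
  str-cong e (app f a) with codeView f
  ... | isPî {X} = cong₂ app (cong₂ app (cong₂ app (cong₂ app (cong₂ app (cong₂ app refl (c0-cong e X)) (c1-cong e X)) (c0-cong e a)) (c1-cong e a)) (str-cong e X)) (str-cong e a)
  ... | isSĝ {X} = cong₂ app (cong₂ app (cong₂ app (cong₂ app (cong₂ app (cong₂ app refl (c0-cong e X)) (c1-cong e X)) (c0-cong e a)) (c1-cong e a)) (str-cong e X)) (str-cong e a)
  ... | notHat = cong₂ app (cong₂ app (cong₂ app (str-cong e f) (c0-cong e a)) (c1-cong e a)) (str-cong e a)
  str-cong e (pair a b) = cong₂ pair (str-cong e a) (str-cong e b)
  str-cong e (fst p) = cong fst (str-cong e p)
  str-cong e (snd p) = cong snd (str-cong e p)
  str-cong e (con c) = refl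

  R-cong : ∀ {ρ ρ'} → ρ ≈E ρ' → ∀ C x y → R ρ C x y ≡ R ρ' C x y
  R-cong e C x y with elView C
  ... | isT {X} = cong₂ app (cong₂ app (cong₂ app (cong₂ app (cong₂ app refl (c0-cong e X)) (c1-cong e X)) (str-cong e X)) refl) refl
  ... | notT = cong₂ app (cong₂ app (str-cong e C) refl) refl

subE : (ℕ → Tm) → TmEnv → TmEnv
subE τ ρ k = map3 (subst τ) (ρ k)

c0-tsub : ∀ τ ρ t → subst τ (c0 ρ t) ≡ c0 (subE τ ρ) t
c0-tsub τ ρ t = subst-subst τ (e0 ρ) t
c1-tsub : ∀ τ ρ t → subst τ (c1 ρ t) ≡ c1 (subE τ ρ) t
c1-tsub τ ρ t = subst-subst τ (e1 ρ) t

sh-subE : ∀ n τ ρ → subE (extSn n τ) (sh n ρ) ≈E sh n (subE τ ρ)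
sh-subE n τ ρ k = cong3 (extSn-shift n τ (e0 ρ k)) (extSn-shift n τ (e1 ρ k)) (extSn-shift n τ (e2 ρ k))

sh-sh : ∀ m n ρ → sh m (sh n ρ) ≈E sh (m + n) ρ
sh-sh m n ρ k = cong3 (shift-shift m n (e0 ρ k)) (shift-shift m n (e1 ρ k)) (shift-shift m n (e2 ρ k))

ext3-subE : ∀ τ ρ → subE (extSn 3 τ) (ext3 ρ) ≈E ext3 (subE τ ρ)
ext3-subE τ ρ zero = refl
ext3-subE τ ρ (suc k) = sh-subE 3 τ ρ k

mutual
  str-tsub : ∀ τ ρ t → subst τ (str ρ t) ≡ str (subE τ ρ) t
  str-tsub τ ρ (var k) = refl
  str-tsub τ ρ ⋆ = refl
  str-tsub τ ρ (Pi A B) =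
    cong₂ lam (c0-tsub τ ρ (Pi A B)) (cong₂ lam (trans (extS-shift τ (c1 ρ (Pi A B))) (cong (shift 1) (c1-tsub τ ρ (Pi A B))))
    (cong₂ Pi (trans (extSn-shift 2 τ (c0 ρ A)) (cong (shift 2) (c0-tsub τ ρ A)))
    (cong₂ Pi (trans (extSn-shift 3 τ (c1 ρ A)) (cong (shift 3) (c1-tsub τ ρ A)))
    (cong₂ Pi (trans (R-tsub (extSn 4 τ) (sh 4 ρ) A (v 1) (v 0)) (R-cong (sh-subE 4 τ ρ) A (v 1) (v 0)))
      (trans (R-tsub (extSn 5 τ) (ext3 (sh 2 ρ)) B (app (v 4) (v 2)) (app (v 3) (v 1)))
        (R-cong {ρ' = ext3 (sh 2 (subE τ ρ))}
          (λ { zero → refl ; (suc k) → trans (cong (map3 (subst (extSn 5 τ))) (sh-sh 3 2 ρ k)) (trans (sh-subE 5 τ ρ k) (sym (sh-sh 3 2 (subE τ ρ) k))) })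
        B (app (v 4) (v 2)) (app (v 3) (v 1))))))))
  str-tsub τ ρ (Sg A B) =
    cong₂ lam (c0-tsub τ ρ (Sg A B)) (cong₂ lam (trans (extS-shift τ (c1 ρ (Sg A B))) (cong (shift 1) (c1-tsub τ ρ (Sg A B))))
    (cong₂ Sg (trans (R-tsub (extSn 2 τ) (sh 2 ρ) A (fst (v 1)) (fst (v 0))) (R-cong (sh-subE 2 τ ρ) A (fst (v 1)) (fst (v 0))))
      (trans (R-tsub (extSn 3 τ) (cons3 (fst (v 2) , fst (v 1) , v 0) (sh 3 ρ)) B (snd (v 2)) (snd (v 1)))
        (R-cong {ρ' = cons3 (fst (v 2) , fst (v 1) , v 0) (sh 3 (subE τ ρ))} (λ { zero → refl ; (suc k) → sh-subE 3 τ ρ k })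
          B (snd (v 2)) (snd (v 1))))))
  str-tsub τ ρ (lam A b) =
    cong₂ lam (c0-tsub τ ρ A) (cong₂ lam (trans (extS-shift τ (c1 ρ A)) (cong (shift 1) (c1-tsub τ ρ A)))
    (cong₂ lam (trans (R-tsub (extSn 2 τ) (sh 2 ρ) A (v 1) (v 0)) (R-cong (sh-subE 2 τ ρ) A (v 1) (v 0)))
      (trans (str-tsub (extSn 3 τ) (ext3 ρ) b) (str-cong (ext3-subE τ ρ) b))))
  str-tsub τ ρ (app f a) with codeView f
  ... | isPî {X} = cong₂ app (cong₂ app (cong₂ app (cong₂ app (cong₂ app (cong₂ app refl (c0-tsub τ ρ X)) (c1-tsub τ ρ X)) (c0-tsub τ ρ a)) (c1-tsub τ ρ a)) (str-tsub τ ρ X)) (str-tsub τ ρ a)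
  ... | isSĝ {X} = cong₂ app (cong₂ app (cong₂ app (cong₂ app (cong₂ app (cong₂ app refl (c0-tsub τ ρ X)) (c1-tsub τ ρ X)) (c0-tsub τ ρ a)) (c1-tsub τ ρ a)) (str-tsub τ ρ X)) (str-tsub τ ρ a)
  ... | notHat = cong₂ app (cong₂ app (cong₂ app (str-tsub τ ρ f) (c0-tsub τ ρ a)) (c1-tsub τ ρ a)) (str-tsub τ ρ a)
  str-tsub τ ρ (pair a b) = cong₂ pair (str-tsub τ ρ a) (str-tsub τ ρ b)
  str-tsub τ ρ (fst p) = cong fst (str-tsub τ ρ p)
  str-tsub τ ρ (snd p) = cong snd (str-tsub τ ρ p)
  str-tsub τ ρ (con cU) = refl
  str-tsub τ ρ (con cPî) = refl
  str-tsub τ ρ (con cSĝ) = refl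
  str-tsub τ ρ (con c⋆̂) = refl
  str-tsub τ ρ (con cT) = refl
  str-tsub τ ρ (con cEq) = refl
  str-tsub τ ρ (con cRel) = refl
  str-tsub τ ρ (con crefl) = refl
  str-tsub τ ρ (con cPî*) = refl
  str-tsub τ ρ (con cSĝ*) = refl

  R-tsub : ∀ τ ρ C x y → subst τ (R ρ C x y) ≡ R (subE τ ρ) C (subst τ x) (subst τ y)
  R-tsub τ ρ C x y with elView C
  ... | isT {X} = cong₂ app (cong₂ app (cong₂ app (cong₂ app (cong₂ app refl (c0-tsub τ ρ X)) (c1-tsub τ ρ X)) (str-tsub τ ρ X)) refl) refl
  ... | notT = cong₂ app (cong₂ app (str-tsub τ ρ C) refl) refl

codeView-ren : ∀ g f → codeView f ≡ notHat → codeView (rename g f) ≡ notHat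
codeView-ren g (var x) e = refl
codeView-ren g ⋆ e = refl
codeView-ren g (Pi f f₁) e = refl
codeView-ren g (Sg f f₁) e = refl
codeView-ren g (lam f f₁) e = refl
codeView-ren g (app (var x) X) e = refl
codeView-ren g (app ⋆ X) e = refl
codeView-ren g (app (Pi _ _) X) e = refl
codeView-ren g (app (Sg _ _) X) e = refl
codeView-ren g (app (lam _ _) X) e = refl
codeView-ren g (app (app _ _) X) e = refl
codeView-ren g (app (pair _ _) X) e = refl
codeView-ren g (app (fst _) X) e = refl
codeView-ren g (app (snd _) X) e = refl
codeView-ren g (app (con cU) X) e = refl
codeView-ren g (app (con cPî) X) ()
codeView-ren g (app (con cSĝ) X) ()
codeView-ren g (app (con c⋆̂) X) e = refl
codeView-ren g (app (con cT) X) e = refl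
codeView-ren g (app (con cEq) X) e = refl
codeView-ren g (app (con cRel) X) e = refl
codeView-ren g (app (con crefl) X) e = refl
codeView-ren g (app (con cPî*) X) e = refl
codeView-ren g (app (con cSĝ*) X) e = refl
codeView-ren g (pair f f₁) e = refl
codeView-ren g (fst f) e = refl
codeView-ren g (snd f) e = refl
codeView-ren g (con x) e = refl

elView-ren : ∀ g f → elView f ≡ notT → elView (rename g f) ≡ notT
elView-ren g (var x) e = refl
elView-ren g ⋆ e = refl
elView-ren g (Pi f f₁) e = refl
elView-ren g (Sg f f₁) e = refl
elView-ren g (lam f f₁) e = refl
elView-ren g (app (var x) X) e = refl
elView-ren g (app ⋆ X) e = refl
elView-ren g (app (Pi _ _) X) e = refl
elView-ren g (app (Sg _ _) X) e = refl
elView-ren g (app (lam _ _) X) e = refl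
elView-ren g (app (app _ _) X) e = refl
elView-ren g (app (pair _ _) X) e = refl
elView-ren g (app (fst _) X) e = refl
elView-ren g (app (snd _) X) e = refl
elView-ren g (app (con cU) X) e = refl
elView-ren g (app (con cPî) X) e = refl
elView-ren g (app (con cSĝ) X) e = refl
elView-ren g (app (con c⋆̂) X) e = refl
elView-ren g (app (con cT) X) ()
elView-ren g (app (con cEq) X) e = refl
elView-ren g (app (con cRel) X) e = refl
elView-ren g (app (con crefl) X) e = refl
elView-ren g (app (con cPî*) X) e = refl
elView-ren g (app (con cSĝ*) X) e = refl
elView-ren g (pair f f₁) e = refl
elView-ren g (fst f) e = refl
elView-ren g (snd f) e = refl
elView-ren g (con x) e = refl

c0-sren : ∀ ρ g t → c0 ρ (rename g t) ≡ c0 (ρ ∘ g) t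
c0-sren ρ g t = subst-rename (e0 ρ) g t
c1-sren : ∀ ρ g t → c1 ρ (rename g t) ≡ c1 (ρ ∘ g) t
c1-sren ρ g t = subst-rename (e1 ρ) g t

mutual
  str-sren : ∀ ρ g t → str ρ (rename g t) ≡ str (ρ ∘ g) t
  str-sren ρ g (var k) = refl
  str-sren ρ g ⋆ = refl
  str-sren ρ g (Pi A B) =
    cong₂ lam (c0-sren ρ g (Pi A B)) (cong₂ lam (cong (shift 1) (c1-sren ρ g (Pi A B)))
    (cong₂ Pi (cong (shift 2) (c0-sren ρ g A)) (cong₂ Pi (cong (shift 3) (c1-sren ρ g A))
    (cong₂ Pi (R-sren (sh 4 ρ) g A (v 1) (v 0))
      (trans (R-sren (ext3 (sh 2 ρ)) (extR g) B (app (v 4) (v 2)) (app (v 3) (v 1)))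
        (R-cong (λ { zero → refl ; (suc k) → refl }) B (app (v 4) (v 2)) (app (v 3) (v 1))))))))
  str-sren ρ g (Sg A B) =
    cong₂ lam (c0-sren ρ g (Sg A B)) (cong₂ lam (cong (shift 1) (c1-sren ρ g (Sg A B)))
    (cong₂ Sg (R-sren (sh 2 ρ) g A (fst (v 1)) (fst (v 0)))
      (trans (R-sren (cons3 (fst (v 2) , fst (v 1) , v 0) (sh 3 ρ)) (extR g) B (snd (v 2)) (snd (v 1)))
        (R-cong (λ { zero → refl ; (suc k) → refl }) B (snd (v 2)) (snd (v 1))))))
  str-sren ρ g (lam A b) =
    cong₂ lam (c0-sren ρ g A) (cong₂ lam (cong (shift 1) (c1-sren ρ g A))
    (cong₂ lam (R-sren (sh 2 ρ) g A (v 1) (v 0))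
      (trans (str-sren (ext3 ρ) (extR g) b) (str-cong (λ { zero → refl ; (suc k) → refl }) b))))
  str-sren ρ g (app f a) with codeView f in eq
  ... | isPî {X} = cong₂ app (cong₂ app (cong₂ app (cong₂ app (cong₂ app (cong₂ app refl (c0-sren ρ g X)) (c1-sren ρ g X)) (c0-sren ρ g a)) (c1-sren ρ g a)) (str-sren ρ g X)) (str-sren ρ g a)
  ... | isSĝ {X} = cong₂ app (cong₂ app (cong₂ app (cong₂ app (cong₂ app (cong₂ app refl (c0-sren ρ g X)) (c1-sren ρ g X)) (c0-sren ρ g a)) (c1-sren ρ g a)) (str-sren ρ g X)) (str-sren ρ g a)
  ... | notHat rewrite codeView-ren g f eq = cong₂ app (cong₂ app (cong₂ app (str-sren ρ g f) (c0-sren ρ g a)) (c1-sren ρ g a)) (str-sren ρ g a)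
  str-sren ρ g (pair a b) = cong₂ pair (str-sren ρ g a) (str-sren ρ g b)
  str-sren ρ g (fst p) = cong fst (str-sren ρ g p)
  str-sren ρ g (snd p) = cong snd (str-sren ρ g p)
  str-sren ρ g (con c) = refl

  R-sren : ∀ ρ g C x y → R ρ (rename g C) x y ≡ R (ρ ∘ g) C x y
  R-sren ρ g C x y with elView C in eq
  ... | isT {X} = cong₂ app (cong₂ app (cong₂ app (cong₂ app (cong₂ app refl (c0-sren ρ g X)) (c1-sren ρ g X)) (str-sren ρ g X)) refl) refl
  ... | notT rewrite elView-ren g C eq = cong₂ app (cong₂ app (str-sren ρ g C) refl) refl

Conv≈ : Tm → Tm → Set
Conv≈ = Conv λ*U≈

apps-step : ∀ {s f f'} xs → Step s f f' → Step s (apps f xs) (apps f' xs)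
apps-step [] r = r
apps-step (x ∷ xs) r = apps-step xs (app₁ r)

β-apps : ∀ {s} σ As body args → length As ≡ length args →
  Star (Step s) (apps (subst σ (lams As body)) args) (subst (consAll args σ) body)
β-apps σ [] body [] e = ε
β-apps {s} σ (A ∷ As) body (x ∷ xs) e =
  apps-step xs (here β) ◅
  ≡subst (λ z → Star (Step s) (apps z xs) (subst (consAll xs (consS x σ)) body)) (sym eq)
    (β-apps (consS x σ) As body xs (cong pred e))
  where
  pred : ℕ → ℕ
  pred zero = zero
  pred (suc n) = n
  eq : (subst (extS σ) (lams As body)) [ x ] ≡ subst (consS x σ) (lams As body)
  eq = sub-ext-single σ (lams As body) x

β-apps≈ : ∀ As body args → length As ≡ length args →
  Conv≈ (apps (lams As body) args) (subst (consAll args var) body)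
β-apps≈ As body args e = ≡subst (λ z → Conv≈ (apps z args) _) (subst-id (lams As body)) (Steps⇒Conv (β-apps var As body args e))

strApp : TmEnv → Tm → Tm → Tm
strApp ρ f a = app (app (app (str ρ f) (c0 ρ a)) (c1 ρ a)) (str ρ a)

str-app : ∀ ρ f a → Conv≈ (str ρ (app f a)) (strApp ρ f a)
str-app ρ f a with codeView f
... | isPî {X} = ⁻ (β-apps≈ hatStarBinders (Pî*· (v 5) (v 4) (v 2) (v 1) (v 3) (v 0))
                     (c0 ρ X ∷ c1 ρ X ∷ str ρ X ∷ c0 ρ a ∷ c1 ρ a ∷ str ρ a ∷ []) refl)
... | isSĝ {X} = ⁻ (β-apps≈ hatStarBinders (Sĝ*· (v 5) (v 4) (v 2) (v 1) (v 3) (v 0))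
                     (c0 ρ X ∷ c1 ρ X ∷ str ρ X ∷ c0 ρ a ∷ c1 ρ a ∷ str ρ a ∷ []) refl)
... | notHat = ε

relApp : TmEnv → Tm → Tm → Tm → Tm
relApp ρ C x y = app (app (str ρ C) x) y

R-unfold : ∀ ρ C x y → Conv≈ (R ρ C x y) (relApp ρ C x y)
R-unfold ρ C x y with elView C
... | isT {X} = ⁻ (β-apps≈ (U· ∷ U· ∷ Eq· (v 1) (v 0) ∷ T· (v 2) ∷ T· (v 2) ∷ []) (Rel· (v 4) (v 3) (v 2) (v 1) (v 0))
                     (c0 ρ X ∷ c1 ρ X ∷ str ρ X ∷ x ∷ y ∷ []) refl)
... | notT = ε

shE : ℕ → ℕ → Tm
shE n k = var (n + k)

shift-as-sub : ∀ n t → shift n t ≡ subst (shE n) t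
shift-as-sub n t = ren-as-sub (n +_) t

subE-sh : ∀ n ρ → subE (shE n) ρ ≈E sh n ρ
subE-sh n ρ k = cong3 (sym (shift-as-sub n (e0 ρ k))) (sym (shift-as-sub n (e1 ρ k))) (sym (shift-as-sub n (e2 ρ k)))

str-sh : ∀ n ρ t → shift n (str ρ t) ≡ str (sh n ρ) t
str-sh n ρ t = trans (shift-as-sub n (str ρ t)) (trans (str-tsub (shE n) ρ t) (str-cong (subE-sh n ρ) t))

R-sh : ∀ n ρ C x y → shift n (R ρ C x y) ≡ R (sh n ρ) C (shift n x) (shift n y)
R-sh n ρ C x y = trans (shift-as-sub n (R ρ C x y)) (trans (R-tsub (shE n) ρ C x y)
  (trans (R-cong (subE-sh n ρ) C _ _) (cong₂ (R (sh n ρ) C) (sym (shift-as-sub n x)) (sym (shift-as-sub n y)))))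

c0-sh : ∀ n ρ t → shift n (c0 ρ t) ≡ c0 (sh n ρ) t
c0-sh n ρ t = trans (shift-as-sub n (c0 ρ t)) (trans (c0-tsub (shE n) ρ t) (c0-cong (subE-sh n ρ) t))
c1-sh : ∀ n ρ t → shift n (c1 ρ t) ≡ c1 (sh n ρ) t
c1-sh n ρ t = trans (shift-as-sub n (c1 ρ t)) (trans (c1-tsub (shE n) ρ t) (c1-cong (subE-sh n ρ) t))

substEnv : (ℕ → Tm) → TmEnv → TmEnv
substEnv σ ρ k = c0 ρ (σ k) , c1 ρ (σ k) , str ρ (σ k)

c0-ssub : ∀ σ ρ t → c0 ρ (subst σ t) ≡ c0 (substEnv σ ρ) t
c0-ssub σ ρ t = subst-subst (e0 ρ) σ t
c1-ssub : ∀ σ ρ t → c1 ρ (subst σ t) ≡ c1 (substEnv σ ρ) t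
c1-ssub σ ρ t = subst-subst (e1 ρ) σ t

subS-sh : ∀ n σ ρ → substEnv σ (sh n ρ) ≈E sh n (substEnv σ ρ)
subS-sh n σ ρ k = cong3 (sym (c0-sh n ρ (σ k))) (sym (c1-sh n ρ (σ k))) (sym (str-sh n ρ (σ k)))

subS-cons : ∀ x σ ρ → substEnv (extS σ) (cons3 x (sh 3 ρ)) ≈E cons3 x (sh 3 (substEnv σ ρ))
subS-cons x σ ρ zero = refl
subS-cons x σ ρ (suc k) = cong3
  (trans (c0-sren (cons3 x (sh 3 ρ)) suc (σ k)) (sym (c0-sh 3 ρ (σ k))))
  (trans (c1-sren (cons3 x (sh 3 ρ)) suc (σ k)) (sym (c1-sh 3 ρ (σ k))))
  (trans (str-sren (cons3 x (sh 3 ρ)) suc (σ k)) (sym (str-sh 3 ρ (σ k))))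

mutual
  str-subst : ∀ σ ρ t → Conv≈ (str ρ (subst σ t)) (str (substEnv σ ρ) t)
  str-subst σ ρ (var k) = ε
  str-subst σ ρ ⋆ = ε
  str-subst σ ρ (Pi A B) =
    cLam (≡⇒Conv (c0-ssub σ ρ (Pi A B))) (cLam (≡⇒Conv (cong (shift 1) (c1-ssub σ ρ (Pi A B))))
    (cPi (≡⇒Conv (cong (shift 2) (c0-ssub σ ρ A))) (cPi (≡⇒Conv (cong (shift 3) (c1-ssub σ ρ A)))
    (cPi (R-subst σ (sh 4 ρ) A (v 1) (v 0) ∙ ≡⇒Conv (R-cong (subS-sh 4 σ ρ) A (v 1) (v 0)))
      (R-subst (extS σ) (ext3 (sh 2 ρ)) B (app (v 4) (v 2)) (app (v 3) (v 1))
       ∙ ≡⇒Conv (R-cong (λ k → trans (subS-cons (v 2 , v 1 , v 0) σ (sh 2 ρ) k)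
                         (cons3-cong (v 2 , v 1 , v 0) (sh-cong 3 (subS-sh 2 σ ρ)) k)) B _ _))))))
  str-subst σ ρ (Sg A B) =
    cLam (≡⇒Conv (c0-ssub σ ρ (Sg A B))) (cLam (≡⇒Conv (cong (shift 1) (c1-ssub σ ρ (Sg A B))))
    (cSg (R-subst σ (sh 2 ρ) A (fst (v 1)) (fst (v 0)) ∙ ≡⇒Conv (R-cong (subS-sh 2 σ ρ) A _ _))
      (R-subst (extS σ) (cons3 (fst (v 2) , fst (v 1) , v 0) (sh 3 ρ)) B (snd (v 2)) (snd (v 1))
       ∙ ≡⇒Conv (R-cong (subS-cons (fst (v 2) , fst (v 1) , v 0) σ ρ) B _ _))))
  str-subst σ ρ (lam A b) =
    cLam (≡⇒Conv (c0-ssub σ ρ A)) (cLam (≡⇒Conv (cong (shift 1) (c1-ssub σ ρ A)))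
    (cLam (R-subst σ (sh 2 ρ) A (v 1) (v 0) ∙ ≡⇒Conv (R-cong (subS-sh 2 σ ρ) A _ _))
      (str-subst (extS σ) (ext3 ρ) b ∙ ≡⇒Conv (str-cong (subS-cons (v 2 , v 1 , v 0) σ ρ) b))))
  str-subst σ ρ (app f a) = str-app ρ (subst σ f) (subst σ a)
    ∙ cApp (cApp (cApp (str-subst σ ρ f) (≡⇒Conv (c0-ssub σ ρ a))) (≡⇒Conv (c1-ssub σ ρ a))) (str-subst σ ρ a)
    ∙ ⁻ (str-app (substEnv σ ρ) f a)
  str-subst σ ρ (pair a b) = cPair (str-subst σ ρ a) (str-subst σ ρ b)
  str-subst σ ρ (fst p) = cFst (str-subst σ ρ p)
  str-subst σ ρ (snd p) = cSnd (str-subst σ ρ p)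
  str-subst σ ρ (con c) = ε

  R-subst : ∀ σ ρ C x y → Conv≈ (R ρ (subst σ C) x y) (R (substEnv σ ρ) C x y)
  R-subst σ ρ C x y = R-unfold ρ (subst σ C) x y ∙ cApp (cApp (str-subst σ ρ C) ε) ε ∙ ⁻ (R-unfold (substEnv σ ρ) C x y)

Rel-cong≈ : ∀ {X X' Y Y' e e' x x' y y'} → Conv≈ X X' → Conv≈ Y Y' → Conv≈ e e' → Conv≈ x x' → Conv≈ y y' →
  Conv≈ (Rel· X Y e x y) (Rel· X' Y' e' x' y')
Rel-cong≈ pX pY pe px py = cApp (cApp (cApp (cApp (cApp ε pX) pY) pe) px) py

ss : Tm → Tm
ss t = shift 1 (shift 1 t)

ss≡ : ∀ t → ss t ≡ shift 2 t
ss≡ t = shift-shift 1 1 t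

β-env : ∀ ρ (a0 a1 as : Tm) → subE (consAll (a0 ∷ a1 ∷ as ∷ []) var) (ext3 ρ) ≈E cons3 (a0 , a1 , as) ρ
β-env ρ a0 a1 as zero = refl
β-env ρ a0 a1 as (suc k) = cong3 (e (e0 ρ k)) (e (e1 ρ k)) (e (e2 ρ k))
  where
  e : ∀ t → subst (consAll (a0 ∷ a1 ∷ as ∷ []) var) (shift 3 t) ≡ t
  e t = trans (subst-rename _ (3 +_) t) (trans (subst-cong (λ _ → refl) t) (subst-id t))

c0-step : ∀ ρ {t u} → Step λ*U t u → Conv≈ (c0 ρ t) (c0 ρ u)
c0-step ρ r = Step⇒Conv (Step-emb (Step-subst (e0 ρ) r))
c1-step : ∀ ρ {t u} → Step λ*U t u → Conv≈ (c1 ρ t) (c1 ρ u)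
c1-step ρ r = Step⇒Conv (Step-emb (Step-subst (e1 ρ) r))
shift-conv : ∀ n {t u} → Conv≈ t u → Conv≈ (shift n t) (shift n u)
shift-conv n = Conv-rename (n +_)

mutual
  str-step : ∀ ρ {t u} → Step λ*U t u → Conv≈ (str ρ t) (str ρ u)
  -- β: the three abstractions of a translated λ are β-reduced against
  -- a₀, a₁, a*, which is source substitution of a.
  str-step ρ (here (β {A = A} {b = b} {a = a})) =
    str-app ρ (lam A b) a
    ∙ β-apps≈ (c0 ρ A ∷ shift 1 (c1 ρ A) ∷ R (sh 2 ρ) A (v 1) (v 0) ∷ []) (str (ext3 ρ) b) (c0 ρ a ∷ c1 ρ a ∷ str ρ a ∷ []) refl
    ∙ ≡⇒Conv (trans (str-tsub _ (ext3 ρ) b) (str-cong (β-env ρ (c0 ρ a) (c1 ρ a) (str ρ a)) b))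
    ∙ ≡⇒Conv (str-cong (λ { zero → refl ; (suc k) → refl }) b)
    ∙ ⁻ (str-subst (single a) ρ b)
  str-step ρ (here π₁β) = Contr⇒Conv π₁β
  str-step ρ (here π₂β) = Contr⇒Conv π₂β
  -- The T rules: T* X x y is Rel X₀ X₁ X* x y, which the Rel rules unfold
  -- along the rules for T.
  str-step ρ (here T-⋆̂) =
    β-apps≈ (U· ∷ U· ∷ Eq· (v 1) (v 0) ∷ []) (lams (T· (v 2) ∷ T· (v 2) ∷ []) (Rel· (v 4) (v 3) (v 2) (v 1) (v 0)))
      (⋆̂· ∷ ⋆̂· ∷ con crefl ∷ []) refl
    ∙ cLam (Contr⇒Conv T-⋆̂) (cLam (Contr⇒Conv T-⋆̂) (Contr⇒Conv Rel-refl))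
  str-step ρ (here (T-Pî {A = A} {B = B})) =
    β-apps≈ (U· ∷ U· ∷ Eq· (v 1) (v 0) ∷ []) (lams (T· (v 2) ∷ T· (v 2) ∷ []) (Rel· (v 4) (v 3) (v 2) (v 1) (v 0)))
      (c0 ρ (Pî· A B) ∷ c1 ρ (Pî· A B) ∷ str ρ (Pî· A B) ∷ []) refl
    ∙ cLam ε (cLam ε (Contr⇒Conv Rel-Pî*))
    ∙ cLam (Contr⇒Conv T-Pî ∙ ≡⇒Conv (cong (λ z → Pi (T· A₀) (T· (app z (v 0)))) (sym (extS-shift (e0 ρ) B))))
      (cLam (Contr⇒Conv T-Pî ∙ ≡⇒Conv (cong (λ z → Pi (T· (shift 1 A₁)) (T· (app z (v 0)))) c1B-shift))
      (cPi (≡⇒Conv (cong T· (ss≡ A₀)))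
      (cPi (≡⇒Conv (cong T· (trans (cong (shift 1) (ss≡ A₁)) (shift-shift 1 2 A₁))))
      (cPi (Rel-cong≈ (≡⇒Conv (trans (cong (shift 2) (ss≡ A₀)) (trans (shift-shift 2 2 A₀) (c0-sh 4 ρ A))))
                 (≡⇒Conv (trans (cong (shift 2) (ss≡ A₁)) (trans (shift-shift 2 2 A₁) (c1-sh 4 ρ A))))
                 (≡⇒Conv (trans (cong (shift 2) (ss≡ As)) (trans (shift-shift 2 2 As) (str-sh 4 ρ A)))) ε ε)
           (Rel-cong≈ (cApp (≡⇒Conv B₀-shift) ε) (cApp (≡⇒Conv B₁-shift) ε)
                 (cApp (cApp (cApp (≡⇒Conv B*-shift) ε) ε) ε ∙ ⁻ (str-app ρ⁺ (shift 1 B) (v 0))) ε ε)))))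
    where
    A₀ = c0 ρ A
    A₁ = c1 ρ A
    As = str ρ A
    ρ⁺ = ext3 (sh 2 ρ)
    c1B-shift : shift 1 (shift 1 (c1 ρ B)) ≡ rename (extR suc) (subst (extS (e1 ρ)) (shift 1 B))
    c1B-shift = sym (trans (cong (rename (extR suc)) (extS-shift (e1 ρ) B))
           (trans (rename-rename (extR suc) suc (c1 ρ B)) (sym (rename-rename suc suc (c1 ρ B)))))
    B₀-shift : shift 3 (ss (c0 ρ B)) ≡ c0 ρ⁺ (shift 1 B)
    B₀-shift = trans (cong (shift 3) (trans (ss≡ _) (c0-sh 2 ρ B))) (trans (c0-sh 3 (sh 2 ρ) B) (sym (c0-sren ρ⁺ suc B)))
    B₁-shift : shift 3 (ss (c1 ρ B)) ≡ c1 ρ⁺ (shift 1 B)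
    B₁-shift = trans (cong (shift 3) (trans (ss≡ _) (c1-sh 2 ρ B))) (trans (c1-sh 3 (sh 2 ρ) B) (sym (c1-sren ρ⁺ suc B)))
    B*-shift : shift 3 (ss (str ρ B)) ≡ str ρ⁺ (shift 1 B)
    B*-shift = trans (cong (shift 3) (trans (ss≡ _) (str-sh 2 ρ B))) (trans (str-sh 3 (sh 2 ρ) B) (sym (str-sren ρ⁺ suc B)))
  str-step ρ (here (T-Sĝ {A = A} {B = B})) =
    β-apps≈ (U· ∷ U· ∷ Eq· (v 1) (v 0) ∷ []) (lams (T· (v 2) ∷ T· (v 2) ∷ []) (Rel· (v 4) (v 3) (v 2) (v 1) (v 0)))
      (c0 ρ (Sĝ· A B) ∷ c1 ρ (Sĝ· A B) ∷ str ρ (Sĝ· A B) ∷ []) refl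
    ∙ cLam ε (cLam ε (Contr⇒Conv Rel-Sĝ*))
    ∙ cLam (Contr⇒Conv T-Sĝ ∙ ≡⇒Conv (cong (λ z → Sg (T· A₀) (T· (app z (v 0)))) (sym (extS-shift (e0 ρ) B))))
      (cLam (Contr⇒Conv T-Sĝ ∙ ≡⇒Conv (cong (λ z → Sg (T· (shift 1 A₁)) (T· (app z (v 0)))) c1B-shift))
      (cSg (Rel-cong≈ (≡⇒Conv (trans (ss≡ A₀) (c0-sh 2 ρ A))) (≡⇒Conv (trans (ss≡ A₁) (c1-sh 2 ρ A)))
                 (≡⇒Conv (trans (ss≡ As) (str-sh 2 ρ A))) ε ε)
           (Rel-cong≈ (cApp (≡⇒Conv B₀-shift) ε) (cApp (≡⇒Conv B₁-shift) ε)
                 (cApp (cApp (cApp (≡⇒Conv B*-shift) ε) ε) ε ∙ ⁻ (str-app ρ⁺ (shift 1 B) (v 0))) ε ε)))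
    where
    A₀ = c0 ρ A
    A₁ = c1 ρ A
    As = str ρ A
    ρ⁺ = cons3 (fst (v 2) , fst (v 1) , v 0) (sh 3 ρ)
    c1B-shift : shift 1 (shift 1 (c1 ρ B)) ≡ rename (extR suc) (subst (extS (e1 ρ)) (shift 1 B))
    c1B-shift = sym (trans (cong (rename (extR suc)) (extS-shift (e1 ρ) B))
           (trans (rename-rename (extR suc) suc (c1 ρ B)) (sym (rename-rename suc suc (c1 ρ B)))))
    B₀-shift : shift 1 (ss (c0 ρ B)) ≡ c0 ρ⁺ (shift 1 B)
    B₀-shift = trans (cong (shift 1) (ss≡ _)) (trans (shift-shift 1 2 _) (trans (c0-sh 3 ρ B) (sym (c0-sren ρ⁺ suc B))))
    B₁-shift : shift 1 (ss (c1 ρ B)) ≡ c1 ρ⁺ (shift 1 B)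
    B₁-shift = trans (cong (shift 1) (ss≡ _)) (trans (shift-shift 1 2 _) (trans (c1-sh 3 ρ B) (sym (c1-sren ρ⁺ suc B))))
    B*-shift : shift 1 (ss (str ρ B)) ≡ str ρ⁺ (shift 1 B)
    B*-shift = trans (cong (shift 1) (ss≡ _)) (trans (shift-shift 1 2 _) (trans (str-sh 3 ρ B) (sym (str-sren ρ⁺ suc B))))
  str-step ρ (Pi₁ {B = B} r) = cLam (c0-step ρ (Pi₁ {B = B} r)) (cLam (shift-conv 1 (c1-step ρ (Pi₁ {B = B} r)))
    (cPi (shift-conv 2 (c0-step ρ r)) (cPi (shift-conv 3 (c1-step ρ r)) (cPi (R-step (sh 4 ρ) (v 1) (v 0) r) ε))))
  str-step ρ (Pi₂ {A = A} r) = cLam (c0-step ρ (Pi₂ {A = A} r)) (cLam (shift-conv 1 (c1-step ρ (Pi₂ {A = A} r)))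
    (cPi ε (cPi ε (cPi ε (R-step (ext3 (sh 2 ρ)) (app (v 4) (v 2)) (app (v 3) (v 1)) r)))))
  str-step ρ (Sg₁ {B = B} r) = cLam (c0-step ρ (Sg₁ {B = B} r)) (cLam (shift-conv 1 (c1-step ρ (Sg₁ {B = B} r)))
    (cSg (R-step (sh 2 ρ) (fst (v 1)) (fst (v 0)) r) ε))
  str-step ρ (Sg₂ {A = A} r) = cLam (c0-step ρ (Sg₂ {A = A} r)) (cLam (shift-conv 1 (c1-step ρ (Sg₂ {A = A} r)))
    (cSg ε (R-step (cons3 (fst (v 2) , fst (v 1) , v 0) (sh 3 ρ)) (snd (v 2)) (snd (v 1)) r)))
  str-step ρ (lam₁ r) = cLam (c0-step ρ r) (cLam (shift-conv 1 (c1-step ρ r)) (cLam (R-step (sh 2 ρ) (v 1) (v 0) r) ε))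
  str-step ρ (lam₂ r) = cLam ε (cLam ε (cLam ε (str-step (ext3 ρ) r)))
  str-step ρ (app₁ {f} {f'} {a} r) = str-app ρ f a ∙ cApp (cApp (cApp (str-step ρ r) ε) ε) ε ∙ ⁻ (str-app ρ f' a)
  str-step ρ (app₂ {f} {a} {a'} r) = str-app ρ f a ∙ cApp (cApp (cApp ε (c0-step ρ r)) (c1-step ρ r)) (str-step ρ r) ∙ ⁻ (str-app ρ f a')
  str-step ρ (pair₁ r) = cPair (str-step ρ r) ε
  str-step ρ (pair₂ r) = cPair ε (str-step ρ r)
  str-step ρ (fst₁ r) = cFst (str-step ρ r)
  str-step ρ (snd₁ r) = cSnd (str-step ρ r)

  R-step : ∀ ρ {t u} x y → Step λ*U t u → Conv≈ (R ρ t x y) (R ρ u x y)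
  R-step ρ {t} {u} x y r = R-unfold ρ t x y ∙ cApp (cApp (str-step ρ r) ε) ε ∙ ⁻ (R-unfold ρ u x y)

str-conv : ∀ ρ {t u} → Conv λ*U t u → Conv≈ (str ρ t) (str ρ u)
str-conv ρ ε = ε
str-conv ρ (fwd r ◅ rs) = str-step ρ r ∙ str-conv ρ rs
str-conv ρ (bwd r ◅ rs) = ⁻ (str-step ρ r) ∙ str-conv ρ rs

R-conv : ∀ ρ {t u} x y → Conv λ*U t u → Conv≈ (R ρ t x y) (R ρ u x y)
R-conv ρ {t} {u} x y c = R-unfold ρ t x y ∙ cApp (cApp (str-conv ρ c) ε) ε ∙ ⁻ (R-unfold ρ u x y)

R-xy : ∀ ρ C {x x' y y'} → Conv≈ x x' → Conv≈ y y' → Conv≈ (R ρ C x y) (R ρ C x' y')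
R-xy ρ C px py with elView C
... | isT = cApp (cApp ε px) py
... | notT = cApp (cApp ε px) py

pis : List Tm → Tm → Tm
pis [] B = B
pis (A ∷ As) B = Pi A (pis As B)

data Args (s : Sys) (Δ : Ctx) : (ℕ → Tm) → List Tm → List Tm → Set where
  [] : ∀ {σ} → Args s Δ σ [] []
  _∷_ : ∀ {σ A As a as} → Δ ⊢[ s ] a ∶ subst σ A → Args s Δ (consS a σ) As as → Args s Δ σ (A ∷ As) (a ∷ as)

apps-typed : ∀ {s Δ F σ As B as} → Δ ⊢[ s ] F ∶ subst σ (pis As B) → Args s Δ σ As as →
  Δ ⊢[ s ] apps F as ∶ subst (consAll as σ) B
apps-typed D [] = D
apps-typed {σ = σ} {A ∷ As} {B} D (_∷_ {a = a} E args) =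
  apps-typed (retype (sub-ext-single σ (pis As B) a) (appl D E)) args

const≈ : ∀ {Δ} c → WF λ*U≈ Δ → Δ ⊢[ λ*U≈ ] con c ∶ ctype c
const≈ c w = closed-typed (λ _ → refl) (ctype-closed c) (const c (E-all c)) w

WF≈ : Ctx → Set
WF≈ = WF λ*U≈

_⊢_∶_ : Ctx → Tm → Tm → Set
Δ ⊢ t ∶ C = Δ ⊢[ λ*U≈ ] t ∶ C
infix 3 _⊢_∶_

Eq-typed : ∀ {Δ X Y} → WF≈ Δ → Δ ⊢ X ∶ U· → Δ ⊢ Y ∶ U· → Δ ⊢ Eq· X Y ∶ ⋆
Eq-typed w DX DY = apps-typed {σ = var} {As = U· ∷ U· ∷ []} {B = ⋆} (const≈ cEq w) (DX ∷ (DY ∷ []))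

T-typed : ∀ {Δ X} → WF≈ Δ → Δ ⊢ X ∶ U· → Δ ⊢ T· X ∶ ⋆
T-typed w DX = apps-typed {σ = var} {As = U· ∷ []} {B = ⋆} (const≈ cT w) (DX ∷ [])

Rel-typed : ∀ {Δ X Y e x y} → WF≈ Δ → Δ ⊢ X ∶ U· → Δ ⊢ Y ∶ U· → Δ ⊢ e ∶ Eq· X Y → Δ ⊢ x ∶ T· X → Δ ⊢ y ∶ T· Y →
  Δ ⊢ Rel· X Y e x y ∶ ⋆
Rel-typed w DX DY De Dx Dy = apps-typed {σ = var} {As = U· ∷ U· ∷ Eq· (v 1) (v 0) ∷ T· (v 2) ∷ T· (v 2) ∷ []} {B = ⋆} (const≈ cRel w) (DX ∷ (DY ∷ (De ∷ (Dx ∷ (Dy ∷ [])))))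

fam-typed : ∀ {Δ X} → WF≈ Δ → Δ ⊢ X ∶ U· → Δ ⊢ Pi (T· X) U· ∶ ⋆
fam-typed w DX = piF (T-typed w DX) (const≈ cU (T-typed w DX ∷ w))

EnvTyped : Ctx → TmEnv → Ctx → Set
EnvTyped Δ ρ Γ = WF≈ Δ × (∀ {k B} → Γ ∋ k ∶ B →
  (Δ ⊢ e0 ρ k ∶ c0 ρ B) × (Δ ⊢ e1 ρ k ∶ c1 ρ B) × (Δ ⊢ e2 ρ k ∶ R ρ B (e0 ρ k) (e1 ρ k)))

EnvTyped₀ : ∀ {Δ ρ Γ} → EnvTyped Δ ρ Γ → TypedSubst Δ (e0 ρ) Γ
EnvTyped₀ (w , h) = w , λ x → proj₁ (h x)
EnvTyped₁ : ∀ {Δ ρ Γ} → EnvTyped Δ ρ Γ → TypedSubst Δ (e1 ρ) Γ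
EnvTyped₁ (w , h) = w , λ x → proj₁ (proj₂ (h x))

EnvTyped-down : ∀ {Δ ρ Γ A} → EnvTyped Δ ρ (A ∷ Γ) → EnvTyped Δ (ρ ∘ suc) Γ
EnvTyped-down {ρ = ρ} (w , h) = w , λ { {k} {B} x →
  let (a , b , c) = h (there x) in
  retype (c0-sren ρ suc B) a , retype (c1-sren ρ suc B) b , retype (R-sren ρ suc B _ _) c }

EnvTyped-weak : ∀ {Δ ρ Γ X} → EnvTyped Δ ρ Γ → Δ ⊢ X ∶ ⋆ → EnvTyped (X ∷ Δ) (sh 1 ρ) Γ
EnvTyped-weak {ρ = ρ} (w , h) E = (E ∷ w) , λ { {k} {B} x →
  let (a , b , c) = h x in
  retype (c0-sh 1 ρ B) (weak a E) , retype (c1-sh 1 ρ B) (weak b E) , retype (R-sh 1 ρ B _ _) (weak c E) }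

EnvTyped-cong : ∀ {Δ ρ ρ' Γ} → ρ ≈E ρ' → EnvTyped Δ ρ Γ → EnvTyped Δ ρ' Γ
EnvTyped-cong {ρ = ρ} {ρ'} e (w , h) = w , λ { {k} {B} x →
  let (a , b , c) = h x in
  reterm (cong proj₁ (e k)) (retype (c0-cong e B) a) ,
  reterm (cong (proj₁ ∘ proj₂) (e k)) (retype (c1-cong e B) b) ,
  reterm (cong (proj₂ ∘ proj₂) (e k)) (retype (trans (R-cong e B _ _) (cong₂ (R ρ' B) (cong proj₁ (e k)) (cong (proj₁ ∘ proj₂) (e k)))) c) }

EnvTyped-weak₂ : ∀ {Δ ρ Γ X Y} → EnvTyped Δ ρ Γ → Δ ⊢ X ∶ ⋆ → (X ∷ Δ) ⊢ Y ∶ ⋆ → EnvTyped (Y ∷ X ∷ Δ) (sh 2 ρ) Γ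
EnvTyped-weak₂ {ρ = ρ} ok DX DY = EnvTyped-cong (sh-sh 1 1 ρ) (EnvTyped-weak (EnvTyped-weak ok DX) DY)

EnvTyped-ext : ∀ {Δ ρ Γ A} → EnvTyped Δ ρ Γ →
  Δ ⊢ c0 ρ A ∶ ⋆ → (c0 ρ A ∷ Δ) ⊢ shift 1 (c1 ρ A) ∶ ⋆ →
  (shift 1 (c1 ρ A) ∷ c0 ρ A ∷ Δ) ⊢ R (sh 2 ρ) A (v 1) (v 0) ∶ ⋆ →
  EnvTyped (R (sh 2 ρ) A (v 1) (v 0) ∷ shift 1 (c1 ρ A) ∷ c0 ρ A ∷ Δ) (ext3 ρ) (A ∷ Γ)
EnvTyped-ext {Δ} {ρ} {Γ} {A} ok D0 D1 D2 = w3 , λ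
  { (here) → retype (e0A) (weak (weak (var0 D0) D1) D2) ,
             retype e1A (weak (var0 D1) D2) ,
             retype eRA (var0 D2)
  ; (there {B = B} x) → let (a , b , c) = proj₂ ok3 x in
      retype (sym (c0-sren (ext3 ρ) suc B)) a , retype (sym (c1-sren (ext3 ρ) suc B)) b , retype (sym (R-sren (ext3 ρ) suc B _ _)) c }
  where
  w3 = D2 ∷ (D1 ∷ (D0 ∷ proj₁ ok))
  ok3 : EnvTyped (R (sh 2 ρ) A (v 1) (v 0) ∷ shift 1 (c1 ρ A) ∷ c0 ρ A ∷ Δ) (sh 3 ρ) Γ
  ok3 = EnvTyped-cong (sh-sh 1 2 ρ) (EnvTyped-weak (EnvTyped-weak₂ ok D0 D1) D2)
  e0A : shift 1 (shift 1 (shift 1 (c0 ρ A))) ≡ c0 (ext3 ρ) (shift 1 A)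
  e0A = trans (trans (cong (shift 1) (shift-shift 1 1 _)) (shift-shift 1 2 _)) (trans (c0-sh 3 ρ A) (sym (c0-sren (ext3 ρ) suc A)))
  e1A : shift 1 (shift 1 (shift 1 (c1 ρ A))) ≡ c1 (ext3 ρ) (shift 1 A)
  e1A = trans (trans (cong (shift 1) (shift-shift 1 1 _)) (shift-shift 1 2 _)) (trans (c1-sh 3 ρ A) (sym (c1-sren (ext3 ρ) suc A)))
  eRA : shift 1 (R (sh 2 ρ) A (v 1) (v 0)) ≡ R (ext3 ρ) (shift 1 A) (v 2) (v 1)
  eRA = trans (R-sh 1 (sh 2 ρ) A (v 1) (v 0)) (trans (R-cong (sh-sh 1 2 ρ) A (v 2) (v 1)) (sym (R-sren (ext3 ρ) suc A (v 2) (v 1))))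

EnvTyped-cons : ∀ {Δ ρ Γ A a0 a1 as} → EnvTyped Δ ρ Γ → Δ ⊢ a0 ∶ c0 ρ A → Δ ⊢ a1 ∶ c1 ρ A → Δ ⊢ as ∶ R ρ A a0 a1 →
  EnvTyped Δ (cons3 (a0 , a1 , as) ρ) (A ∷ Γ)
EnvTyped-cons {Δ} {ρ} {Γ} {A} {a0} {a1} {as} (w , h) D0 D1 D2 = w , λ
  { here → retype (sym (c0-sren ρ' suc A)) D0 , retype (sym (c1-sren ρ' suc A)) D1 , retype (sym (R-sren ρ' suc A _ _)) D2
  ; (there {B = B} x) → let (a , b , c) = h x in
      retype (sym (c0-sren ρ' suc B)) a , retype (sym (c1-sren ρ' suc B)) b , retype (sym (R-sren ρ' suc B _ _)) c }
  where ρ' = cons3 (a0 , a1 , as) ρ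

RelΠ : TmEnv → Tm → Tm → Tm → Tm → Tm
RelΠ ρ A B x y = Pi (c0 ρ A) (Pi (shift 1 (c1 ρ A)) (Pi (R (sh 2 ρ) A (v 1) (v 0))
  (R (ext3 ρ) B (app (shift 3 x) (v 2)) (app (shift 3 y) (v 1)))))

RelΣ : TmEnv → Tm → Tm → Tm → Tm → Tm
RelΣ ρ A B x y = Sg (R ρ A (fst x) (fst y))
  (R (cons3 (fst (shift 1 x) , fst (shift 1 y) , v 0) (sh 1 ρ)) B (snd (shift 1 x)) (snd (shift 1 y)))

R-U : ∀ ρ x y → Conv≈ (R ρ U· x y) (Eq· x y)
R-U ρ x y = β-apps≈ (U· ∷ U· ∷ []) (Eq· (v 1) (v 0)) (x ∷ y ∷ []) refl

R-⋆ : ∀ ρ x y → Conv≈ (R ρ ⋆ x y) (Pi x (Pi (shift 1 y) ⋆))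
R-⋆ ρ x y = β-apps≈ (⋆ ∷ ⋆ ∷ []) (Pi (v 1) (Pi (v 1) ⋆)) (x ∷ y ∷ []) refl

sub-sh : ∀ {σ} m j t → (∀ k → σ (m + k) ≡ var (j + k)) → subst σ (shift m t) ≡ shift j t
sub-sh {σ} m j t h = trans (subst-rename σ (m +_) t) (trans (subst-cong h t) (sym (ren-as-sub (j +_) t)))

R-Pi : ∀ ρ A B x y → Conv≈ (R ρ (Pi A B) x y) (RelΠ ρ A B x y)
R-Pi ρ A B x y = β-apps≈ (c0 ρ (Pi A B) ∷ shift 1 (c1 ρ (Pi A B)) ∷ [])
    (Pi (shift 2 (c0 ρ A)) (Pi (shift 3 (c1 ρ A)) (Pi (R (sh 4 ρ) A (v 1) (v 0))
       (R (ext3 (sh 2 ρ)) B (app (v 4) (v 2)) (app (v 3) (v 1)))))) (x ∷ y ∷ []) refl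
  ∙ ≡⇒Conv (cong₂ Pi (trans (sub-sh 2 0 _ (λ k → refl)) (shift-zero _)) (cong₂ Pi (sub-sh 3 1 _ (λ k → refl))
      (cong₂ Pi (trans (R-tsub _ (sh 4 ρ) A (v 1) (v 0)) (R-cong (λ k → cong3 (sub-sh 4 2 _ (λ _ → refl)) (sub-sh 4 2 _ (λ _ → refl)) (sub-sh 4 2 _ (λ _ → refl))) A _ _))
        (trans (R-tsub _ (ext3 (sh 2 ρ)) B (app (v 4) (v 2)) (app (v 3) (v 1)))
          (trans (R-cong {ρ' = ext3 ρ} (λ { zero → refl ; (suc k) → cong3 (e3 _) (e3 _) (e3 _) }) B _ _)
            (cong₂ (λ p q → R (ext3 ρ) B (app p (v 2)) (app q (v 1))) (s3 x) (s3 y)))))))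
  where
  e3 : ∀ t → subst (extSn 3 (consAll (x ∷ y ∷ []) var)) (shift 3 (shift 2 t)) ≡ shift 3 t
  e3 t = trans (cong (subst _) (shift-shift 3 2 t)) (sub-sh 5 3 t (λ k → refl))
  s3 : ∀ t → shift 1 (shift 1 (shift 1 t)) ≡ shift 3 t
  s3 t = trans (cong (shift 1) (shift-shift 1 1 t)) (shift-shift 1 2 t)

R-Sg : ∀ ρ A B x y → Conv≈ (R ρ (Sg A B) x y) (RelΣ ρ A B x y)
R-Sg ρ A B x y = β-apps≈ (c0 ρ (Sg A B) ∷ shift 1 (c1 ρ (Sg A B)) ∷ [])
    (Sg (R (sh 2 ρ) A (fst (v 1)) (fst (v 0)))
        (R (cons3 (fst (v 2) , fst (v 1) , v 0) (sh 3 ρ)) B (snd (v 2)) (snd (v 1)))) (x ∷ y ∷ []) refl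
  ∙ ≡⇒Conv (cong₂ Sg
      (trans (R-tsub _ (sh 2 ρ) A (fst (v 1)) (fst (v 0))) (R-cong (λ k → cong3 (eq2 _) (eq2 _) (eq2 _)) A _ _))
      (trans (R-tsub _ (cons3 (fst (v 2) , fst (v 1) , v 0) (sh 3 ρ)) B (snd (v 2)) (snd (v 1)))
         (R-cong (λ { zero → refl ; (suc k) → cong3 (e31 _) (e31 _) (e31 _) }) B _ _)))
  where
  eq2 : ∀ t → subst (consAll (x ∷ y ∷ []) var) (shift 2 t) ≡ t
  eq2 t = trans (sub-sh 2 0 t (λ k → refl)) (trans (ren-as-sub (0 +_) t) (subst-id t))
  e31 : ∀ t → subst (extS (consAll (x ∷ y ∷ []) var)) (shift 3 t) ≡ shift 1 t
  e31 t = sub-sh 3 1 t (λ k → refl)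

R-single : ∀ ρ B w0 w1 z x y →
  (R (cons3 (shift 1 w0 , shift 1 w1 , v 0) (sh 1 ρ)) B (shift 1 x) (shift 1 y)) [ z ] ≡ R (cons3 (w0 , w1 , z) ρ) B x y
R-single ρ B w0 w1 z x y = trans (R-tsub (single z) _ B _ _)
  (trans (R-cong (λ { zero → cong3 (sub-single-shift z w0) (sub-single-shift z w1) refl
                    ; (suc k) → cong3 (sub-single-shift z _) (sub-single-shift z _) (sub-single-shift z _) }) B _ _)
         (cong₂ (R _ B) (sub-single-shift z x) (sub-single-shift z y)))

R-envconv : ∀ ρ B {x0 x0' x1 x1' xs} x y → Conv≈ x0 x0' → Conv≈ x1 x1' →
  Conv≈ (R (cons3 (x0 , x1 , xs) ρ) B x y) (R (cons3 (x0' , x1' , xs) ρ) B x y)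
R-envconv ρ B {x0} {x0'} {x1} {x1'} {xs} x y c0' c1' =
  ≡⇒Conv (sym (eq x0 x1)) ∙ subst-conv {σ = consAll (x0 ∷ x1 ∷ xs ∷ []) var} {σ' = consAll (x0' ∷ x1' ∷ xs ∷ []) var} (λ { zero → ε ; (suc zero) → c1' ; (suc (suc zero)) → c0' ; (suc (suc (suc k))) → ε }) (R (ext3 ρ) B (shift 3 x) (shift 3 y)) ∙ ≡⇒Conv (eq x0' x1')
  where
  eq : ∀ a b → subst (consAll (a ∷ b ∷ xs ∷ []) var) (R (ext3 ρ) B (shift 3 x) (shift 3 y)) ≡ R (cons3 (a , b , xs) ρ) B x y
  eq a b = trans (R-tsub _ (ext3 ρ) B _ _) (trans (R-cong (β-env ρ a b xs) B _ _)
    (cong₂ (R _ B) (trans (sub-sh 3 0 x (λ _ → refl)) (trans (ren-as-sub (0 +_) x) (subst-id x)))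
                   (trans (sub-sh 3 0 y (λ _ → refl)) (trans (ren-as-sub (0 +_) y) (subst-id y)))))

sss : Tm → Tm
sss t = shift 1 (shift 1 (shift 1 t))

sss≡ : ∀ t → sss t ≡ shift 3 t
sss≡ t = trans (cong (shift 1) (shift-shift 1 1 t)) (shift-shift 1 2 t)

app-shift3-typed : ∀ {Δ X Y Z x P Q z} → WF≈ (Z ∷ Y ∷ X ∷ Δ) → Δ ⊢ x ∶ Pi P Q → (Z ∷ Y ∷ X ∷ Δ) ⊢ z ∶ shift 3 P →
  (Z ∷ Y ∷ X ∷ Δ) ⊢ app (shift 3 x) z ∶ subst (consS z (shE 3)) Q
app-shift3-typed {x = x} {P} {Q} {z} w@(EZ ∷ (EY ∷ (EX ∷ _))) Dx Dz =
  retype eq (appl (reterm (sss≡ x) (retype (sss≡ (Pi P Q)) (weak (weak (weak Dx EX) EY) EZ))) Dz)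
  where
  eq : (rename (extR (3 +_)) Q) [ z ] ≡ subst (consS z (shE 3)) Q
  eq = trans (subst-rename (single z) (extR (3 +_)) Q) (subst-cong (λ { zero → refl ; (suc k) → refl }) Q)

c0ext : ∀ ρ B → subst (consS (v 2) (shE 3)) (subst (extS (e0 ρ)) B) ≡ c0 (ext3 ρ) B
c0ext ρ B = trans (subst-subst _ (extS (e0 ρ)) B) (subst-cong (λ { zero → refl ; (suc k) → trans (subst-rename _ suc (e0 ρ k))
  (trans (subst-cong (λ _ → refl) (e0 ρ k)) (sym (ren-as-sub (3 +_) (e0 ρ k)))) }) B)

c1ext : ∀ ρ B → subst (consS (v 1) (shE 3)) (subst (extS (e1 ρ)) B) ≡ c1 (ext3 ρ) B
c1ext ρ B = trans (subst-subst _ (extS (e1 ρ)) B) (subst-cong (λ { zero → refl ; (suc k) → trans (subst-rename _ suc (e1 ρ k))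
  (trans (subst-cong (λ _ → refl) (e1 ρ k)) (sym (ren-as-sub (3 +_) (e1 ρ k)))) }) B)

snd-eq : ∀ (σ : ℕ → Tm) B z → (rename (extR suc) (subst (extS σ) B)) [ z ] ≡ subst (consS z (shift 1 ∘ σ)) B
snd-eq σ B z = trans (subst-rename (single z) (extR suc) (subst (extS σ) B))
  (trans (subst-subst _ (extS σ) B) (subst-cong (λ { zero → refl ; (suc k) → trans (subst-rename _ suc (σ k))
     (trans (subst-cong (λ _ → refl) (σ k)) (sym (ren-as-sub suc (σ k)))) }) B))

⋆ʳ-typed : [] ⊢ ⋆ʳ ∶ Pi ⋆ (Pi ⋆ ⋆)
⋆ʳ-typed = abs (abs (piF Dv1 (piF Dv1' (⋆-typed (Dv1' ∷ (Dv1 ∷ w2))))) (piF (⋆-typed w1) (⋆-typed (⋆-typed w1 ∷ w1)))) (piF ax (piF (⋆-typed w1) (⋆-typed (⋆-typed w1 ∷ w1))))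
  where
  w1 : WF≈ (⋆ ∷ [])
  w1 = ax ∷ []
  w2 : WF≈ (⋆ ∷ ⋆ ∷ [])
  w2 = ⋆-typed w1 ∷ w1
  Dv1 : (⋆ ∷ ⋆ ∷ []) ⊢ v 1 ∶ ⋆
  Dv1 = weak (var0 ax) (⋆-typed w1)
  Dv1' : (v 1 ∷ ⋆ ∷ ⋆ ∷ []) ⊢ v 1 ∶ ⋆
  Dv1' = weak (var0 (⋆-typed w1)) Dv1

⋆ʳ-app-typed : ∀ {Δ x y} → WF≈ Δ → Δ ⊢ x ∶ ⋆ → Δ ⊢ y ∶ ⋆ → Δ ⊢ app (app ⋆ʳ x) y ∶ ⋆
⋆ʳ-app-typed w Dx Dy = appl (appl (closed-typed (λ _ → refl) (λ _ → refl) ⋆ʳ-typed w) Dx) Dy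

HatStarFamTy : Tm → Tm → Tm → Tm → Tm → Tm
HatStarFamTy X₀ X₁ Y₀ Y₁ Xs = Pi (T· X₀) (Pi (T· (shift 1 X₁)) (Pi (Rel· (shift 1 (shift 1 X₀)) (shift 1 (shift 1 X₁)) (shift 1 (shift 1 Xs)) (v 1) (v 0))
  (Eq· (app (sss Y₀) (v 2)) (app (sss Y₁) (v 1)))))

HatStarFamTy-typed : ∀ {Δ X₀ X₁ Y₀ Y₁ Xs} → WF≈ Δ → Δ ⊢ X₀ ∶ U· → Δ ⊢ X₁ ∶ U· → Δ ⊢ Xs ∶ Eq· X₀ X₁ →
  Δ ⊢ Y₀ ∶ Pi (T· X₀) U· → Δ ⊢ Y₁ ∶ Pi (T· X₁) U· → Δ ⊢ HatStarFamTy X₀ X₁ Y₀ Y₁ Xs ∶ ⋆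
HatStarFamTy-typed w DX0 DX1 DXs DY0 DY1 = piF D0 (piF D1 (piF D2 D3))
  where
  D0 = T-typed w DX0
  w1 = D0 ∷ w
  D1 = T-typed w1 (weak DX1 D0)
  w2 = D1 ∷ w1
  D2 = Rel-typed w2 (weak (weak DX0 D0) D1) (weak (weak DX1 D0) D1) (weak (weak DXs D0) D1) (weak (var0 D0) D1) (var0 D1)
  w3 = D2 ∷ w2
  D3 = Eq-typed w3 (appl (weak (weak (weak DY0 D0) D1) D2) (weak (weak (var0 D0) D1) D2))
                (appl (weak (weak (weak DY1 D0) D1) D2) (weak (var0 D1) D2))

hatStarArgs : List Tm
hatStarArgs = U· ∷ U· ∷ Pi (T· (v 1)) U· ∷ Pi (T· (v 1)) U· ∷ Eq· (v 3) (v 2) ∷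
  Pi (T· (v 4)) (Pi (T· (v 4)) (Pi (Rel· (v 6) (v 5) (v 2) (v 1) (v 0)) (Eq· (app (v 5) (v 2)) (app (v 4) (v 1))))) ∷ []

Pî*-typed : ∀ {Δ X₀ X₁ Y₀ Y₁ Xs Ys} →
  WF≈ Δ → Δ ⊢ X₀ ∶ U· → Δ ⊢ X₁ ∶ U· → Δ ⊢ Y₀ ∶ Pi (T· X₀) U· → Δ ⊢ Y₁ ∶ Pi (T· X₁) U· →
  Δ ⊢ Xs ∶ Eq· X₀ X₁ → Δ ⊢ Ys ∶ HatStarFamTy X₀ X₁ Y₀ Y₁ Xs →
  Δ ⊢ Pî*· X₀ X₁ Y₀ Y₁ Xs Ys ∶ Eq· (Pî· X₀ Y₀) (Pî· X₁ Y₁)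
Pî*-typed w DX0 DX1 DY0 DY1 DXs DYs =
   apps-typed {σ = var} {As = hatStarArgs} {B = Eq· (Pî· (v 5) (v 3)) (Pî· (v 4) (v 2))} (const≈ cPî* w) (DX0 ∷ (DX1 ∷ (DY0 ∷ (DY1 ∷ (DXs ∷ (DYs ∷ []))))))

Sĝ*-typed : ∀ {Δ X₀ X₁ Y₀ Y₁ Xs Ys} →
  WF≈ Δ → Δ ⊢ X₀ ∶ U· → Δ ⊢ X₁ ∶ U· → Δ ⊢ Y₀ ∶ Pi (T· X₀) U· → Δ ⊢ Y₁ ∶ Pi (T· X₁) U· →
  Δ ⊢ Xs ∶ Eq· X₀ X₁ → Δ ⊢ Ys ∶ HatStarFamTy X₀ X₁ Y₀ Y₁ Xs →
  Δ ⊢ Sĝ*· X₀ X₁ Y₀ Y₁ Xs Ys ∶ Eq· (Sĝ· X₀ Y₀) (Sĝ· X₁ Y₁)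
Sĝ*-typed w DX0 DX1 DY0 DY1 DXs DYs =
   apps-typed {σ = var} {As = hatStarArgs} {B = Eq· (Sĝ· (v 5) (v 3)) (Sĝ· (v 4) (v 2))} (const≈ cSĝ* w) (DX0 ∷ (DX1 ∷ (DY0 ∷ (DY1 ∷ (DXs ∷ (DYs ∷ []))))))

inv-con : ∀ {c} t → rename suc t ≡ con c → t ≡ con c
inv-con (var x) ()
inv-con ⋆ ()
inv-con (Pi t t₁) ()
inv-con (Sg t t₁) ()
inv-con (lam t t₁) ()
inv-con (app t t₁) ()
inv-con (pair t t₁) ()
inv-con (fst t) ()
inv-con (snd t) ()
inv-con (con x) refl = refl

inv-app : ∀ {c X} t → rename suc t ≡ app (con c) X → Σ Tm (λ X' → t ≡ app (con c) X' × X ≡ rename suc X')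
inv-app (var x) ()
inv-app ⋆ ()
inv-app (Pi t t₁) ()
inv-app (Sg t t₁) ()
inv-app (lam t t₁) ()
inv-app (app f a) e with inv-con f (cong hd e) | cong ar e
  where
  hd : Tm → Tm
  hd (app f _) = f
  hd t = t
  ar : Tm → Tm
  ar (app _ a) = a
  ar t = t
... | refl | refl = a , refl , refl
inv-app (pair t t₁) ()
inv-app (fst t) ()
inv-app (snd t) ()
inv-app (con x) ()

cong-Rel : ∀ {X X' Y Y' e e' x x' y y'} → X ≡ X' → Y ≡ Y' → e ≡ e' → x ≡ x' → y ≡ y' →
  Rel· X Y e x y ≡ Rel· X' Y' e' x' y'
cong-Rel refl refl refl refl refl = refl

closedB : ∀ {c Bc} → ctype c ≡ Pi U· Bc → ∀ f → rename (extR f) Bc ≡ Bc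
closedB {c} hc f = cong bodyOf (trans (sym (cong (rename f) hc)) (trans (ctype-closed c f) hc))
  where
  bodyOf : Tm → Tm
  bodyOf (Pi _ b) = b
  bodyOf t = t

sub-drop : ∀ {σ} n t → (∀ k → σ (n + k) ≡ var k) → subst σ (shift n t) ≡ t
sub-drop {σ} n t h = trans (subst-rename σ (n +_) t) (trans (subst-cong h t) (subst-id t))

-- The relational
-- validity lemma R-typed (the relation of a type is a type) is proved
-- simultaneously, as are the typings of the relations of Π and Σ.

Related : Const → Set
Related c = ∀ {Δ} ρ → WF≈ Δ → Δ ⊢ str ρ (con c) ∶ R ρ (ctype c) (con c) (con c)

record HatArgsTyped (Δ : Ctx) (ρ : TmEnv) (X a : Tm) : Set where
  field
    X₀-typed : Δ ⊢ c0 ρ X ∶ U·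
    X₁-typed : Δ ⊢ c1 ρ X ∶ U·
    a₀-typed : Δ ⊢ c0 ρ a ∶ Pi (T· (c0 ρ X)) U·
    a₁-typed : Δ ⊢ c1 ρ a ∶ Pi (T· (c1 ρ X)) U·
    X*-typed : Δ ⊢ str ρ X ∶ Eq· (c0 ρ X) (c1 ρ X)
    a*-typed : Δ ⊢ str ρ a ∶ HatStarFamTy (c0 ρ X) (c1 ρ X) (c0 ρ a) (c1 ρ a) (str ρ X)

module Fundamental (Al : Const → Set) (consts-ok : ∀ c → Al c → Related c) where
  open Annotated Al

  c0-typed : ∀ {Γ t C Δ ρ} → Γ ⊢v t ∶ C → EnvTyped Δ ρ Γ → Δ ⊢ c0 ρ t ∶ c0 ρ C
  c0-typed D ok = subst-typed≈ D (EnvTyped₀ ok)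
  c1-typed : ∀ {Γ t C Δ ρ} → Γ ⊢v t ∶ C → EnvTyped Δ ρ Γ → Δ ⊢ c1 ρ t ∶ c1 ρ C
  c1-typed D ok = subst-typed≈ D (EnvTyped₁ ok)

  const-generation : ∀ {Γ t S c} → Γ ⊢v t ∶ S → t ≡ con c → Conv λ*U S (ctype c)
  const-generation (const c a) refl = ε
  const-generation {c = c} (weak {t = t'} D E) eq with inv-con t' eq
  ... | refl = ≡subst (Conv λ*U _) (ctype-closed c suc) (Conv-rename suc (const-generation D refl))
  const-generation (conv D c E) eq = ⁻ c ∙ const-generation D eq
  const-generation ax ()
  const-generation (var0 D) ()
  const-generation (piF D E) ()
  const-generation (sgF D E) ()
  const-generation (abs D E F) ()
  const-generation (appl D E F G H) ()
  const-generation (pairI D E F G) ()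
  const-generation (proj₁I D E F) ()
  const-generation (proj₂I D E F G) ()

  mutual

    abstraction : ∀ {Γ t C Δ ρ} → Γ ⊢v t ∶ C → EnvTyped Δ ρ Γ → Δ ⊢ str ρ t ∶ R ρ C (c0 ρ t) (c1 ρ t)
    abstraction {ρ = ρ} ax ok = closed-typed (λ _ → refl) (λ _ → refl) (conv ⋆ʳ-typed (⁻ (R-⋆ ρ ⋆ ⋆)) (⋆ʳ-app-typed [] ax ax)) (proj₁ ok)
    abstraction {ρ = ρ} (const c a) ok = consts-ok c a ρ (proj₁ ok)
    abstraction (var0 D) ok = proj₂ (proj₂ (proj₂ ok here))
    abstraction {ρ = ρ} (weak {t = t} {B} D E) ok =
      reterm (sym (str-sren ρ suc t)) (retype (sym (trans (R-sren ρ suc B _ _) (cong₂ (R (ρ ∘ suc) B) (c0-sren ρ suc t) (c1-sren ρ suc t))))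
        (abstraction D (EnvTyped-down ok)))
    abstraction {ρ = ρ} (piF DA DB) ok = conv (str-Pi-typed DA DB ok) (⁻ (R-⋆ ρ _ _)) (⋆ʳ-app-typed (proj₁ ok) (c0-typed (piF DA DB) ok) (c1-typed (piF DA DB) ok))
    abstraction {ρ = ρ} (sgF DA DB) ok = conv (str-Sg-typed DA DB ok) (⁻ (R-⋆ ρ _ _)) (⋆ʳ-app-typed (proj₁ ok) (c0-typed (sgF DA DB) ok) (c1-typed (sgF DA DB) ok))
    abstraction (abs D DA DB) ok = abstraction-lam D DA DB ok
    abstraction (appl {f = f} D₁ D₂ DA DB DBa) ok with codeView f
    ... | isPî = abstraction-Pî D₁ D₂ DA DB DBa ok
    ... | isSĝ = abstraction-Sĝ D₁ D₂ DA DB DBa ok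
    ... | notHat = abstraction-app D₁ D₂ DA DB DBa ok
    abstraction (pairI D₁ D₂ DA DB) ok = abstraction-pair D₁ D₂ DA DB ok
    abstraction {ρ = ρ} (proj₁I {p = p} {A} {B} D DA DB) ok =
      proj₁I (conv (abstraction D ok) (R-Sg ρ A B (c0 ρ p) (c1 ρ p)) (RelΣ-typed DA DB ok (c0-typed D ok) (c1-typed D ok)))
    abstraction {ρ = ρ} (proj₂I {p = p} {A} {B} D DA DB DBf) ok =
      conv (retype (R-single ρ B (fst (c0 ρ p)) (fst (c1 ρ p)) (fst (str ρ p)) (snd (c0 ρ p)) (snd (c1 ρ p)))
              (proj₂I (conv (abstraction D ok) (R-Sg ρ A B (c0 ρ p) (c1 ρ p)) (RelΣ-typed DA DB ok (c0-typed D ok) (c1-typed D ok)))))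
           (⁻ (R-subst (single (fst p)) ρ B _ _ ∙ ≡⇒Conv (R-cong (λ { zero → refl ; (suc k) → refl }) B _ _)))
           (R-typed DBf ok (c0-typed (proj₂I D DA DB DBf) ok) (c1-typed (proj₂I D DA DB DBf) ok))
    abstraction {ρ = ρ} (conv D c E) ok = conv (abstraction D ok) (R-conv ρ _ _ c) (R-typed E ok (c0-typed (conv D c E) ok) (c1-typed (conv D c E) ok))

    -- Abstractions: the body is related under x₀, x₁, x*, and R (Π A B)
    -- unfolds to the corresponding triple Π-type.
    abstraction-lam : ∀ {Γ A b B Δ ρ} → (A ∷ Γ) ⊢v b ∶ B → Γ ⊢v A ∶ ⋆ → (A ∷ Γ) ⊢v B ∶ ⋆ → EnvTyped Δ ρ Γ →
      Δ ⊢ str ρ (lam A b) ∶ R ρ (Pi A B) (c0 ρ (lam A b)) (c1 ρ (lam A b))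
    abstraction-lam {A = A} {b} {B} {Δ} {ρ} D DA DB ok =
      conv (abs (abs (abs Hb (piF DR DRB)) (piF D1 (piF DR DRB))) (piF D0 (piF D1 (piF DR DRB))))
           (cPi ε (cPi ε (cPi ε (R-xy (ext3 ρ) B (⁻ β0) (⁻ β1)))) ∙ ⁻ (R-Pi ρ A B (c0 ρ (lam A b)) (c1 ρ (lam A b))))
           (R-Pi-typed DA DB ok (c0-typed (abs D DA DB) ok) (c1-typed (abs D DA DB) ok))
      where
      D0 = c0-typed DA ok
      D1 = weak (c1-typed DA ok) D0
      ok2 = EnvTyped-weak₂ ok D0 D1
      DR = R-typed DA ok2 (retype (trans (ss≡ _) (c0-sh 2 ρ A)) (weak (var0 D0) D1)) (retype (trans (ss≡ _) (c1-sh 2 ρ A)) (var0 D1))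
      ok3 = EnvTyped-ext ok D0 D1 DR
      Hb = abstraction D ok3
      DRB = R-typed DB ok3 (c0-typed D ok3) (c1-typed D ok3)
      β0 : Conv≈ (app (shift 3 (c0 ρ (lam A b))) (v 2)) (c0 (ext3 ρ) b)
      β0 = Contr⇒Conv β ∙ ≡⇒Conv (trans (subst-rename (single (v 2)) (extR (3 +_)) (subst (extS (e0 ρ)) b)) (trans (subst-cong {σ = single (v 2) ∘ extR (3 +_)} {τ = consS (v 2) (shE 3)} (λ { zero → refl ; (suc k) → refl }) (subst (extS (e0 ρ)) b))
             (c0ext ρ b)))
      β1 : Conv≈ (app (shift 3 (c1 ρ (lam A b))) (v 1)) (c1 (ext3 ρ) b)
      β1 = Contr⇒Conv β ∙ ≡⇒Conv (trans (subst-rename (single (v 1)) (extR (3 +_)) (subst (extS (e1 ρ)) b)) (trans (subst-cong {σ = single (v 1) ∘ extR (3 +_)} {τ = consS (v 1) (shE 3)} (λ { zero → refl ; (suc k) → refl }) (subst (extS (e1 ρ)) b))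
             (c1ext ρ b)))

    -- Applications f a (other than codes): f* is related at Π A B, so it can
    -- be applied to a₀, a₁ and a*.
    abstraction-app : ∀ {Γ f a A B Δ ρ} → Γ ⊢v f ∶ Pi A B → Γ ⊢v a ∶ A → Γ ⊢v A ∶ ⋆ → (A ∷ Γ) ⊢v B ∶ ⋆ →
      Γ ⊢v B [ a ] ∶ ⋆ → EnvTyped Δ ρ Γ → Δ ⊢ strApp ρ f a ∶ R ρ (B [ a ]) (c0 ρ (app f a)) (c1 ρ (app f a))
    abstraction-app {f = f} {a} {A} {B} {Δ} {ρ} D₁ D₂ DA DB DBa ok =
      conv (retype eqres (apps-typed {σ = var} {As = c0 ρ A ∷ shift 1 (c1 ρ A) ∷ R (sh 2 ρ) A (v 1) (v 0) ∷ []}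
              {B = R (ext3 ρ) B (app (shift 3 (c0 ρ f)) (v 2)) (app (shift 3 (c1 ρ f)) (v 1))}
              (retype (sym (subst-id _)) fstar)
              (retype (sym (subst-id _)) (c0-typed D₂ ok) ∷ (retype (sym (sub-drop 1 _ (λ _ → refl))) (c1-typed D₂ ok) ∷ (retype (sym eqas) (abstraction D₂ ok) ∷ [])))))
           (⁻ (R-subst (single a) ρ B _ _ ∙ ≡⇒Conv (R-cong (λ { zero → refl ; (suc k) → refl }) B _ _)))
           (R-typed DBa ok (c0-typed (appl D₁ D₂ DA DB DBa) ok) (c1-typed (appl D₁ D₂ DA DB DBa) ok))
      where
      fstar = conv (abstraction D₁ ok) (R-Pi ρ A B (c0 ρ f) (c1 ρ f)) (RelΠ-typed DA DB ok (c0-typed D₁ ok) (c1-typed D₁ ok))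
      τ2 = consAll (c0 ρ a ∷ c1 ρ a ∷ []) var
      eqas : subst τ2 (R (sh 2 ρ) A (v 1) (v 0)) ≡ R ρ A (c0 ρ a) (c1 ρ a)
      eqas = trans (R-tsub τ2 (sh 2 ρ) A (v 1) (v 0))
        (R-cong (λ k → cong3 (sub-drop 2 _ (λ _ → refl)) (sub-drop 2 _ (λ _ → refl)) (sub-drop 2 _ (λ _ → refl))) A _ _)
      τ3 = consAll (c0 ρ a ∷ c1 ρ a ∷ str ρ a ∷ []) var
      eqres : subst τ3 (R (ext3 ρ) B (app (shift 3 (c0 ρ f)) (v 2)) (app (shift 3 (c1 ρ f)) (v 1)))
              ≡ R (cons3 (c0 ρ a , c1 ρ a , str ρ a) ρ) B (app (c0 ρ f) (c0 ρ a)) (app (c1 ρ f) (c1 ρ a))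
      eqres = trans (R-tsub τ3 (ext3 ρ) B _ _) (trans (R-cong (β-env ρ _ _ _) B _ _)
        (cong₂ (R _ B) (cong (λ z → app z (c0 ρ a)) (sub-drop 3 _ (λ _ → refl))) (cong (λ z → app z (c1 ρ a)) (sub-drop 3 _ (λ _ → refl)))))

    -- Pairs: a* is related at A, and b* at B under the entry (π₁ p₀, π₁ p₁, a*).
    abstraction-pair : ∀ {Γ a b A B Δ ρ} → Γ ⊢v a ∶ A → Γ ⊢v b ∶ (B [ a ]) → Γ ⊢v A ∶ ⋆ → (A ∷ Γ) ⊢v B ∶ ⋆ →
      EnvTyped Δ ρ Γ → Δ ⊢ str ρ (pair a b) ∶ R ρ (Sg A B) (c0 ρ (pair a b)) (c1 ρ (pair a b))
    abstraction-pair {a = a} {b} {A} {B} {Δ} {ρ} D₁ D₂ DA DB ok =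
      conv (pairI a' b' (RelΣ-typed DA DB ok DP0 DP1)) (⁻ (R-Sg ρ A B P₀ P₁)) (R-Sg-typed DA DB ok DP0 DP1)
      where
      P₀ = c0 ρ (pair a b)
      P₁ = c1 ρ (pair a b)
      DP0 = c0-typed (pairI D₁ D₂ DA DB) ok
      DP1 = c1-typed (pairI D₁ D₂ DA DB) ok
      a' : Δ ⊢ str ρ a ∶ R ρ A (fst P₀) (fst P₁)
      a' = conv (abstraction D₁ ok) (R-xy ρ A (⁻ (Contr⇒Conv π₁β)) (⁻ (Contr⇒Conv π₁β))) (R-typed DA ok (proj₁I DP0) (proj₁I DP1))
      okc = EnvTyped-cons ok (proj₁I DP0) (proj₁I DP1) a'
      Tb = R-typed DB okc (retype (trans (sub-ext-single (e0 ρ) B (fst P₀)) (subst-cong (λ { zero → refl ; (suc k) → refl }) B)) (proj₂I DP0)) (retype (trans (sub-ext-single (e1 ρ) B (fst P₁)) (subst-cong (λ { zero → refl ; (suc k) → refl }) B)) (proj₂I DP1))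
      b' = retype (sym (R-single ρ B (fst P₀) (fst P₁) (str ρ a) (snd P₀) (snd P₁)))
        (conv (abstraction D₂ ok) (R-subst (single a) ρ B _ _ ∙ ≡⇒Conv (R-cong (λ { zero → refl ; (suc k) → refl }) B _ _)
           ∙ R-envconv ρ B _ _ (⁻ (Contr⇒Conv π₁β)) (⁻ (Contr⇒Conv π₁β)) ∙ R-xy _ B (⁻ (Contr⇒Conv π₂β)) (⁻ (Contr⇒Conv π₂β))) Tb)

    hat-args-typed : ∀ {Γ c X a A B Δ ρ} → ctype c ≡ ctype cPî →
      Γ ⊢v app (con c) X ∶ Pi A B → Γ ⊢v a ∶ A → EnvTyped Δ ρ Γ →
      HatArgsTyped Δ ρ X a × Conv λ*U B U·
    hat-args-typed {X = X} {a} {ρ = ρ} hc D₁ D₂ ok with code-arg-typed D₁ refl ok hc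
    ... | DX0 , DX1 , DXs , cS with Pi-inj cS
    ...   | cA , cB = record
      { X₀-typed = DX0 ; X₁-typed = DX1 ; a₀-typed = DY0 ; a₁-typed = DY1 ; X*-typed = DXs
      ; a*-typed = conv (abstraction D₂ ok) (R-conv ρ _ _ cA ∙ R-Pi ρ (T· X) U· _ _ ∙ fam≈)
                        (HatStarFamTy-typed w DX0 DX1 DXs DY0 DY1) } , cB
      where
      w = proj₁ ok
      DY0 = conv (c0-typed D₂ ok) (Conv-emb (Conv-subst (e0 ρ) cA)) (fam-typed w DX0)
      DY1 = conv (c1-typed D₂ ok) (Conv-emb (Conv-subst (e1 ρ) cA)) (fam-typed w DX1)
      rel≡ : R (sh 2 ρ) (T· X) (v 1) (v 0) ≡ Rel· (ss (c0 ρ X)) (ss (c1 ρ X)) (ss (str ρ X)) (v 1) (v 0)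
      rel≡ = cong-Rel (sym (trans (ss≡ _) (c0-sh 2 ρ X))) (sym (trans (ss≡ _) (c1-sh 2 ρ X))) (sym (trans (ss≡ _) (str-sh 2 ρ X))) refl refl
      fam≈ : Conv≈ (RelΠ ρ (T· X) U· (c0 ρ a) (c1 ρ a)) (HatStarFamTy (c0 ρ X) (c1 ρ X) (c0 ρ a) (c1 ρ a) (str ρ X))
      fam≈ = cPi ε (cPi ε (cPi (≡⇒Conv rel≡)
               (R-U (ext3 ρ) _ _ ∙ ≡⇒Conv (cong₂ (λ p q → Eq· (app p (v 2)) (app q (v 1))) (sym (sss≡ _)) (sym (sss≡ _))))))

    abstraction-Pî : ∀ {Γ X a A B Δ ρ} → Γ ⊢v app (con cPî) X ∶ Pi A B → Γ ⊢v a ∶ A → Γ ⊢v A ∶ ⋆ → (A ∷ Γ) ⊢v B ∶ ⋆ →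
      Γ ⊢v B [ a ] ∶ ⋆ → EnvTyped Δ ρ Γ →
      Δ ⊢ Pî*· (c0 ρ X) (c1 ρ X) (c0 ρ a) (c1 ρ a) (str ρ X) (str ρ a) ∶ R ρ (B [ a ]) (Pî· (c0 ρ X) (c0 ρ a)) (Pî· (c1 ρ X) (c1 ρ a))
    abstraction-Pî {a = a} {ρ = ρ} D₁ D₂ DA DB DBa ok with hat-args-typed refl D₁ D₂ ok
    ... | args , cB =
      conv (Pî*-typed (proj₁ ok) X₀-typed X₁-typed a₀-typed a₁-typed X*-typed a*-typed)
           (⁻ (R-conv ρ _ _ (Conv-subst (single a) cB) ∙ R-U ρ _ _))
           (R-typed DBa ok (c0-typed (appl D₁ D₂ DA DB DBa) ok) (c1-typed (appl D₁ D₂ DA DB DBa) ok))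
      where open HatArgsTyped args

    abstraction-Sĝ : ∀ {Γ X a A B Δ ρ} → Γ ⊢v app (con cSĝ) X ∶ Pi A B → Γ ⊢v a ∶ A → Γ ⊢v A ∶ ⋆ → (A ∷ Γ) ⊢v B ∶ ⋆ →
      Γ ⊢v B [ a ] ∶ ⋆ → EnvTyped Δ ρ Γ →
      Δ ⊢ Sĝ*· (c0 ρ X) (c1 ρ X) (c0 ρ a) (c1 ρ a) (str ρ X) (str ρ a) ∶ R ρ (B [ a ]) (Sĝ· (c0 ρ X) (c0 ρ a)) (Sĝ· (c1 ρ X) (c1 ρ a))
    abstraction-Sĝ {a = a} {ρ = ρ} D₁ D₂ DA DB DBa ok with hat-args-typed refl D₁ D₂ ok
    ... | args , cB =
      conv (Sĝ*-typed (proj₁ ok) X₀-typed X₁-typed a₀-typed a₁-typed X*-typed a*-typed)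
           (⁻ (R-conv ρ _ _ (Conv-subst (single a) cB) ∙ R-U ρ _ _))
           (R-typed DBa ok (c0-typed (appl D₁ D₂ DA DB DBa) ok) (c1-typed (appl D₁ D₂ DA DB DBa) ok))
      where open HatArgsTyped args

    R-typed : ∀ {Γ C Δ ρ x y} → Γ ⊢v C ∶ ⋆ → EnvTyped Δ ρ Γ → Δ ⊢ x ∶ c0 ρ C → Δ ⊢ y ∶ c1 ρ C → Δ ⊢ R ρ C x y ∶ ⋆
    R-typed {C = C} D ok Dx Dy with elView C
    ... | isT {X} with code-arg-typed D refl ok refl
    ...   | D0X , D1X , DXs , _ = Rel-typed (proj₁ ok) D0X D1X DXs Dx Dy
    R-typed {C = C} {ρ = ρ} D ok Dx Dy | notT =
      appl (retype (cong (λ z → Pi z ⋆) (sub-single-shift _ _)) (appl D' Dx)) Dy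
      where
      D0 = c0-typed D ok
      D' = conv (abstraction D ok) (R-⋆ ρ _ _) (piF D0 (piF (weak (c1-typed D ok) D0) (⋆-typed (weak (c1-typed D ok) D0 ∷ (D0 ∷ proj₁ ok)))))

    code-arg-typed : ∀ {Γ t S Δ ρ c X Bc} → Γ ⊢v t ∶ S → t ≡ app (con c) X → EnvTyped Δ ρ Γ → ctype c ≡ Pi U· Bc →
       (Δ ⊢ c0 ρ X ∶ U·) × (Δ ⊢ c1 ρ X ∶ U·) × (Δ ⊢ str ρ X ∶ Eq· (c0 ρ X) (c1 ρ X)) × Conv λ*U S (Bc [ X ])
    code-arg-typed {ρ = ρ} (appl {a = a} D₁ D₂ DA DB DBa) refl ok hc with Pi-inj (≡subst (Conv λ*U _) hc (const-generation D₁ refl))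
    ... | cA , cB = D0X , D1X , conv (abstraction D₂ ok) (R-conv ρ _ _ cA ∙ R-U ρ _ _) (Eq-typed (proj₁ ok) D0X D1X) , Conv-subst (single a) cB
      where
      D0X = conv (c0-typed D₂ ok) (Conv-emb (Conv-subst (e0 ρ) cA)) (const≈ cU (proj₁ ok))
      D1X = conv (c1-typed D₂ ok) (Conv-emb (Conv-subst (e1 ρ) cA)) (const≈ cU (proj₁ ok))
    code-arg-typed {ρ = ρ} {Bc = Bc} (weak {t = t'} D E) eq ok hc with inv-app t' eq
    ... | X' , refl , refl with code-arg-typed D refl (EnvTyped-down ok) hc
    ...   | D0X , D1X , DXs , cS = reterm (sym (c0-sren ρ suc X')) D0X , reterm (sym (c1-sren ρ suc X')) D1X ,
            reterm (sym (str-sren ρ suc X')) (retype (sym (cong₂ Eq· (c0-sren ρ suc X') (c1-sren ρ suc X'))) DXs) ,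
            ≡subst (Conv λ*U _) (trans (rename-single suc Bc X') (cong (_[ shift 1 X' ]) (closedB hc suc))) (Conv-rename suc cS)
    code-arg-typed (conv D c E) eq ok hc with code-arg-typed D eq ok hc
    ... | a , a' , b , cS = a , a' , b , (⁻ c ∙ cS)
    code-arg-typed ax () ok hc
    code-arg-typed (const c x) () ok hc
    code-arg-typed (var0 D) () ok hc
    code-arg-typed (piF D E) () ok hc
    code-arg-typed (sgF D E) () ok hc
    code-arg-typed (abs D E F) () ok hc
    code-arg-typed (pairI D E F G) () ok hc
    code-arg-typed (proj₁I D E F) () ok hc
    code-arg-typed (proj₂I D E F G) () ok hc

    RelΠ-typed : ∀ {Γ A B Δ ρ x y} → Γ ⊢v A ∶ ⋆ → (A ∷ Γ) ⊢v B ∶ ⋆ → EnvTyped Δ ρ Γ →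
      Δ ⊢ x ∶ c0 ρ (Pi A B) → Δ ⊢ y ∶ c1 ρ (Pi A B) → Δ ⊢ RelΠ ρ A B x y ∶ ⋆
    RelΠ-typed {A = A} {B} {Δ} {ρ} {x} {y} DA DB ok Dx Dy = piF D0 (piF D1 (piF DR DRB))
      where
      D0 = c0-typed DA ok
      D1 = weak (c1-typed DA ok) D0
      ok2 = EnvTyped-weak₂ ok D0 D1
      DR = R-typed DA ok2 (retype (trans (ss≡ _) (c0-sh 2 ρ A)) (weak (var0 D0) D1)) (retype (trans (ss≡ _) (c1-sh 2 ρ A)) (var0 D1))
      ok3 = EnvTyped-ext ok D0 D1 DR
      w3 = proj₁ ok3
      Dx3 = retype (c0ext ρ B) (app-shift3-typed w3 Dx (retype (sss≡ _) (weak (weak (var0 D0) D1) DR)))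
      Dy3 = retype (c1ext ρ B) (app-shift3-typed w3 Dy (retype (trans (cong (shift 1) (shift-shift 1 1 _)) (shift-shift 1 2 _)) (weak (var0 D1) DR)))
      DRB = R-typed DB ok3 Dx3 Dy3

    RelΣ-typed : ∀ {Γ A B Δ ρ x y} → Γ ⊢v A ∶ ⋆ → (A ∷ Γ) ⊢v B ∶ ⋆ → EnvTyped Δ ρ Γ →
      Δ ⊢ x ∶ c0 ρ (Sg A B) → Δ ⊢ y ∶ c1 ρ (Sg A B) → Δ ⊢ RelΣ ρ A B x y ∶ ⋆
    RelΣ-typed {A = A} {B} {Δ} {ρ} {x} {y} DA DB ok Dx Dy = sgF DR DRB
      where
      DR = R-typed DA ok (proj₁I Dx) (proj₁I Dy)
      okw = EnvTyped-weak ok DR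
      okS = EnvTyped-cons okw (retype (c0-sh 1 ρ A) (proj₁I (weak Dx DR))) (retype (c1-sh 1 ρ A) (proj₁I (weak Dy DR)))
              (retype (R-sh 1 ρ A _ _) (var0 DR))
      DRB = R-typed DB okS (retype (trans (snd-eq (e0 ρ) B _) (subst-cong (λ { zero → refl ; (suc k) → refl }) B)) (proj₂I (weak Dx DR)))
                      (retype (trans (snd-eq (e1 ρ) B _) (subst-cong (λ { zero → refl ; (suc k) → refl }) B)) (proj₂I (weak Dy DR)))

    str-Pi-typed : ∀ {Γ A B Δ ρ} → Γ ⊢v A ∶ ⋆ → (A ∷ Γ) ⊢v B ∶ ⋆ → EnvTyped Δ ρ Γ →
      Δ ⊢ str ρ (Pi A B) ∶ Pi (c0 ρ (Pi A B)) (Pi (shift 1 (c1 ρ (Pi A B))) ⋆)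
    str-Pi-typed {A = A} {B} {Δ} {ρ} DA DB ok =
      abs (abs (reterm eqBody body) (piF DP1 (⋆-typed (DP1 ∷ w1)))) (piF DP0 (piF DP1 (⋆-typed (DP1 ∷ w1))))
      where
      DP0 = c0-typed (piF DA DB) ok
      DP1 = weak (c1-typed (piF DA DB) ok) DP0
      w1 = DP0 ∷ proj₁ ok
      ok2 = EnvTyped-weak₂ ok DP0 DP1
      body = RelΠ-typed DA DB ok2 (retype (trans (ss≡ _) (c0-sh 2 ρ (Pi A B))) (weak (var0 DP0) DP1))
                             (retype (trans (ss≡ _) (c1-sh 2 ρ (Pi A B))) (var0 DP1))
      eqBody : RelΠ (sh 2 ρ) A B (v 1) (v 0) ≡ Pi (shift 2 (c0 ρ A)) (Pi (shift 3 (c1 ρ A)) (Pi (R (sh 4 ρ) A (v 1) (v 0))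
         (R (ext3 (sh 2 ρ)) B (app (v 4) (v 2)) (app (v 3) (v 1)))))
      eqBody = cong₂ Pi (sym (c0-sh 2 ρ A)) (cong₂ Pi (trans (cong (shift 1) (sym (c1-sh 2 ρ A))) (shift-shift 1 2 _))
                 (cong₂ Pi (R-cong (sh-sh 2 2 ρ) A _ _) refl))

    str-Sg-typed : ∀ {Γ A B Δ ρ} → Γ ⊢v A ∶ ⋆ → (A ∷ Γ) ⊢v B ∶ ⋆ → EnvTyped Δ ρ Γ →
      Δ ⊢ str ρ (Sg A B) ∶ Pi (c0 ρ (Sg A B)) (Pi (shift 1 (c1 ρ (Sg A B))) ⋆)
    str-Sg-typed {A = A} {B} {Δ} {ρ} DA DB ok =
      abs (abs (reterm eqBody body) (piF DP1 (⋆-typed (DP1 ∷ w1)))) (piF DP0 (piF DP1 (⋆-typed (DP1 ∷ w1))))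
      where
      DP0 = c0-typed (sgF DA DB) ok
      DP1 = weak (c1-typed (sgF DA DB) ok) DP0
      w1 = DP0 ∷ proj₁ ok
      ok2 = EnvTyped-weak₂ ok DP0 DP1
      body = RelΣ-typed DA DB ok2 (retype (trans (ss≡ _) (c0-sh 2 ρ (Sg A B))) (weak (var0 DP0) DP1))
                             (retype (trans (ss≡ _) (c1-sh 2 ρ (Sg A B))) (var0 DP1))
      eqBody : RelΣ (sh 2 ρ) A B (v 1) (v 0) ≡ Sg (R (sh 2 ρ) A (fst (v 1)) (fst (v 0)))
          (R (cons3 (fst (v 2) , fst (v 1) , v 0) (sh 3 ρ)) B (snd (v 2)) (snd (v 1)))
      eqBody = cong₂ Sg refl (R-cong (cons3-cong _ (sh-sh 1 2 ρ)) B _ _)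

    R-Pi-typed : ∀ {Γ A B Δ ρ x y} → Γ ⊢v A ∶ ⋆ → (A ∷ Γ) ⊢v B ∶ ⋆ → EnvTyped Δ ρ Γ →
      Δ ⊢ x ∶ c0 ρ (Pi A B) → Δ ⊢ y ∶ c1 ρ (Pi A B) → Δ ⊢ R ρ (Pi A B) x y ∶ ⋆
    R-Pi-typed DA DB ok Dx Dy = appl (retype (cong (λ z → Pi z ⋆) (sub-single-shift _ _)) (appl (str-Pi-typed DA DB ok) Dx)) Dy

    R-Sg-typed : ∀ {Γ A B Δ ρ x y} → Γ ⊢v A ∶ ⋆ → (A ∷ Γ) ⊢v B ∶ ⋆ → EnvTyped Δ ρ Γ →
      Δ ⊢ x ∶ c0 ρ (Sg A B) → Δ ⊢ y ∶ c1 ρ (Sg A B) → Δ ⊢ R ρ (Sg A B) x y ∶ ⋆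
    R-Sg-typed DA DB ok Dx Dy = appl (retype (cong (λ z → Pi z ⋆) (sub-single-shift _ _)) (appl (str-Sg-typed DA DB ok) Dx)) Dy

-- Conversions between concrete closed terms are checked by computing:
-- leftmost-outermost reduction with fuel, and comparing the results.
rootContr : (t : Tm) → Maybe (Σ Tm (Contr λ*U≈ t))
rootContr (app (lam A b) a) = just (_ , β)
rootContr (fst (pair a b)) = just (_ , π₁β)
rootContr (snd (pair a b)) = just (_ , π₂β)
rootContr (app (con cT) (app (app (con cPî) A) B)) = just (_ , T-Pî)
rootContr (app (con cT) (app (app (con cSĝ) A) B)) = just (_ , T-Sĝ)
rootContr (app (con cT) (con c⋆̂)) = just (_ , T-⋆̂)
rootContr (app (app (app (app (app (con cRel) X) Y) (con crefl)) A) B) = just (_ , Rel-refl)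
rootContr (app (app (app (app (app (con cRel) X) Y) (app (app (app (app (app (app (con cPî*) A) A') B) B') As) Bs)) f) f') = just (_ , Rel-Pî*)
rootContr (app (app (app (app (app (con cRel) X) Y) (app (app (app (app (app (app (con cSĝ*) A) A') B) B') As) Bs)) f) f') = just (_ , Rel-Sĝ*)
rootContr _ = nothing

leftmostStep : (t : Tm) → Maybe (Σ Tm (Step λ*U≈ t))
leftmostStep t = Maybe.map (Prod.map₂ here) (rootContr t) <∣> inside t
  where
  under : ∀ {t} (f : Tm → Tm) → (∀ {u} → Step λ*U≈ t u → Step λ*U≈ (f t) (f u)) →
    Maybe (Σ Tm (Step λ*U≈ t)) → Maybe (Σ Tm (Step λ*U≈ (f t)))
  under f h = Maybe.map (Prod.map f h)
  inside : (t : Tm) → Maybe (Σ Tm (Step λ*U≈ t))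
  inside (var x) = nothing
  inside ⋆ = nothing
  inside (Pi A B) = under (λ x → Pi x B) Pi₁ (leftmostStep A) <∣> under (Pi A) Pi₂ (leftmostStep B)
  inside (Sg A B) = under (λ x → Sg x B) Sg₁ (leftmostStep A) <∣> under (Sg A) Sg₂ (leftmostStep B)
  inside (lam A B) = under (λ x → lam x B) lam₁ (leftmostStep A) <∣> under (lam A) lam₂ (leftmostStep B)
  inside (app A B) = under (λ x → app x B) app₁ (leftmostStep A) <∣> under (app A) app₂ (leftmostStep B)
  inside (pair A B) = under (λ x → pair x B) pair₁ (leftmostStep A) <∣> under (pair A) pair₂ (leftmostStep B)
  inside (fst A) = under fst fst₁ (leftmostStep A)
  inside (snd A) = under snd snd₁ (leftmostStep A)
  inside (con c) = nothing

normalize : ℕ → (t : Tm) → Σ Tm (Star (Step λ*U≈) t)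
normalize zero t = t , ε
normalize (suc n) t with leftmostStep t
... | nothing = t , ε
... | just (u , r) with normalize n u
...   | w , rs = w , (r ◅ rs)

conv-by-normalization : ∀ n t u → proj₁ (normalize n t) ≡ proj₁ (normalize n u) → Conv≈ t u
conv-by-normalization n t u e = Steps⇒Conv (proj₂ (normalize n t)) ∙ ≡⇒Conv e ∙ ⁻ (Steps⇒Conv (proj₂ (normalize n u)))

wf-U : WF≈ (U· ∷ [])
wf-U = const≈ cU [] ∷ []
wf-UU : WF≈ (U· ∷ U· ∷ [])
wf-UU = const≈ cU wf-U ∷ wf-U

var0-typed : ∀ {Δ A} → WF≈ (A ∷ Δ) → (A ∷ Δ) ⊢ v 0 ∶ shift 1 A
var0-typed w = var-typed w here
var1-typed : ∀ {Δ A B} → WF≈ (B ∷ A ∷ Δ) → (B ∷ A ∷ Δ) ⊢ v 1 ∶ shift 1 (shift 1 A)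
var1-typed w = var-typed w (there here)
var2-typed : ∀ {Δ A B C} → WF≈ (C ∷ B ∷ A ∷ Δ) → (C ∷ B ∷ A ∷ Δ) ⊢ v 2 ∶ shift 1 (shift 1 (shift 1 A))
var2-typed w = var-typed w (there (there here))
var3-typed : ∀ {Δ A B C D} → WF≈ (D ∷ C ∷ B ∷ A ∷ Δ) → (D ∷ C ∷ B ∷ A ∷ Δ) ⊢ v 3 ∶ shift 1 (shift 1 (shift 1 (shift 1 A)))
var3-typed w = var-typed w (there (there (there here)))
var4-typed : ∀ {Δ A B C D E} → WF≈ (E ∷ D ∷ C ∷ B ∷ A ∷ Δ) → (E ∷ D ∷ C ∷ B ∷ A ∷ Δ) ⊢ v 4 ∶ shift 1 (shift 1 (shift 1 (shift 1 (shift 1 A))))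
var4-typed w = var-typed w (there (there (there (there here))))
var5-typed : ∀ {Δ A B C D E F} → WF≈ (F ∷ E ∷ D ∷ C ∷ B ∷ A ∷ Δ) → (F ∷ E ∷ D ∷ C ∷ B ∷ A ∷ Δ) ⊢ v 5 ∶ shift 1 (shift 1 (shift 1 (shift 1 (shift 1 (shift 1 A)))))
var5-typed w = var-typed w (there (there (there (there (there here)))))

Uʳ-typed : [] ⊢ Uʳ ∶ Pi U· (Pi U· ⋆)
Uʳ-typed = abs (abs (Eq-typed wf-UU (var1-typed wf-UU) (var0-typed wf-UU)) (piF (const≈ cU wf-U) (⋆-typed wf-UU))) (piF (const≈ cU []) (piF (const≈ cU wf-U) (⋆-typed wf-UU)))

Tʳ-typed : [] ⊢ Tʳ ∶ Pi U· (Pi U· (Pi (Eq· (v 1) (v 0)) (Pi (T· (v 2)) (Pi (T· (v 2)) ⋆))))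
Tʳ-typed = abs (abs (abs (abs (abs body P5) P4) P3) P2) P1
  where
  E3 = Eq-typed wf-UU (var1-typed wf-UU) (var0-typed wf-UU)
  w3 = E3 ∷ wf-UU
  E4 = T-typed w3 (var2-typed w3)
  w4 = E4 ∷ w3
  E5 = T-typed w4 (var2-typed w4)
  w5 = E5 ∷ w4
  body = Rel-typed w5 (var4-typed w5) (var3-typed w5) (var2-typed w5) (var1-typed w5) (var0-typed w5)
  P5 = piF E5 (⋆-typed w5)
  P4 = piF E4 P5
  P3 = piF E3 P4
  P2 = piF (const≈ cU wf-U) P3
  P1 = piF (const≈ cU []) P2

hatStarTypeʳ : (Tm → Tm → Tm) → Tm
hatStarTypeʳ hat = pis hatStarBinders (Eq· (hat (v 5) (v 2)) (hat (v 4) (v 1)))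

Pî-typed : ∀ {Δ X Y} → WF≈ Δ → Δ ⊢ X ∶ U· → Δ ⊢ Y ∶ Pi (T· X) U· → Δ ⊢ Pî· X Y ∶ U·
Pî-typed w DX DY = apps-typed {σ = var} {As = U· ∷ Pi (T· (v 0)) U· ∷ []} {B = U·} (const≈ cPî w) (DX ∷ DY ∷ [])

Sĝ-typed : ∀ {Δ X Y} → WF≈ Δ → Δ ⊢ X ∶ U· → Δ ⊢ Y ∶ Pi (T· X) U· → Δ ⊢ Sĝ· X Y ∶ U·
Sĝ-typed w DX DY = apps-typed {σ = var} {As = U· ∷ Pi (T· (v 0)) U· ∷ []} {B = U·} (const≈ cSĝ w) (DX ∷ DY ∷ [])

-- The translations of Π̂ and Σ̂: the six arguments of the constructor of Eq,
-- abstracted in the order in which str applies them.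
hatʳ-typed : (hat : Tm → Tm → Tm) (hat* : Tm → Tm → Tm → Tm → Tm → Tm → Tm) →
  (∀ {Δ X Y} → WF≈ Δ → Δ ⊢ X ∶ U· → Δ ⊢ Y ∶ Pi (T· X) U· → Δ ⊢ hat X Y ∶ U·) →
  (∀ {Δ X₀ X₁ Y₀ Y₁ Xs Ys} → WF≈ Δ → Δ ⊢ X₀ ∶ U· → Δ ⊢ X₁ ∶ U· → Δ ⊢ Y₀ ∶ Pi (T· X₀) U· → Δ ⊢ Y₁ ∶ Pi (T· X₁) U· →
     Δ ⊢ Xs ∶ Eq· X₀ X₁ → Δ ⊢ Ys ∶ HatStarFamTy X₀ X₁ Y₀ Y₁ Xs → Δ ⊢ hat* X₀ X₁ Y₀ Y₁ Xs Ys ∶ Eq· (hat X₀ Y₀) (hat X₁ Y₁)) →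
  [] ⊢ lams hatStarBinders (hat* (v 5) (v 4) (v 2) (v 1) (v 3) (v 0)) ∶ hatStarTypeʳ hat
hatʳ-typed hat hat* hat-typed hat*-typed = abs (abs (abs (abs (abs (abs body P6) P5) P4) P3) P2) P1
  where
  E3 = Eq-typed wf-UU (var1-typed wf-UU) (var0-typed wf-UU)
  w3 = E3 ∷ wf-UU
  E4 = fam-typed w3 (var2-typed w3)
  w4 = E4 ∷ w3
  E5 = fam-typed w4 (var2-typed w4)
  w5 = E5 ∷ w4
  E6 = HatStarFamTy-typed w5 (var4-typed w5) (var3-typed w5) (var2-typed w5) (var1-typed w5) (var0-typed w5)
  w6 = E6 ∷ w5
  body = hat*-typed w6 (var5-typed w6) (var4-typed w6) (var2-typed w6) (var1-typed w6) (var3-typed w6) (var0-typed w6)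
  P6 = piF E6 (Eq-typed w6 (hat-typed w6 (var5-typed w6) (var2-typed w6)) (hat-typed w6 (var4-typed w6) (var1-typed w6)))
  P5 = piF E5 P6
  P4 = piF E4 P5
  P3 = piF E3 P4
  P2 = piF (const≈ cU wf-U) P3
  P1 = piF (const≈ cU []) P2

Pîʳ-typed : [] ⊢ Pîʳ ∶ hatStarTypeʳ Pî·
Pîʳ-typed = hatʳ-typed Pî· Pî*· Pî-typed Pî*-typed

Sĝʳ-typed : [] ⊢ Sĝʳ ∶ hatStarTypeʳ Sĝ·
Sĝʳ-typed = hatʳ-typed Sĝ· Sĝ*· Sĝ-typed Sĝ*-typed

-- Typing the translation of T uses the abstraction theorem for the type
-- Π U. ⋆ of T, whose derivation only mentions U; typing those of Π̂ and Σ̂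
-- uses it for Π U. (T 0 → U) → U, which mentions U and T.  So the
-- constants are handled in stages.
data ForT : Const → Set where
  forT-U : ForT cU

data ForHat : Const → Set where
  forHat-U : ForHat cU
  forHat-T : ForHat cT

U-related : Related cU
U-related ρ w = closed-typed (λ _ → refl) (λ _ → refl)
  (conv Uʳ-typed (⁻ (R-⋆ ρ U· U·)) (⋆ʳ-app-typed [] (const≈ cU []) (const≈ cU []))) w

⋆̂-related : Related c⋆̂
⋆̂-related ρ w = closed-typed (λ _ → refl) (λ _ → refl)
  (conv (const≈ crefl []) (⁻ (R-U ρ ⋆̂· ⋆̂·)) (appl (appl Uʳ-typed (const≈ c⋆̂ [])) (const≈ c⋆̂ []))) w

related-forT : ∀ c → ForT c → Related c
related-forT .cU forT-U = U-related

module AbstractionForT = Fundamental ForT related-forT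
module AnnotatedForT = Annotated ForT

⋆-typed-forT : AnnotatedForT._⊢v_∶_ (U· ∷ []) ⋆ ⋆
⋆-typed-forT = ⋆-typedᵛ (const cU forT-U ∷ [])
  where open AnnotatedForT

T-related : Related cT
T-related ρ w = closed-typed (λ _ → refl) (λ _ → refl)
  (conv Tʳ-typed (conv-by-normalization 100 _ _ refl)
    (AbstractionForT.R-Pi-typed {ρ = ρ} (Annotated.const cU forT-U) ⋆-typed-forT ([] , λ ()) (const≈ cT []) (const≈ cT []))) w

related-forHat : ∀ c → ForHat c → Related c
related-forHat .cU forHat-U = U-related
related-forHat .cT forHat-T = T-related

module AbstractionForHat = Fundamental ForHat related-forHat
module AnnotatedForHat = Annotated ForHat

hatDom-typed-forHat : AnnotatedForHat._⊢v_∶_ (U· ∷ []) (Pi (Pi (T· (v 0)) U·) U·) ⋆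
hatDom-typed-forHat = piF (piF T0 (U-typed (T0 ∷ wf-U₁))) (U-typed (piF T0 (U-typed (T0 ∷ wf-U₁)) ∷ wf-U₁))
  where
  open AnnotatedForHat
  U-typed : ∀ {Γ} → WFv Γ → Γ ⊢v U· ∶ ⋆
  U-typed w = closed-typedᵛ (λ _ → refl) (λ _ → refl) (const cU forHat-U) w
  wf-U₁ : WFv (U· ∷ [])
  wf-U₁ = const cU forHat-U ∷ []
  T0 : (U· ∷ []) ⊢v T· (v 0) ∶ ⋆
  T0 = appl (closed-typedᵛ (λ _ → refl) (λ _ → refl) (const cT forHat-T) wf-U₁) (var0 (const cU forHat-U))
         (U-typed wf-U₁) (⋆-typedᵛ (U-typed wf-U₁ ∷ wf-U₁)) (⋆-typedᵛ wf-U₁)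

Pî-related : Related cPî
Pî-related ρ w = closed-typed (λ _ → refl) (λ _ → refl)
  (conv Pîʳ-typed (conv-by-normalization 400 _ _ refl)
    (AbstractionForHat.R-Pi-typed {ρ = ρ} (Annotated.const cU forHat-U) hatDom-typed-forHat ([] , λ ()) (const≈ cPî []) (const≈ cPî []))) w

Sĝ-related : Related cSĝ
Sĝ-related ρ w = closed-typed (λ _ → refl) (λ _ → refl)
  (conv Sĝʳ-typed (conv-by-normalization 400 _ _ refl)
    (AbstractionForHat.R-Pi-typed {ρ = ρ} (Annotated.const cU forHat-U) hatDom-typed-forHat ([] , λ ()) (const≈ cSĝ []) (const≈ cSĝ []))) w

related-λ*U : ∀ c → Allowed λ*U c → Related c
related-λ*U .cU U-U = U-related
related-λ*U .c⋆̂ U-⋆̂ = ⋆̂-related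
related-λ*U .cT U-T = T-related
related-λ*U .cPî U-Pî = Pî-related
related-λ*U .cSĝ U-Sĝ = Sĝ-related

module AbstractionλU = Fundamental (Allowed λ*U) related-λ*U

-- Part 11: reflected terms.  On the image of reflection the translation
-- str agrees with Defs' star, once the environment of variable indices
-- is turned into an environment of variables.
varEnv : Env → TmEnv
varEnv ρ k = var (proj₁ (ρ k)) , var (proj₁ (proj₂ (ρ k))) , var (proj₂ (proj₂ (ρ k)))

c₀≡c0 : ∀ ρ t → c₀ ρ t ≡ c0 (varEnv ρ) t
c₀≡c0 ρ t = ren-as-sub _ t
c₁≡c1 : ∀ ρ t → c₁ ρ t ≡ c1 (varEnv ρ) t
c₁≡c1 ρ t = ren-as-sub _ t

codeView-reflect-app : ∀ f a → codeView (app (reflect f) a) ≡ notHat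
codeView-reflect-app (var x) a = refl
codeView-reflect-app ⋆ a = refl
codeView-reflect-app (Pi f f₁) a = refl
codeView-reflect-app (Sg f f₁) a = refl
codeView-reflect-app (lam f f₁) a = refl
codeView-reflect-app (app f f₁) a = refl
codeView-reflect-app (pair f f₁) a = refl
codeView-reflect-app (fst f) a = refl
codeView-reflect-app (snd f) a = refl

-- Hence str takes its generic application case on reflected terms.
codeView-reflect : ∀ f → codeView (reflect f) ≡ notHat
codeView-reflect (var x) = refl
codeView-reflect ⋆ = refl
codeView-reflect (Pi f f₁) = refl
codeView-reflect (Sg f f₁) = refl
codeView-reflect (lam f f₁) = refl
codeView-reflect (app f a) = codeView-reflect-app f (reflect a)
codeView-reflect (pair f f₁) = refl
codeView-reflect (fst f) = refl
codeView-reflect (snd f) = refl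

extE-varEnv : ∀ ρ → varEnv (extE ρ) ≈E ext3 (varEnv ρ)
extE-varEnv ρ zero = refl
extE-varEnv ρ (suc k) = refl

triLam≡str : ∀ ρ A b → star ρ A ≡ str (varEnv ρ) (reflect A) → star (extE ρ) b ≡ str (varEnv (extE ρ)) (reflect b) →
  triLam ρ (reflect A) (star ρ A) (star (extE ρ) b) ≡ str (varEnv ρ) (lam (T· (reflect A)) (reflect b))
triLam≡str ρ A b eA eb = cong₂ lam (cong T· (c₀≡c0 ρ (reflect A))) (cong₂ lam (cong (λ z → T· (shift 1 z)) (c₁≡c1 ρ (reflect A)))
  (cong₂ lam (cong-Rel (trans (cong (shift 2) (c₀≡c0 ρ (reflect A))) (c0-sh 2 (varEnv ρ) (reflect A)))
                       (trans (cong (shift 2) (c₁≡c1 ρ (reflect A))) (c1-sh 2 (varEnv ρ) (reflect A)))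
                       (trans (cong (shift 2) eA) (str-sh 2 (varEnv ρ) (reflect A))) refl refl)
             (trans eb (str-cong (extE-varEnv ρ) (reflect b)))))

star≡str : ∀ ρ M → star ρ M ≡ str (varEnv ρ) (reflect M)
star≡str ρ (var k) = refl
star≡str ρ ⋆ = refl
star≡str ρ (Pi A B) = cong₂ app (cong₂ app (cong₂ app (cong₂ app (cong₂ app (cong₂ app refl (c₀≡c0 ρ _)) (c₁≡c1 ρ _)) (c₀≡c0 ρ _)) (c₁≡c1 ρ _)) (star≡str ρ A))
  (triLam≡str ρ A B (star≡str ρ A) (star≡str (extE ρ) B))
star≡str ρ (Sg A B) = cong₂ app (cong₂ app (cong₂ app (cong₂ app (cong₂ app (cong₂ app refl (c₀≡c0 ρ _)) (c₁≡c1 ρ _)) (c₀≡c0 ρ _)) (c₁≡c1 ρ _)) (star≡str ρ A))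
  (triLam≡str ρ A B (star≡str ρ A) (star≡str (extE ρ) B))
star≡str ρ (lam A b) = triLam≡str ρ A b (star≡str ρ A) (star≡str (extE ρ) b)
star≡str ρ (app f a) rewrite codeView-reflect f =
  cong₂ app (cong₂ app (cong₂ app (star≡str ρ f) (c₀≡c0 ρ _)) (c₁≡c1 ρ _)) (star≡str ρ a)
star≡str ρ (pair a b) = cong₂ pair (star≡str ρ a) (star≡str ρ b)
star≡str ρ (fst p) = cong fst (star≡str ρ p)
star≡str ρ (snd p) = cong snd (star≡str ρ p)

module AnnotatedλU = Annotated (Allowed λ*U)
open Annotate using (annotate)
open AbstractionλU using (abstraction; c0-typed; c1-typed)

embed≈ : ∀ {Γ t C} → Γ ⊢[ λ*U ] t ∶ C → Γ ⊢ t ∶ C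
embed≈ ax = ax
embed≈ (const c x) = const c (E-all c)
embed≈ (var0 D) = var0 (embed≈ D)
embed≈ (weak D E) = weak (embed≈ D) (embed≈ E)
embed≈ (piF D E) = piF (embed≈ D) (embed≈ E)
embed≈ (sgF D E) = sgF (embed≈ D) (embed≈ E)
embed≈ (abs D E) = abs (embed≈ D) (embed≈ E)
embed≈ (appl D E) = appl (embed≈ D) (embed≈ E)
embed≈ (pairI D E F) = pairI (embed≈ D) (embed≈ E) (embed≈ F)
embed≈ (proj₁I D) = proj₁I (embed≈ D)
embed≈ (proj₂I D) = proj₂I (embed≈ D)
embed≈ (conv D c E) = conv (embed≈ D) (Conv-emb c) (embed≈ E)

∋-suffix : ∀ {G k B} R → G ∋ k ∶ B → (G ++ R) ∋ k ∶ B
∋-suffix R here = here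
∋-suffix R (there x) = there (∋-suffix R x)

∋-prefix : ∀ {G k B} P → G ∋ k ∶ B → (P ++ G) ∋ (length P + k) ∶ shift (length P) B
∋-prefix {B = B} [] x = ≡subst (_ ∋ _ ∶_) (sym (shift-zero B)) x
∋-prefix {B = B} (X ∷ P) x = ≡subst (_ ∋ _ ∶_) (shift-shift 1 (length P) B) (there (∋-prefix P x))

annotated-weaken≈ : ∀ {G R t C} → AnnotatedλU._⊢v_∶_ G t C → WF≈ (G ++ R) → (G ++ R) ⊢ t ∶ C
annotated-weaken≈ {G} {R} {t} {C} D w =
  reterm (subst-id t) (retype (subst-id C)
    (AnnotatedλU.subst-typed≈ D (w , λ x → retype (sym (subst-id _)) (var-typed w (∋-suffix R x)))))

ctx-wf≈ : ∀ {Γ} → UCtx Γ → WF≈ (ctx Γ)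
ctx-wf≈ [] = []
ctx-wf≈ (D ∷ u) = T-typed (ctx-wf≈ u) (embed≈ D) ∷ ctx-wf≈ u

ctx++-wf≈ : ∀ {R} Γ' → UCtx Γ' → WF≈ R → WF≈ (ctx Γ' ++ R)
ctx++-wf≈ [] u w = w
ctx++-wf≈ (A ∷ Γ'') (D ∷ u) w = T-typed w' (annotated-weaken≈ (annotate D) w') ∷ w'
  where w' = ctx++-wf≈ Γ'' u w

UCtx-suffix : ∀ pre {Γ'} → UCtx (pre ++ Γ') → UCtx Γ'
UCtx-suffix [] u = u
UCtx-suffix (A ∷ pre) (D ∷ u) = UCtx-suffix pre u

-- Priming is the identity on de Bruijn terms: the primed block of Γ* is ctx Γ.
primed-ctx : ∀ n Γ → map (λ A → T· (c₁ (primeEnv n) (reflect A))) Γ ≡ ctx Γ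
primed-ctx n [] = refl
primed-ctx n (A ∷ Γ) = cong₂ _∷_ (cong T· (rename-id (reflect A))) (primed-ctx n Γ)

ctx-var : ∀ pre A Γ'' → ctx (pre ++ A ∷ Γ'') ∋ length pre ∶ shift (suc (length pre)) (T· (reflect A))
ctx-var [] A Γ'' = here
ctx-var (B ∷ pre) A Γ'' =
  ≡subst (ctx (B ∷ pre ++ A ∷ Γ'') ∋ suc (length pre) ∶_) (shift-shift 1 (suc (length pre)) (T· (reflect A)))
    (there (ctx-var pre A Γ''))

-- Index arithmetic for Γ* = (x₁*..xₙ*), (x₁'..xₙ'), (x₁..xₙ), when Γ = pre ++ A ∷ Γ''
-- with p = length pre and m = length Γ''.  Seen from the entry for A
-- (below the m entries x*), the unprimed x_A sits at m + n + p = 2n - 1,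
-- and the primed x_A' at m + p = n - 1.
module IndexArithmetic (n p m : ℕ) (n≡ : n ≡ p + suc m) where

  open +-*-Solver using (solve; _:+_; _:*_; con; _:=_)

  unprimed-index : 2 * n ∸ 1 ≡ m + n + p
  unprimed-index rewrite n≡ | +-suc p m =
    solve 2 (λ p m → (p :+ m) :+ (con 1 :+ ((p :+ m) :+ con 0)) := m :+ (con 1 :+ (p :+ m)) :+ p) refl p m

  unprimed-depth : m + n + suc p ≡ 2 * n
  unprimed-depth rewrite n≡ | +-suc p m =
    solve 2 (λ p m → m :+ (con 1 :+ (p :+ m)) :+ (con 1 :+ p) := con 2 :* (con 1 :+ (p :+ m))) refl p m

  primed-index : n ∸ 1 ≡ m + p
  primed-index rewrite n≡ | +-suc p m = +-comm p m

  primed-depth : m + suc p ≡ n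
  primed-depth rewrite n≡ = trans (+-suc m p) (trans (cong suc (+-comm m p)) (sym (+-suc p m)))

  unprimed-index-suc : suc (2 * n ∸ 1) ≡ 2 * n + 0
  unprimed-index-suc rewrite n≡ | +-suc p m =
    solve 2 (λ p m → con 1 :+ ((p :+ m) :+ (con 1 :+ ((p :+ m) :+ con 0))) := con 2 :* (con 1 :+ (p :+ m)) :+ con 0) refl p m

  primed-index-suc : suc (n ∸ 1) ≡ n + 0
  primed-index-suc rewrite n≡ | +-suc p m = cong suc (sym (+-comm (p + m) 0))

-- The environment x ↦ (x , x' , x*) is
-- typed from ctx Γ into Γ*; it is built entry by entry, the relational
-- entries x* being added on top of the two blocks ctx Γ ++ ctx Γ.
module StarContext (Γ : List Src) (uΓ : UCtx Γ) where

  n : ℕ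
  n = length Γ

  ρ : TmEnv
  ρ = varEnv (envΓ n)

  blocks : Ctx
  blocks = ctx Γ ++ ctx Γ

  relEntry : Src → Tm
  relEntry A = Rel· (c₀ (envΓ n) (reflect A)) (c₁ (envΓ n) (reflect A)) (star (envΓ n) A) (var (2 * n ∸ 1)) (var (n ∸ 1))

  partial : List Src → Ctx
  partial Γ' = map relEntry Γ' ++ blocks

  relEntry≡R : ∀ A → relEntry A ≡ R ρ (T· (reflect A)) (var (2 * n ∸ 1)) (var (n ∸ 1))
  relEntry≡R A = cong-Rel (c₀≡c0 (envΓ n) (reflect A)) (c₁≡c1 (envΓ n) (reflect A)) (star≡str (envΓ n) A) refl refl

  ρ-shift : sh 1 ρ ≈E (ρ ∘ suc)
  ρ-shift k = cong3 (cong var (sym (+-suc (2 * n) k))) (cong var (sym (+-suc n k))) refl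

  unprimed-var-typed : ∀ pre A Γ'' → pre ++ A ∷ Γ'' ≡ Γ → WF≈ (partial Γ'') →
    partial Γ'' ⊢ var (2 * n ∸ 1) ∶ T· (c0 ρ (reflect A))
  unprimed-var-typed pre A Γ'' eq w =
    reterm (cong var (sym unprimed-index)) (retype type≡ (var-typed w (≡subst₃ member)))
    where
    open IndexArithmetic n (length pre) (length Γ'') (trans (cong length (sym eq)) (length-++ pre))
    P = map relEntry Γ'' ++ ctx Γ
    lenP : length P ≡ length Γ'' + n
    lenP = trans (length-++ (map relEntry Γ'')) (cong₂ _+_ (length-map relEntry Γ'') (length-map _ Γ))
    X = shift (suc (length pre)) (T· (reflect A))
    member : (P ++ ctx Γ) ∋ length P + length pre ∶ shift (length P) X
    member = ∋-prefix P (≡subst (λ G → G ∋ _ ∶ _) (cong ctx eq) (ctx-var pre A Γ''))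
    ≡subst₃ : (P ++ ctx Γ) ∋ length P + length pre ∶ shift (length P) X →
              partial Γ'' ∋ length Γ'' + n + length pre ∶ shift (length Γ'' + n) X
    ≡subst₃ x rewrite ++-assoc (map relEntry Γ'') (ctx Γ) (ctx Γ) | lenP = x
    type≡ : shift (length Γ'' + n) X ≡ T· (c0 ρ (reflect A))
    type≡ = trans (shift-shift (length Γ'' + n) _ _)
              (cong T· (trans (cong (λ z → shift z (reflect A)) unprimed-depth) (ren-as-sub _ (reflect A))))

  primed-var-typed : ∀ pre A Γ'' → pre ++ A ∷ Γ'' ≡ Γ → WF≈ (partial Γ'') →
    partial Γ'' ⊢ var (n ∸ 1) ∶ T· (c1 ρ (reflect A))
  primed-var-typed pre A Γ'' eq w =
    reterm (cong var (sym primed-index)) (retype type≡ (var-typed w (≡subst₂ member)))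
    where
    open IndexArithmetic n (length pre) (length Γ'') (trans (cong length (sym eq)) (length-++ pre))
    X = shift (suc (length pre)) (T· (reflect A))
    member : partial Γ'' ∋ length (map relEntry Γ'') + length pre ∶ shift (length (map relEntry Γ'')) X
    member = ∋-prefix (map relEntry Γ'') (∋-suffix (ctx Γ) (≡subst (λ G → G ∋ _ ∶ _) (cong ctx eq) (ctx-var pre A Γ'')))
    ≡subst₂ : partial Γ'' ∋ length (map relEntry Γ'') + length pre ∶ shift (length (map relEntry Γ'')) X →
              partial Γ'' ∋ length Γ'' + length pre ∶ shift (length Γ'') X
    ≡subst₂ x rewrite length-map relEntry Γ'' = x
    type≡ : shift (length Γ'') X ≡ T· (c1 ρ (reflect A))
    type≡ = trans (shift-shift (length Γ'') _ _)
              (cong T· (trans (cong (λ z → shift z (reflect A)) primed-depth) (ren-as-sub _ (reflect A))))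

  starCtx-env-step : ∀ pre A Γ'' → pre ++ A ∷ Γ'' ≡ Γ → ctx Γ'' ⊢[ λ*U ] reflect A ∶ U· →
    EnvTyped (partial Γ'') ρ (ctx Γ'') → EnvTyped (partial (A ∷ Γ'')) ρ (ctx (A ∷ Γ''))
  starCtx-env-step pre A Γ'' eq DA ok =
    EnvTyped-cong (λ { zero → refl ; (suc k) → refl }) (EnvTyped-cons ok⁺ x-typed x'-typed x*-typed)
    where
    open IndexArithmetic n (length pre) (length Γ'') (trans (cong length (sym eq)) (length-++ pre))
    w = proj₁ ok
    D = annotate DA
    A* = conv (abstraction D ok) (R-U ρ _ _) (Eq-typed w (c0-typed D ok) (c1-typed D ok))
    entry-typed : partial Γ'' ⊢ relEntry A ∶ ⋆
    entry-typed = reterm (sym (relEntry≡R A))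
      (Rel-typed w (c0-typed D ok) (c1-typed D ok) A* (unprimed-var-typed pre A Γ'' eq w) (primed-var-typed pre A Γ'' eq w))
    ok⁺ : EnvTyped (relEntry A ∷ partial Γ'') (ρ ∘ suc) (ctx Γ'')
    ok⁺ = EnvTyped-cong ρ-shift (EnvTyped-weak ok entry-typed)
    shift-c0 = trans (c0-sh 1 ρ (reflect A)) (c0-cong ρ-shift (reflect A))
    shift-c1 = trans (c1-sh 1 ρ (reflect A)) (c1-cong ρ-shift (reflect A))
    shift-str = trans (str-sh 1 ρ (reflect A)) (str-cong ρ-shift (reflect A))
    x-typed : (relEntry A ∷ partial Γ'') ⊢ var (2 * n + 0) ∶ c0 (ρ ∘ suc) (T· (reflect A))
    x-typed = reterm (cong var unprimed-index-suc) (retype (cong T· shift-c0) (weak (unprimed-var-typed pre A Γ'' eq w) entry-typed))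
    x'-typed : (relEntry A ∷ partial Γ'') ⊢ var (n + 0) ∶ c1 (ρ ∘ suc) (T· (reflect A))
    x'-typed = reterm (cong var primed-index-suc) (retype (cong T· shift-c1) (weak (primed-var-typed pre A Γ'' eq w) entry-typed))
    x*-typed : (relEntry A ∷ partial Γ'') ⊢ var 0 ∶ R (ρ ∘ suc) (T· (reflect A)) (var (2 * n + 0)) (var (n + 0))
    x*-typed = retype (trans (cong (shift 1) (relEntry≡R A))
                 (cong-Rel shift-c0 shift-c1 shift-str (cong var unprimed-index-suc) (cong var primed-index-suc)))
               (var0 entry-typed)

  starCtx-env : ∀ pre Γ' → pre ++ Γ' ≡ Γ → EnvTyped (partial Γ') ρ (ctx Γ')
  starCtx-env pre [] eq = w , λ ()
    where w = ctx++-wf≈ Γ uΓ (ctx-wf≈ uΓ)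
  starCtx-env pre (A ∷ Γ'') eq with UCtx-suffix pre (≡subst UCtx (sym eq) uΓ)
  ... | DA ∷ _ = starCtx-env-step pre A Γ'' eq DA
                   (starCtx-env (pre ++ A ∷ []) Γ'' (trans (++-assoc pre (A ∷ []) Γ'') eq))

  starCtx-typed-env : EnvTyped (starCtx Γ) ρ (ctx Γ)
  starCtx-typed-env = ≡subst (λ G → EnvTyped G ρ (ctx Γ))
    (cong (map relEntry Γ ++_) (cong (_++ ctx Γ) (sym (primed-ctx n Γ))))
    (starCtx-env [] Γ refl)

open StarContext using (starCtx-typed-env)

mainTheorem8 : (Γ : List Src) (A M : Src) →
    UCtx Γ →
    ctx Γ ⊢[ λ*U ] reflect A ∶ U· →
    ctx Γ ⊢[ λ*U ] reflect M ∶ T· (reflect A) →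
    starCtx Γ ⊢[ λ*U≈ ] star (envΓ (length Γ)) M ∶
    Rel· (c₀ (envΓ (length Γ)) (reflect A)) (c₁ (envΓ (length Γ)) (reflect A))
    (star (envΓ (length Γ)) A)
    (c₀ (envΓ (length Γ)) (reflect M)) (c₁ (envΓ (length Γ)) (reflect M))
mainTheorem8 Γ A M uΓ _ DM =
  reterm (sym (star≡str e M))
    (retype (sym (cong-Rel (c₀≡c0 e (reflect A)) (c₁≡c1 e (reflect A)) (star≡str e A)
                           (c₀≡c0 e (reflect M)) (c₁≡c1 e (reflect M))))
      (abstraction (annotate DM) (starCtx-typed-env Γ uΓ)))
  where
  e = envΓ (length Γ)
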